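{- Let $M$ be a fixed deterministic multitape Turing machine, $U$ a fixed universal prefix Turing machine, and $A$ a fixed Turing machine implementing the Algebraic Replay Engine as described in the context. There exists a constant $c' \ge 1$, depending only on $M$, $U$ and $A$, such that for every input, every time bound $t$, every block size $b$, and every block-respecting interval $[L,R]$ of the corresponding run of $M$, the history $H_{[L,R]}=(C_L,\dots,C_R)$, encoded as a single binary string, satisfies \[ K\bigl(H_{[L,R]} \,\big|\, \sigma([L,R])\bigr) \le c'. \] In particular, for the full run interval $[0,t]$, the history $H_t=(C_0,\dots,C_t)$ satisfies $K(H_t \mid \sigma([0,t])) = O(1)$.
   Context: $M=(Q,\Sigma,\Gamma,\delta,q_0,q_{\mathrm{acc}},q_{\mathrm{rej}})$ is a deterministic $k$-tape Turing machine in which each head moves by at most one cell per step; a length-$t$ run is the sequence of configurations $C_0,\dots,C_t$ (tape contents, head positions, control state). For a block size $b$, the time-blocks are $I_k=[(k-1)b+1,\min\{kb,t\}]$, $k=1,\dots,\lceil t/b\rceil$. For a constant $c_{\mathrm{int}}\ge 1$, a run is block-respecting with parameters $(b,c_{\mathrm{int}})$ if for every block $I_k$ all interaction between the computation inside $I_k$ and the rest of the run passes through an interface window of at most $c_{\mathrm{int}} b$ work-tape cells at the temporal boundaries of $I_k$. A block-respecting interval is a time interval $[L,R]$ that is a union of whole consecutive blocks of such a run (the full run interval $[0,t]$ is treated as one). Its interval summary is $\sigma([L,R])=(q_{\mathrm{in}},q_{\mathrm{out}},\vec h_{\mathrm{in}},\vec h_{\mathrm{out}},W_{\mathrm{interface}})$: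 the control states and head positions at times $L$ and $R$ and the contents of the interface window; it is encoded as a binary string that additionally contains a self-delimiting encoding of the endpoints $(L,R)$. The Algebraic Replay Engine (taken as given) is a fixed Turing machine $A$ such that for every block-respecting interval $[L,R]$ and every $\tau\in[L,R]$, $A$ on input $(\sigma([L,R]),\tau)$ outputs $C_\tau$ using $O(b)$ work-tape cells. Configurations, summaries, time indices and finite sequences of configurations are encoded as binary strings by fixed computable injective self-delimiting encodings; $K(x\mid y)=\min\{|p| : U(p,y)=x\}$ is prefix-free conditional Kolmogorov complexity with respect to $U$ of these encodings. -}

module Defs where

open import Data.Nat using (ℕ; zero; suc; _+_; _*_; _∸_; _≤_; _<_; _/_)
open import Data.Nat.Binary.Base using (ℕᵇ; 2[1+_]; 1+[2_]) renaming (zero to zeroᵇ; fromℕ to toℕᵇ)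
open import Data.Fin using (Fin; toℕ; _≟_) renaming (zero to fz; suc to fs)
open import Data.Bool using (Bool; true; false)
open import Data.List using (List; []; _∷_; _++_; length; concatMap; concat)
open import Data.Vec as Vec using (Vec)
open import Data.Product using (Σ; _×_; _,_; ∃; ∃-syntax)
open import Data.Sum using (_⊎_)
open import Relation.Nullary using (yes; no)
open import Relation.Binary.PropositionalEquality using (_≡_)
open import Function.Bundles using (_⇔_)

-- A machine has  suc k  tapes (so at least one), states  Fin nQ  and tape
-- alphabet  Fin (3 + nΓ)  where symbol 0 is the blank and symbols 1, 2
-- are the input/output bits 0, 1.  Tapes are one-way infinite (cells
-- indexed by ℕ); each head moves by at most one cell per step (a left
-- move at cell 0 stays at cell 0).

data Move : Set where
  left stay right : Move

record TM : Set where
  field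
    k   : ℕ
    nQ  : ℕ
    nΓ  : ℕ
    δ   : Fin nQ → Vec (Fin (3 + nΓ)) (suc k) → Fin nQ × Vec (Fin (3 + nΓ) × Move) (suc k)
    q₀ qacc qrej : Fin nQ

module _ (M : TM) where
  open TM M

  Γ : Set
  Γ = Fin (3 + nΓ)

  -- A configuration: control state, the visited portion of every tape
  -- (cells beyond the list are blank), and the head positions.
  record Config : Set where
    constructor config
    field
      state : Fin nQ
      tapes : Vec (List Γ) (suc k)
      heads : Vec ℕ (suc k)

blank : ∀ {n} → Fin (3 + n)
blank = fz

bitSym : ∀ {n} → Bool → Fin (3 + n)
bitSym false = fs fz
bitSym true  = fs (fs fz)

readCell : ∀ {n} → List (Fin (3 + n)) → ℕ → Fin (3 + n)
readCell []       _       = blank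
readCell (x ∷ xs) zero    = x
readCell (x ∷ xs) (suc i) = readCell xs i

writeCell : ∀ {n} → List (Fin (3 + n)) → ℕ → Fin (3 + n) → List (Fin (3 + n))
writeCell []       zero    a = a ∷ []
writeCell []       (suc i) a = blank ∷ writeCell [] i a
writeCell (x ∷ xs) zero    a = a ∷ xs
writeCell (x ∷ xs) (suc i) a = x ∷ writeCell xs i a

moveHead : Move → ℕ → ℕ
moveHead left  zero    = zero
moveHead left  (suc h) = h
moveHead stay  h       = h
moveHead right h       = suc h

isHalting : (M : TM) → Fin (TM.nQ M) → Bool
isHalting M q with q ≟ TM.qacc M | q ≟ TM.qrej M
... | yes _ | _     = true
... | no _  | yes _ = true
... | no _  | no _  = false

Halted : (M : TM) → Config M → Set
Halted M C = isHalting M (Config.state C) ≡ true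

writeAt : ∀ {n} → List (Fin (3 + n)) × ℕ → Fin (3 + n) × Move → List (Fin (3 + n))
writeAt (t , h) (a , _) = writeCell t h a

moveAt : ∀ {n} → ℕ → Fin (3 + n) × Move → ℕ
moveAt h (_ , m) = moveHead m h

step : (M : TM) → Config M → Config M
step M (config q ts hs) with isHalting M q | TM.δ M q (Vec.zipWith readCell ts hs)
... | true  | _        = config q ts hs
... | false | (q' , as) =
  config q' (Vec.zipWith writeAt (Vec.zip ts hs) as) (Vec.zipWith moveAt hs as)

runFor : (M : TM) → Config M → ℕ → Config M
runFor M C zero    = C
runFor M C (suc n) = step M (runFor M C n)

loadInput : ∀ {n} → List (List Bool) → ℕ → List (Fin (3 + n))
loadInput []         _       = []
loadInput (w ∷ ws)   zero    = Data.List.map bitSym w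
  where import Data.List
loadInput (w ∷ ws)   (suc i) = loadInput ws i

initConfig : (M : TM) → List (List Bool) → Config M
initConfig M ws =
  config (TM.q₀ M) (Vec.tabulate (λ i → loadInput ws (toℕ i))) (Vec.replicate _ 0)

bitsOf : ∀ {n} → List (Fin (3 + n)) → List Bool
bitsOf [] = []
bitsOf (fz ∷ xs) = []
bitsOf (fs fz ∷ xs) = false ∷ bitsOf xs
bitsOf (fs (fs fz) ∷ xs) = true ∷ bitsOf xs
bitsOf (fs (fs (fs _)) ∷ xs) = []

output : (M : TM) → Config M → List Bool
output M C = bitsOf (Vec.head (Config.tapes C))

Outputs : TM → List (List Bool) → List Bool → Set
Outputs T ws x = ∃[ n ] (Halted T (runFor T (initConfig T ws) n)
                          × output T (runFor T (initConfig T ws) n) ≡ x)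

Outputs₂ : TM → List Bool → List Bool → List Bool → Set
Outputs₂ T p y x = Outputs T (p ∷ y ∷ []) x

HaltsOn₂ : TM → List Bool → List Bool → Set
HaltsOn₂ T p y = ∃[ x ] Outputs₂ T p y x

PrefixMachine : TM → Set
PrefixMachine T = ∀ y p q → HaltsOn₂ T p y → HaltsOn₂ T (p ++ q) y → q ≡ []

UniversalPrefix : TM → Set
UniversalPrefix U =
  PrefixMachine U ×
  (∀ T → PrefixMachine T → ∃[ c ] ∀ p y x → (Outputs₂ T p y x ⇔ Outputs₂ U (c ++ p) y x))

-- K(x | y) ≤ c, i.e.  min { |p| : U(p,y) = x } ≤ c, unfolded.
K≤ : (U : TM) → (x y : List Bool) → ℕ → Set
K≤ U x y c = ∃[ p ] (length p ≤ c × Outputs₂ U p y x)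

bitsᵇ : ℕᵇ → List Bool
bitsᵇ zeroᵇ     = []
bitsᵇ 2[1+ n ]  = false ∷ bitsᵇ n
bitsᵇ 1+[2 n ]  = true ∷ bitsᵇ n

selfDelim : List Bool → List Bool
selfDelim bs = concatMap (λ b → b ∷ b ∷ []) bs ++ (false ∷ true ∷ [])

encℕ : ℕ → List Bool
encℕ n = selfDelim (bitsᵇ (toℕᵇ n))

encList : {A : Set} → (A → List Bool) → List A → List Bool
encList f xs = encℕ (length xs) ++ concatMap f xs

encFin : ∀ {n} → Fin n → List Bool
encFin i = encℕ (toℕ i)

encConfig : (M : TM) → Config M → List Bool
encConfig M (config q ts hs) =
  encFin q ++ concat (Vec.toList (Vec.zipWith (λ t h → encℕ h ++ encList encFin t) ts hs))

encHistory : (M : TM) → List (Config M) → List Bool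
encHistory M = encList (encConfig M)

configAt : (M : TM) → List Bool → ℕ → Config M
configAt M x τ = runFor M (initConfig M (x ∷ [])) τ

historyFrom : (M : TM) → List Bool → ℕ → ℕ → List (Config M)
historyFrom M x L zero    = configAt M x L ∷ []
historyFrom M x L (suc n) = configAt M x L ∷ historyFrom M x (suc L) n

history : (M : TM) → List Bool → ℕ → ℕ → List (Config M)
history M x L R = historyFrom M x L (R ∸ L)

ceilDiv : ℕ → ℕ → ℕ
ceilDiv t zero     = 0
ceilDiv t (suc b') = (t + b') / suc b'

minℕ : ℕ → ℕ → ℕ
minℕ = Data.Nat._⊓_
  where import Data.Nat

-- [L,R] is the full interval [0,t], or the union of blocks I_i ∪ … ∪ I_j
-- with 1 ≤ i ≤ j ≤ ⌈t/b⌉, where I_k = [(k-1)b+1, min(kb,t)].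
BlockInterval : (t b L R : ℕ) → Set
BlockInterval t b L R =
  (L ≡ 0 × R ≡ t) ⊎
  (∃[ i ] ∃[ j ] (1 ≤ i × i ≤ j × j ≤ ceilDiv t b
                  × L ≡ (i ∸ 1) * b + 1 × R ≡ minℕ (j * b) t))

-- A cell of the interface window: (tape, position, symbol).
Cell : TM → Set
Cell M = Fin (suc (TM.k M)) × ℕ × Γ M

encCell : (M : TM) → Cell M → List Bool
encCell M (i , p , s) = encFin i ++ encℕ p ++ encFin s

-- The notion of a block-respecting run with parameters (b, c_int) and the
-- interface window of an interval (left abstract).
record BlockStructure (M : TM) (cint : ℕ) : Set₁ where
  field
    BlockRespecting : (x : List Bool) (t b : ℕ) → Set
    window : (x : List Bool) (t b L R : ℕ) → List (Cell M)
    window-size : ∀ x t b L R → BlockRespecting x t b → BlockInterval t b L R →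
                  length (window x t b L R) ≤ cint * b

-- Encoding of σ([L,R]) = (q_in, q_out, h_in, h_out, W_interface) together
-- with a self-delimiting encoding of (L, R).
encSummary : (M : TM) {cint : ℕ} → BlockStructure M cint →
             (x : List Bool) (t b L R : ℕ) → List Bool
encSummary M S x t b L R =
  encℕ L ++ encℕ R
  ++ encFin (Config.state (configAt M x L)) ++ encFin (Config.state (configAt M x R))
  ++ encList encℕ (Vec.toList (Config.heads (configAt M x L)))
  ++ encList encℕ (Vec.toList (Config.heads (configAt M x R)))
  ++ encList (encCell M) (BlockStructure.window S x t b L R)

-- A implements the Algebraic Replay Engine for M (correctness clause):
-- on input (σ([L,R]), τ) it outputs C_τ, for every block-respecting interval.
ReplayEngine : (M : TM) {cint : ℕ} → BlockStructure M cint → TM → Set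
ReplayEngine M S A =
  ∀ x t b L R τ → 1 ≤ b → BlockStructure.BlockRespecting S x t b → BlockInterval t b L R →
  L ≤ τ → τ ≤ R →
  Outputs₂ A (encSummary M S x t b L R) (encℕ τ) (encConfig M (configAt M x τ))

{-# OPTIONS --safe #-}
-- Let T be the machine that, given the empty program and a summary σ of
-- [L, R], reads L and R off σ and, for τ = L, …, R in turn, runs the replay
-- engine A on (σ, τ) and appends its output C_τ to a buffer while counting the
-- rounds; at the end it writes the count R - L + 1 followed by the buffer,
-- which is exactly encHistory (C_L, …, C_R).  T halts only on the empty
-- program, so it is a prefix machine, and U simulates it behind a fixed prefix
-- c_T; hence K(H | σ) ≤ |c_T|, whatever the input, t, b, L and R.
--
-- Every work tape carries a mark on
-- cell 0, so that heads can be rewound between phases, and a loop invariant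
-- records what each tape holds at the start of a round.
module Submission where

open import Defs
open import Data.Nat as N using (ℕ; zero; suc; _+_; _*_; _∸_; _≤_; _<_; _≡ᵇ_; z≤n; s≤s; pred; _/_)
open import Data.Nat.Properties as NP using (≤-refl; ≤-trans; +-suc; +-identityʳ; n≤1+n; pred-mono-≤; ≤-antisym; +-assoc; m≤m+n; m≤n+m; m+[n∸m]≡n; +-cancelˡ-≡; +-monoʳ-≤)
open import Data.Fin as F using (Fin; toℕ; _↑ˡ_; _↑ʳ_; splitAt; combine; remQuot; #_) renaming (zero to fz; suc to fs)
open import Data.Fin.Properties as FP using (splitAt-↑ˡ; splitAt-↑ʳ; remQuot-combine)
open import Data.Bool using (Bool; true; false; if_then_else_; _∧_; _∨_; not)
open import Data.Maybe using (Maybe; just; nothing)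
open import Data.List as L using (List; []; _∷_; _++_; length; concatMap)
open import Data.Vec as V using (Vec; lookup; tabulate)
open import Data.Vec.Properties as VP using (lookup∘tabulate; tabulate-cong; lookup-zipWith; lookup-map; tabulate∘lookup; lookup-zip; lookup-replicate)
open import Data.Product using (_×_; _,_; proj₁; proj₂; ∃; ∃-syntax)
open import Data.Sum using (_⊎_; inj₁; inj₂; [_,_]′)
open import Relation.Binary.PropositionalEquality
open import Relation.Nullary using (yes; no; does; ¬_)
open import Data.Unit using (⊤; tt)
open import Data.Empty using (⊥; ⊥-elim)
open import Data.Nat.Binary.Base as B using (2[1+_]; 1+[2_])
open import Data.Nat.Binary.Properties as BP using (fromℕ≡fromℕ'; toℕ-fromℕ)
open import Data.List.Properties as LP using (++-assoc; length-++; ++-identityʳ; ∷-injective)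
open import Data.Nat.DivMod using (m/n*n≤m)
open import Function.Bundles using (Equivalence)

-- Runs of Turing machines

stepResult : (M : TM) → Bool → Fin (TM.nQ M) × Vec (Γ M × Move) (suc (TM.k M)) →
             Fin (TM.nQ M) → Vec (List (Γ M)) (suc (TM.k M)) → Vec ℕ (suc (TM.k M)) → Config M
stepResult M true  r q ts hs = config q ts hs
stepResult M false r q ts hs =
  config (proj₁ r) (V.zipWith writeAt (V.zip ts hs) (proj₂ r)) (V.zipWith moveAt hs (proj₂ r))

step-unfold : ∀ M q ts hs →
  step M (config q ts hs) ≡ stepResult M (isHalting M q) (TM.δ M q (V.zipWith readCell ts hs)) q ts hs
step-unfold M q ts hs with isHalting M q | TM.δ M q (V.zipWith readCell ts hs)
... | true  | _ = refl
... | false | _ = refl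

step-halted : ∀ M C → Halted M C → step M C ≡ C
step-halted M (config q ts hs) h =
  trans (step-unfold M q ts hs) (cong (λ b → stepResult M b (TM.δ M q (V.zipWith readCell ts hs)) q ts hs) h)

runFrom : (M : TM) → Config M → ℕ → Config M
runFrom M C zero    = C
runFrom M C (suc n) = runFrom M (step M C) n

runFor-step : ∀ M C n → runFor M (step M C) n ≡ step M (runFor M C n)
runFor-step M C zero    = refl
runFor-step M C (suc n) = cong (step M) (runFor-step M C n)

runFrom≡runFor : ∀ M C n → runFrom M C n ≡ runFor M C n
runFrom≡runFor M C zero    = refl
runFrom≡runFor M C (suc n) = trans (runFrom≡runFor M (step M C) n) (runFor-step M C n)

runFrom-+ : ∀ M C a b → runFrom M C (a + b) ≡ runFrom M (runFrom M C a) b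
runFrom-+ M C zero    b = refl
runFrom-+ M C (suc a) b = runFrom-+ M (step M C) a b

runFrom-halted : ∀ M C k → Halted M C → runFrom M C k ≡ C
runFrom-halted M C zero    h = refl
runFrom-halted M C (suc k) h = trans (cong (λ C′ → runFrom M C′ k) (step-halted M C h)) (runFrom-halted M C k h)

LeastTrue : (ℕ → Bool) → ℕ → Set
LeastTrue P m = P m ≡ true × (∀ k → k < m → P k ≡ false)

first-true-below : (P : ℕ → Bool) → ∀ n → (∀ k → k < n → P k ≡ false) ⊎ (∃[ m ] (m < n × LeastTrue P m))
first-true-below P zero = inj₁ (λ k ())
first-true-below P (suc n) with first-true-below P n
... | inj₂ (m , m<n , least) = inj₂ (m , NP.m<n⇒m<1+n m<n , least)
... | inj₁ below with P n in eq
...   | true  = inj₂ (n , ≤-refl , eq , below)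
...   | false = inj₁ λ k k<1+n → [ below k , (λ { refl → eq }) ]′ (NP.m<1+n⇒m<n∨m≡n k<1+n)

opaque
  least-true : (P : ℕ → Bool) → ∀ n → P n ≡ true → ∃[ m ] (m ≤ n × LeastTrue P m)
  least-true P n Pn with first-true-below P (suc n)
  ... | inj₁ below = ⊥-elim (true≢false (trans (sym Pn) (below n ≤-refl)))
    where true≢false : true ≡ false → ⊥
          true≢false ()
  ... | inj₂ (m , s≤s m≤n , least) = m , m≤n , least

readCell-writeCell : ∀ {n} (l : List (Fin (3 + n))) h a i →
  readCell (writeCell l h a) i ≡ (if i ≡ᵇ h then a else readCell l i)
readCell-writeCell []      zero    a zero    = refl
readCell-writeCell []      zero    a (suc i) = refl
readCell-writeCell []      (suc h) a zero    = refl
readCell-writeCell []      (suc h) a (suc i) = readCell-writeCell [] h a i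
readCell-writeCell (x ∷ l) zero    a zero    = refl
readCell-writeCell (x ∷ l) zero    a (suc i) = refl
readCell-writeCell (x ∷ l) (suc h) a zero    = refl
readCell-writeCell (x ∷ l) (suc h) a (suc i) = readCell-writeCell l h a i

isHalting-≟ : ∀ M q → TM.qacc M ≡ TM.qrej M → isHalting M q ≡ does (q F.≟ TM.qacc M)
isHalting-≟ M q acc≡rej with q F.≟ TM.qacc M | q F.≟ TM.qrej M
... | yes _   | _       = refl
... | no _    | no _    = refl
... | no ≢acc | yes ≡rej = ⊥-elim (≢acc (trans ≡rej (sym acc≡rej)))

head≡lookup-zero : ∀ {X : Set} {n} (v : Vec X (suc n)) → V.head v ≡ lookup v fz
head≡lookup-zero (x V.∷ v) = refl

allFin : ∀ n → (Fin n → Bool) → Bool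
allFin zero    f = true
allFin (suc n) f = f fz ∧ allFin n (λ j → f (fs j))

allFin-cong : ∀ n {f g : Fin n → Bool} → (∀ j → f j ≡ g j) → allFin n f ≡ allFin n g
allFin-cong zero e = refl
allFin-cong (suc n) e = cong₂ _∧_ (e fz) (allFin-cong n (λ j → e (fs j)))

allFin-sound : ∀ n (f : Fin n → Bool) → allFin n f ≡ true → ∀ j → f j ≡ true
allFin-sound (suc n) f all j with f fz in f0
allFin-sound (suc n) f all fz     | true = f0
allFin-sound (suc n) f all (fs j) | true = allFin-sound n (λ j → f (fs j)) all j
allFin-sound (suc n) f () j       | false

allFin-complete : ∀ n (f : Fin n → Bool) → (∀ j → f j ≡ true) → allFin n f ≡ true
allFin-complete zero f e = refl
allFin-complete (suc n) f e rewrite e fz = allFin-complete n (λ j → f (fs j)) (λ j → e (fs j))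

sumF : ∀ n → (Fin n → ℕ) → ℕ
sumF zero    f = 0
sumF (suc n) f = f fz + sumF n (λ j → f (fs j))

sumF-≥ : ∀ n f j → f j ≤ sumF n f
sumF-≥ (suc n) f fz     = m≤m+n (f fz) _
sumF-≥ (suc n) f (fs j) = ≤-trans (sumF-≥ n (λ j → f (fs j)) j) (m≤n+m _ (f fz))

-- Numerals, histories and block intervals

-- bitsᵇ writes n in bijective base 2, least significant digit first, with
-- digit 1 as true and digit 2 as false.
incBits : List Bool → List Bool
incBits []          = true ∷ []
incBits (true ∷ r)  = false ∷ r
incBits (false ∷ r) = true ∷ incBits r

bitsᵇ-suc : ∀ x → bitsᵇ (B.suc x) ≡ incBits (bitsᵇ x)
bitsᵇ-suc B.zero   = refl
bitsᵇ-suc 2[1+ x ] = cong (true ∷_) (bitsᵇ-suc x)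
bitsᵇ-suc 1+[2 x ] = refl

fromℕ-suc : ∀ n → B.fromℕ (suc n) ≡ B.suc (B.fromℕ n)
fromℕ-suc n = trans (fromℕ≡fromℕ' (suc n)) (cong B.suc (sym (fromℕ≡fromℕ' n)))

encℕ-suc : ∀ n → encℕ (suc n) ≡ selfDelim (incBits (bitsᵇ (B.fromℕ n)))
encℕ-suc n = cong selfDelim (trans (cong bitsᵇ (fromℕ-suc n)) (bitsᵇ-suc (B.fromℕ n)))

selfDelim-injective : ∀ xs ys → selfDelim xs ≡ selfDelim ys → xs ≡ ys
selfDelim-injective []           []           e = refl
selfDelim-injective []           (false ∷ ys) ()
selfDelim-injective []           (true ∷ ys)  ()
selfDelim-injective (false ∷ xs) []           ()
selfDelim-injective (true ∷ xs)  []           ()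
selfDelim-injective (x ∷ xs)     (y ∷ ys)     e with ∷-injective e
... | x≡y , e′ = cong₂ _∷_ x≡y (selfDelim-injective xs ys (proj₂ (∷-injective e′)))

bitsᵇ-injective : ∀ x y → bitsᵇ x ≡ bitsᵇ y → x ≡ y
bitsᵇ-injective B.zero   B.zero   e  = refl
bitsᵇ-injective 2[1+ x ] 2[1+ y ] e  = cong 2[1+_] (bitsᵇ-injective x y (proj₂ (∷-injective e)))
bitsᵇ-injective 1+[2 x ] 1+[2 y ] e  = cong 1+[2_] (bitsᵇ-injective x y (proj₂ (∷-injective e)))
bitsᵇ-injective B.zero   2[1+ y ] ()
bitsᵇ-injective B.zero   1+[2 y ] ()
bitsᵇ-injective 2[1+ x ] B.zero   ()
bitsᵇ-injective 2[1+ x ] 1+[2 y ] ()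
bitsᵇ-injective 1+[2 x ] B.zero   ()
bitsᵇ-injective 1+[2 x ] 2[1+ y ] ()

encℕ-injective : ∀ a b → encℕ a ≡ encℕ b → a ≡ b
encℕ-injective a b e = begin
  a                      ≡⟨ toℕ-fromℕ a ⟨
  B.toℕ (B.fromℕ a)      ≡⟨ cong B.toℕ (bitsᵇ-injective (B.fromℕ a) (B.fromℕ b) (selfDelim-injective _ _ e)) ⟩
  B.toℕ (B.fromℕ b)      ≡⟨ toℕ-fromℕ b ⟩
  b                      ∎
  where open ≡-Reasoning

outputsUpTo : (ℕ → List Bool) → ℕ → ℕ → List Bool
outputsUpTo out L zero    = []
outputsUpTo out L (suc d) = outputsUpTo out L d ++ out (L + d)

outputsUpTo-suc : ∀ out L m → outputsUpTo out L (suc m) ≡ out L ++ outputsUpTo out (suc L) m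
outputsUpTo-suc out L zero = trans (cong out (+-identityʳ L)) (sym (++-identityʳ (out L)))
outputsUpTo-suc out L (suc m) = begin
  outputsUpTo out L (suc m) ++ out (L + suc m)               ≡⟨ cong (_++ out (L + suc m)) (outputsUpTo-suc out L m) ⟩
  (out L ++ outputsUpTo out (suc L) m) ++ out (L + suc m)    ≡⟨ ++-assoc (out L) _ _ ⟩
  out L ++ outputsUpTo out (suc L) m ++ out (L + suc m)      ≡⟨ cong (λ k → out L ++ outputsUpTo out (suc L) m ++ out k) (+-suc L m) ⟩
  out L ++ outputsUpTo out (suc L) (suc m)                   ∎
  where open ≡-Reasoning

length-historyFrom : ∀ M x L n → length (historyFrom M x L n) ≡ suc n
length-historyFrom M x L zero    = refl
length-historyFrom M x L (suc n) = cong suc (length-historyFrom M x (suc L) n)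

concatMap-historyFrom : ∀ M x L n →
  concatMap (encConfig M) (historyFrom M x L n) ≡ outputsUpTo (λ τ → encConfig M (configAt M x τ)) L (suc n)
concatMap-historyFrom M x L zero =
  trans (++-identityʳ _) (cong (λ τ → encConfig M (configAt M x τ)) (sym (+-identityʳ L)))
concatMap-historyFrom M x L (suc n) =
  trans (cong (encConfig M (configAt M x L) ++_) (concatMap-historyFrom M x (suc L) n)) (sym (outputsUpTo-suc _ L (suc n)))

encHistory-history : ∀ M x L R →
  encHistory M (history M x L R) ≡
  encℕ (suc (R ∸ L)) ++ outputsUpTo (λ τ → encConfig M (configAt M x τ)) L (suc (R ∸ L))
encHistory-history M x L R =
  cong₂ _++_ (cong encℕ (length-historyFrom M x L (R ∸ L))) (concatMap-historyFrom M x L (R ∸ L))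

BlockInterval-≤ : ∀ t b L R → 1 ≤ b → BlockInterval t b L R → L ≤ R
BlockInterval-≤ t b L R b1 (inj₁ (refl , refl)) = z≤n
BlockInterval-≤ t b L R b1 (inj₂ (zero , j , () , _))
BlockInterval-≤ t b L R b1 (inj₂ (suc i' , zero , s≤s z≤n , () , _))
BlockInterval-≤ t (suc b') L R b1 (inj₂ (suc i' , suc j' , s≤s z≤n , s≤s i≤j , jc , refl , refl)) = NP.⊓-glb ha hb
  where
  b = suc b'
  a≤ : i' * b ≤ j' * b
  a≤ = NP.*-monoˡ-≤ b i≤j
  ha : i' * b + 1 ≤ b + j' * b
  ha = ≤-trans (NP.+-monoˡ-≤ 1 a≤) (subst (j' * b + 1 ≤_) (NP.+-comm (j' * b) b) (NP.+-monoʳ-≤ (j' * b) (s≤s z≤n)))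
  jb : suc j' * b ≤ t + b'
  jb = ≤-trans (NP.*-monoˡ-≤ b jc) (m/n*n≤m (t + b') b)
  h1 : suc (b' + i' * b) ≤ b' + t
  h1 = ≤-trans (s≤s (NP.+-monoʳ-≤ b' a≤)) (subst (suc (b' + j' * b) ≤_) (NP.+-comm t b') jb)
  h2 : b' + suc (i' * b) ≤ b' + t
  h2 = subst (_≤ b' + t) (sym (NP.+-suc b' (i' * b))) h1
  hb : i' * b + 1 ≤ t
  hb = subst (_≤ t) (NP.+-comm 1 (i' * b)) (NP.+-cancelˡ-≤ b' _ _ h2)

module HistoryMachine (A : TM) where

  kA = TM.k A
  nQA = TM.nQ A
  nΓA = TM.nΓ A
  ΓA = Fin (3 + nΓA)

  -- Tapes: O output, Y the summary σ (as loaded by initConfig), W a marked copy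
  -- of σ, T the current τ, R the bound R, N the round count, B the buffer,
  -- then the 1 + kA tapes of A.
  nTapes = 7 + suc kA

  tO tY tW tT tR tN tB : Fin nTapes
  tO = fz
  tY = fs fz
  tW = fs (fs fz)
  tT = fs (fs (fs fz))
  tR = fs (fs (fs (fs fz)))
  tN = fs (fs (fs (fs (fs fz))))
  tB = fs (fs (fs (fs (fs (fs fz)))))

  tA : Fin (suc kA) → Fin nTapes
  tA j = fs (fs (fs (fs (fs (fs (fs j))))))

  -- raw b is an input/output bit; cell a e is a symbol a of A, with e marking
  -- cell 0 so that heads can be rewound.
  data Sym : Set where
    □ : Sym
    raw : Bool → Sym
    cell : ΓA → Bool → Sym

  bool→fin2 : Bool → Fin 2
  bool→fin2 false = fz
  bool→fin2 true  = fs fz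

  fin2→bool : Fin 2 → Bool
  fin2→bool fz     = false
  fin2→bool (fs _) = true

  nΓT = (3 + nΓA) * 2

  encSym : Sym → Fin (3 + nΓT)
  encSym □           = fz
  encSym (raw false) = fs fz
  encSym (raw true)  = fs (fs fz)
  encSym (cell a e)  = fs (fs (fs (combine a (bool→fin2 e))))

  decSym : Fin (3 + nΓT) → Sym
  decSym fz               = □
  decSym (fs fz)          = raw false
  decSym (fs (fs fz))     = raw true
  decSym (fs (fs (fs c))) = cell (proj₁ (remQuot {3 + nΓA} 2 c)) (fin2→bool (proj₂ (remQuot {3 + nΓA} 2 c)))

  decSym-encSym : ∀ s → decSym (encSym s) ≡ s
  decSym-encSym □           = refl
  decSym-encSym (raw false) = refl
  decSym-encSym (raw true)  = refl
  decSym-encSym (cell a e)  =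
    trans (cong₂ cell (cong proj₁ split) (cong (λ p → fin2→bool (proj₂ p)) split)) (cong (cell a) (fin2→bool∘bool→fin2 e))
    where
    split = remQuot-combine {n = 3 + nΓA} {k = 2} a (bool→fin2 e)
    fin2→bool∘bool→fin2 : ∀ e → fin2→bool (bool→fin2 e) ≡ e
    fin2→bool∘bool→fin2 false = refl
    fin2→bool∘bool→fin2 true  = refl

  data Rewind : Set where
    rwWork rwParsed rwA rwErased rwLoaded rwOutput rwCount rwTime rwDone rwNext rwBuffer : Rewind

  data Counter : Set where
    countCtr timeCtr : Counter

  -- A number n is kept as selfDelim (bitsᵇ n): every digit doubled, then 0 1.
  -- Incrementing (incBits) scans the digit pairs: a pair 1 1 becomes 0 0 and
  -- stops; a pair 0 0 becomes 1 1 and carries on; the terminator 0 1 becomes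
  -- the digit pair 1 1 followed by a new terminator 0 1.
  data IncPhase : Set where
    readPair clearSecond readSecond setFirst skipSecond growFirst growSkip newTerm0 newTerm1 : IncPhase

  data ParseTarget : Set where
    intoTime intoBound : ParseTarget

  data Ctl : Set where
    start initCount diverge accept copySummary : Ctl
    rewind : Rewind → Ctl
    parseFirst : ParseTarget → Ctl
    parseSecond : ParseTarget → Bool → Ctl
    eraseA loadSummary loadTime saveOutput compareBound emitCount emitBuffer : Ctl
    increment : Counter → IncPhase → Ctl

  nCtl : ℕ
  nCtl = 47

  encCtl : Ctl → Fin nCtl
  encCtl start                             = # 0
  encCtl initCount                         = # 1
  encCtl diverge                           = # 2
  encCtl accept                            = # 3
  encCtl copySummary                       = # 4
  encCtl (rewind rwWork)                   = # 5
  encCtl (rewind rwParsed)                 = # 6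
  encCtl (rewind rwA)                      = # 7
  encCtl (rewind rwErased)                 = # 8
  encCtl (rewind rwLoaded)                 = # 9
  encCtl (rewind rwOutput)                 = # 10
  encCtl (rewind rwCount)                  = # 11
  encCtl (rewind rwTime)                   = # 12
  encCtl (rewind rwDone)                   = # 13
  encCtl (rewind rwNext)                   = # 14
  encCtl (rewind rwBuffer)                 = # 15
  encCtl (parseFirst intoTime)             = # 16
  encCtl (parseFirst intoBound)            = # 17
  encCtl (parseSecond intoTime false)      = # 18
  encCtl (parseSecond intoTime true)       = # 19
  encCtl (parseSecond intoBound false)     = # 20
  encCtl (parseSecond intoBound true)      = # 21
  encCtl eraseA                            = # 22
  encCtl loadSummary                       = # 23
  encCtl loadTime                          = # 24
  encCtl saveOutput                        = # 25
  encCtl compareBound                      = # 26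
  encCtl emitCount                         = # 27
  encCtl emitBuffer                        = # 28
  encCtl (increment countCtr readPair)     = # 29
  encCtl (increment countCtr clearSecond)  = # 30
  encCtl (increment countCtr readSecond)   = # 31
  encCtl (increment countCtr setFirst)     = # 32
  encCtl (increment countCtr skipSecond)   = # 33
  encCtl (increment countCtr growFirst)    = # 34
  encCtl (increment countCtr growSkip)     = # 35
  encCtl (increment countCtr newTerm0)     = # 36
  encCtl (increment countCtr newTerm1)     = # 37
  encCtl (increment timeCtr readPair)      = # 38
  encCtl (increment timeCtr clearSecond)   = # 39
  encCtl (increment timeCtr readSecond)    = # 40
  encCtl (increment timeCtr setFirst)      = # 41
  encCtl (increment timeCtr skipSecond)    = # 42
  encCtl (increment timeCtr growFirst)     = # 43
  encCtl (increment timeCtr growSkip)      = # 44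
  encCtl (increment timeCtr newTerm0)      = # 45
  encCtl (increment timeCtr newTerm1)      = # 46

  decCtl : Fin nCtl → Ctl
  decCtl = lookup
    ( start V.∷ initCount V.∷ diverge V.∷ accept V.∷ copySummary
    V.∷ rewind rwWork V.∷ rewind rwParsed V.∷ rewind rwA V.∷ rewind rwErased V.∷ rewind rwLoaded V.∷ rewind rwOutput
    V.∷ rewind rwCount V.∷ rewind rwTime V.∷ rewind rwDone V.∷ rewind rwNext V.∷ rewind rwBuffer
    V.∷ parseFirst intoTime V.∷ parseFirst intoBound
    V.∷ parseSecond intoTime false V.∷ parseSecond intoTime true V.∷ parseSecond intoBound false V.∷ parseSecond intoBound true
    V.∷ eraseA V.∷ loadSummary V.∷ loadTime V.∷ saveOutput V.∷ compareBound V.∷ emitCount V.∷ emitBuffer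
    V.∷ increment countCtr readPair V.∷ increment countCtr clearSecond V.∷ increment countCtr readSecond
    V.∷ increment countCtr setFirst V.∷ increment countCtr skipSecond V.∷ increment countCtr growFirst
    V.∷ increment countCtr growSkip V.∷ increment countCtr newTerm0 V.∷ increment countCtr newTerm1
    V.∷ increment timeCtr readPair V.∷ increment timeCtr clearSecond V.∷ increment timeCtr readSecond
    V.∷ increment timeCtr setFirst V.∷ increment timeCtr skipSecond V.∷ increment timeCtr growFirst
    V.∷ increment timeCtr growSkip V.∷ increment timeCtr newTerm0 V.∷ increment timeCtr newTerm1 V.∷ V.[])

  decCtl-encCtl : ∀ c → decCtl (encCtl c) ≡ c
  decCtl-encCtl start                            = refl
  decCtl-encCtl initCount                        = refl
  decCtl-encCtl diverge                          = refl
  decCtl-encCtl accept                           = refl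
  decCtl-encCtl copySummary                      = refl
  decCtl-encCtl (rewind rwWork)                  = refl
  decCtl-encCtl (rewind rwParsed)                = refl
  decCtl-encCtl (rewind rwA)                     = refl
  decCtl-encCtl (rewind rwErased)                = refl
  decCtl-encCtl (rewind rwLoaded)                = refl
  decCtl-encCtl (rewind rwOutput)                = refl
  decCtl-encCtl (rewind rwCount)                 = refl
  decCtl-encCtl (rewind rwTime)                  = refl
  decCtl-encCtl (rewind rwDone)                  = refl
  decCtl-encCtl (rewind rwNext)                  = refl
  decCtl-encCtl (rewind rwBuffer)                = refl
  decCtl-encCtl (parseFirst intoTime)            = refl
  decCtl-encCtl (parseFirst intoBound)           = refl
  decCtl-encCtl (parseSecond intoTime false)     = refl
  decCtl-encCtl (parseSecond intoTime true)      = refl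
  decCtl-encCtl (parseSecond intoBound false)    = refl
  decCtl-encCtl (parseSecond intoBound true)     = refl
  decCtl-encCtl eraseA                           = refl
  decCtl-encCtl loadSummary                      = refl
  decCtl-encCtl loadTime                         = refl
  decCtl-encCtl saveOutput                       = refl
  decCtl-encCtl compareBound                     = refl
  decCtl-encCtl emitCount                        = refl
  decCtl-encCtl emitBuffer                       = refl
  decCtl-encCtl (increment countCtr readPair)    = refl
  decCtl-encCtl (increment countCtr clearSecond) = refl
  decCtl-encCtl (increment countCtr readSecond)  = refl
  decCtl-encCtl (increment countCtr setFirst)    = refl
  decCtl-encCtl (increment countCtr skipSecond)  = refl
  decCtl-encCtl (increment countCtr growFirst)   = refl
  decCtl-encCtl (increment countCtr growSkip)    = refl
  decCtl-encCtl (increment countCtr newTerm0)    = refl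
  decCtl-encCtl (increment countCtr newTerm1)    = refl
  decCtl-encCtl (increment timeCtr readPair)     = refl
  decCtl-encCtl (increment timeCtr clearSecond)  = refl
  decCtl-encCtl (increment timeCtr readSecond)   = refl
  decCtl-encCtl (increment timeCtr setFirst)     = refl
  decCtl-encCtl (increment timeCtr skipSecond)   = refl
  decCtl-encCtl (increment timeCtr growFirst)    = refl
  decCtl-encCtl (increment timeCtr growSkip)     = refl
  decCtl-encCtl (increment timeCtr newTerm0)     = refl
  decCtl-encCtl (increment timeCtr newTerm1)     = refl

  data St : Set where
    ctl : Ctl → St
    sim : Fin nQA → St

  nQT = nCtl + nQA

  encSt : St → Fin nQT
  encSt (ctl c) = encCtl c ↑ˡ nQA
  encSt (sim q) = nCtl ↑ʳ q

  decSt : Fin nQT → St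
  decSt i = [ (λ c → ctl (decCtl c)) , sim ]′ (splitAt nCtl i)

  decSt-encSt : ∀ s → decSt (encSt s) ≡ s
  decSt-encSt (ctl c) rewrite splitAt-↑ˡ nCtl (encCtl c) nQA = cong ctl (decCtl-encCtl c)
  decSt-encSt (sim q) rewrite splitAt-↑ʳ nCtl nQA q = refl

  isAccept : St → Bool
  isAccept (ctl accept) = true
  isAccept _            = false

  aSymbol : Sym → ΓA
  aSymbol □          = fz
  aSymbol (raw b)    = bitSym b
  aSymbol (cell a _) = a

  leftEnd : Sym → Bool
  leftEnd (cell _ e) = e
  leftEnd _          = false

  is□ : Sym → Bool
  is□ □ = true
  is□ _ = false

  bitOfΓ : ΓA → Maybe Bool
  bitOfΓ fz               = nothing
  bitOfΓ (fs fz)          = just false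
  bitOfΓ (fs (fs fz))     = just true
  bitOfΓ (fs (fs (fs _))) = nothing

  bitOf : Sym → Maybe Bool
  bitOf s = bitOfΓ (aSymbol s)

  writeA : Sym → ΓA → Sym
  writeA r a = cell a (leftEnd r)

  eqF : ∀ {n} → Fin n → Fin n → Bool
  eqF fz     fz     = true
  eqF fz     (fs _) = false
  eqF (fs _) fz     = false
  eqF (fs a) (fs b) = eqF a b

  Action = Sym × Move

  override : (Fin nTapes → Action) → Fin nTapes → Action → Fin nTapes → Action
  override f k a j = if eqF j k then a else f j

  idle : Vec Sym nTapes → Fin nTapes → Action
  idle v j = (lookup v j , stay)

  isATape : Fin nTapes → Bool
  isATape (fs (fs (fs (fs (fs (fs (fs j))))))) = true
  isATape _ = false

  isA₁ : Fin nTapes → Bool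
  isA₁ (fs (fs (fs (fs (fs (fs (fs (fs fz)))))))) = true
  isA₁ _ = false

  byTape : {X : Set} → X → X → X → X → X → X → X → (Fin (suc kA) → X) → Fin nTapes → X
  byTape xO xY xW xT xR xN xB f fz                                     = xO
  byTape xO xY xW xT xR xN xB f (fs fz)                                = xY
  byTape xO xY xW xT xR xN xB f (fs (fs fz))                           = xW
  byTape xO xY xW xT xR xN xB f (fs (fs (fs fz)))                      = xT
  byTape xO xY xW xT xR xN xB f (fs (fs (fs (fs fz))))                 = xR
  byTape xO xY xW xT xR xN xB f (fs (fs (fs (fs (fs fz)))))            = xN
  byTape xO xY xW xT xR xN xB f (fs (fs (fs (fs (fs (fs fz))))))       = xB
  byTape xO xY xW xT xR xN xB f (fs (fs (fs (fs (fs (fs (fs j))))))) = f j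

  rewinds : Rewind → Fin nTapes → Bool
  rewinds rwWork   j = eqF j tW
  rewinds rwParsed j = eqF j tW ∨ eqF j tT ∨ eqF j tR
  rewinds rwA      j = isATape j
  rewinds rwErased j = isATape j
  rewinds rwLoaded j = eqF j tW ∨ eqF j tT ∨ isATape j
  rewinds rwOutput j = eqF j (tA fz)
  rewinds rwCount  j = eqF j tN
  rewinds rwTime   j = eqF j tT
  rewinds rwDone   j = eqF j tT ∨ eqF j tR
  rewinds rwNext   j = eqF j tT ∨ eqF j tR
  rewinds rwBuffer j = eqF j tB

  afterRewind : Rewind → St
  afterRewind rwWork   = ctl (parseFirst intoTime)
  afterRewind rwParsed = ctl (rewind rwA)
  afterRewind rwA      = ctl eraseA
  afterRewind rwErased = ctl loadSummary
  afterRewind rwLoaded = sim (TM.q₀ A)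
  afterRewind rwOutput = ctl saveOutput
  afterRewind rwCount  = ctl compareBound
  afterRewind rwTime   = ctl (rewind rwA)
  afterRewind rwDone   = ctl (rewind rwBuffer)
  afterRewind rwNext   = ctl (increment timeCtr readPair)
  afterRewind rwBuffer = ctl emitCount

  targetTape : ParseTarget → Fin nTapes
  targetTape intoTime  = tT
  targetTape intoBound = tR

  afterParse : ParseTarget → St
  afterParse intoTime  = ctl (parseFirst intoBound)
  afterParse intoBound = ctl (rewind rwParsed)

  ctrTape : Counter → Fin nTapes
  ctrTape countCtr = tN
  ctrTape timeCtr  = tT

  ctrRewind : Counter → Rewind
  ctrRewind countCtr = rwCount
  ctrRewind timeCtr  = rwTime

  bit0 bit1 : ΓA
  bit0 = bitSym false
  bit1 = bitSym true

  eraseAction : Sym → Action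
  eraseAction s = if is□ s then (□ , stay) else ((if leftEnd s then cell fz true else □) , right)

  writeBit : Bool → Sym → Sym
  writeBit b r = writeA r (bitSym b)

  writeRaw : Bool → Sym → Sym
  writeRaw b r = raw b

  copyAction : Vec Sym nTapes → Fin nTapes → (Fin nTapes → Bool) → (Bool → Sym → Sym) → Bool → Fin nTapes → Action
  copyAction v a D w b j = if eqF j a then (lookup v a , right) else (if D j then (w b (lookup v j) , right) else idle v j)

  copyTo : Vec Sym nTapes → Fin nTapes → Fin nTapes → Bool → Fin nTapes → Action
  copyTo v a d b = copyAction v a (λ j → eqF j d) writeBit b

  writeOn : Vec Sym nTapes → Fin nTapes → ΓA → Move → Fin nTapes → Action
  writeOn v X γ m = override (idle v) X (writeA (lookup v X) γ , m)

  moveOn : Vec Sym nTapes → Fin nTapes → Move → Fin nTapes → Action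
  moveOn v X m = override (idle v) X (lookup v X , m)

  incTransition : Vec Sym nTapes → Counter → IncPhase → Maybe Bool → St × (Fin nTapes → Action)
  incTransition v x readPair    (just true)  = ctl (increment x clearSecond) , writeOn v (ctrTape x) bit0 right
  incTransition v x readPair    (just false) = ctl (increment x readSecond) , moveOn v (ctrTape x) right
  incTransition v x readPair    nothing      = ctl diverge , idle v
  incTransition v x clearSecond _            = ctl (rewind (ctrRewind x)) , writeOn v (ctrTape x) bit0 stay
  incTransition v x readSecond  (just false) = ctl (increment x setFirst) , writeOn v (ctrTape x) bit1 left
  incTransition v x readSecond  (just true)  = ctl (increment x growFirst) , writeOn v (ctrTape x) bit1 left
  incTransition v x readSecond  nothing      = ctl diverge , idle v
  incTransition v x setFirst    _            = ctl (increment x skipSecond) , writeOn v (ctrTape x) bit1 right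
  incTransition v x skipSecond  _            = ctl (increment x readPair) , moveOn v (ctrTape x) right
  incTransition v x growFirst   _            = ctl (increment x growSkip) , writeOn v (ctrTape x) bit1 right
  incTransition v x growSkip    _            = ctl (increment x newTerm0) , moveOn v (ctrTape x) right
  incTransition v x newTerm0    _            = ctl (increment x newTerm1) , writeOn v (ctrTape x) bit0 right
  incTransition v x newTerm1    _            = ctl (rewind (ctrRewind x)) , writeOn v (ctrTape x) bit1 stay

  incrementStep : Vec Sym nTapes → Counter → IncPhase → St × (Fin nTapes → Action)
  incrementStep v x p = incTransition v x p (bitOf (lookup v (ctrTape x)))

  -- The pair 0 1 (not b₁ ∧ b) is the terminator of selfDelim.
  parseStep : Vec Sym nTapes → ParseTarget → Maybe Bool → Maybe Bool → St × (Fin nTapes → Action)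
  parseStep v x prev      nothing  = ctl diverge , idle v
  parseStep v x nothing   (just b) = ctl (parseSecond x b) , copyTo v tW (targetTape x) b
  parseStep v x (just b₁) (just b) = (if not b₁ ∧ b then afterParse x else ctl (parseFirst x)) , copyTo v tW (targetTape x) b

  sameBit : Bool → Bool → Bool
  sameBit false false = true
  sameBit true  true  = true
  sameBit _     _     = false

  advanceTR : Vec Sym nTapes → Fin nTapes → Action
  advanceTR v = override (moveOn v tT right) tR (lookup v tR , right)

  compareStep : Vec Sym nTapes → Maybe Bool → Maybe Bool → St × (Fin nTapes → Action)
  compareStep v nothing  nothing  = ctl (rewind rwDone) , idle v
  compareStep v (just a) (just b) = if sameBit a b then (ctl compareBound , advanceTR v) else (ctl (rewind rwNext) , idle v)
  compareStep v _        _        = ctl (rewind rwNext) , idle v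

  emitAction : Vec Sym nTapes → Fin nTapes → Bool → Fin nTapes → Action
  emitAction v a b = copyAction v a (λ j → eqF j tO) writeRaw b

  copyLoop : St → St → Vec Sym nTapes → Fin nTapes → (Bool → Fin nTapes → Action) → St × (Fin nTapes → Action)
  copyLoop s s′ v a act with bitOf (lookup v a)
  ... | just b  = s , act b
  ... | nothing = s′ , idle v

  simStep : Vec Sym nTapes → Fin nQA → Bool → St × (Fin nTapes → Action)
  simStep v q true  = ctl (rewind rwOutput) , idle v
  simStep v q false =
    sim (proj₁ res) ,
    byTape (idle v tO) (idle v tY) (idle v tW) (idle v tT) (idle v tR) (idle v tN) (idle v tB)
      (λ j → writeA (lookup v (tA j)) (proj₁ (lookup (proj₂ res) j)) , proj₂ (lookup (proj₂ res) j))
    where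
    res = TM.δ A q (tabulate (λ j → aSymbol (lookup v (tA j))))

  -- N starts as selfDelim [] = encℕ 0.
  initAction : Vec Sym nTapes → Fin nTapes → Action
  initAction v = byTape (idle v tO) (idle v tY) (cell fz true , stay) (cell fz true , stay) (cell fz true , stay)
                        (cell bit0 true , right) (cell fz true , stay) (λ j → cell fz true , stay)

  -- A nonempty program sends the machine to diverge, which never halts.
  δS : St → Vec Sym nTapes → St × (Fin nTapes → Action)
  δS (ctl start) v = if is□ (lookup v tO) then (ctl initCount , initAction v) else (ctl diverge , idle v)
  δS (ctl initCount) v = ctl copySummary , override (idle v) tN (cell bit1 false , left)
  δS (ctl diverge) v = ctl diverge , idle v
  δS (ctl accept) v = ctl accept , idle v
  δS (ctl copySummary) v = copyLoop (ctl copySummary) (ctl (rewind rwWork)) v tY (copyTo v tY tW)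
  δS (ctl (rewind k)) v =
    (if allFin nTapes (λ j → not (rewinds k j) ∨ leftEnd (lookup v j)) then afterRewind k else ctl (rewind k)) ,
    (λ j → lookup v j , (if rewinds k j ∧ not (leftEnd (lookup v j)) then left else stay))
  δS (ctl (parseFirst x)) v = parseStep v x nothing (bitOf (lookup v tW))
  δS (ctl (parseSecond x b)) v = parseStep v x (just b) (bitOf (lookup v tW))
  δS (ctl eraseA) v =
    (if allFin (suc kA) (λ j → is□ (lookup v (tA j))) then ctl (rewind rwErased) else ctl eraseA) ,
    byTape (idle v tO) (idle v tY) (idle v tW) (idle v tT) (idle v tR) (idle v tN) (idle v tB) (λ j → eraseAction (lookup v (tA j)))
  δS (ctl loadSummary) v = copyLoop (ctl loadSummary) (ctl loadTime) v tW (copyTo v tW (tA fz))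
  δS (ctl loadTime) v = copyLoop (ctl loadTime) (ctl (rewind rwLoaded)) v tT (copyAction v tT isA₁ writeBit)
  δS (ctl saveOutput) v = copyLoop (ctl saveOutput) (ctl (increment countCtr readPair)) v (tA fz) (copyTo v (tA fz) tB)
  δS (ctl (increment x p)) v = incrementStep v x p
  δS (ctl compareBound) v = compareStep v (bitOf (lookup v tT)) (bitOf (lookup v tR))
  δS (ctl emitCount) v = copyLoop (ctl emitCount) (ctl emitBuffer) v tN (emitAction v tN)
  δS (ctl emitBuffer) v = copyLoop (ctl emitBuffer) (ctl accept) v tB (emitAction v tB)
  δS (sim q) v = simStep v q (isHalting A q)

  δT : Fin nQT → Vec (Fin (3 + nΓT)) nTapes → Fin nQT × Vec (Fin (3 + nΓT) × Move) nTapes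
  δT q v = encSt (proj₁ r) , tabulate (λ j → encSym (proj₁ (proj₂ r j)) , proj₂ (proj₂ r j))
    where r = δS (decSt q) (V.map decSym v)

  machine : TM
  machine = record { k = 6 + suc kA ; nQ = nQT ; nΓ = nΓT ; δ = δT
                   ; q₀ = encSt (ctl start) ; qacc = encSt (ctl accept) ; qrej = encSt (ctl accept) }

  -- The machine viewed through its own symbols and states: tapes are functions
  -- ℕ → Sym, so that a step is a pointwise update.
  record Snapshot : Set where
    constructor snapshot
    field
      st : St
      tp : Fin nTapes → ℕ → Sym
      hd : Fin nTapes → ℕ
  open Snapshot public

  updateAt : (ℕ → Sym) → ℕ → Sym → ℕ → Sym
  updateAt f h a i = if i ≡ᵇ h then a else f i

  reads : Snapshot → Vec Sym nTapes
  reads S = tabulate (λ j → tp S j (hd S j))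

  lookup-reads : ∀ S j → lookup (reads S) j ≡ tp S j (hd S j)
  lookup-reads S j = lookup∘tabulate (λ j → tp S j (hd S j)) j

  transition : Snapshot → St × (Fin nTapes → Action)
  transition S = δS (st S) (reads S)

  apply : Snapshot → Snapshot
  apply S = snapshot (proj₁ r) (λ j → updateAt (tp S j) (hd S j) (proj₁ (proj₂ r j))) (λ j → moveHead (proj₂ (proj₂ r j)) (hd S j))
    where r = transition S

  next : Snapshot → Snapshot
  next S = if isAccept (st S) then S else apply S

  run : Snapshot → ℕ → Snapshot
  run S zero    = S
  run S (suc n) = run (next S) n

  run-+ : ∀ S a b → run S (a + b) ≡ run (run S a) b
  run-+ S zero    b = refl
  run-+ S (suc a) b = run-+ (next S) a b

  record Reaches (P : Snapshot → Set) (S : Snapshot) : Set where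
    constructor reaches
    field
      steps   : ℕ
      reached : P (run S steps)

  infixr 4 _⟫_
  _⟫_ : ∀ {P Q : Snapshot → Set} {S} → Reaches P S → (∀ {S′} → P S′ → Reaches Q S′) → Reaches Q S
  _⟫_ {Q = Q} {S} (reaches c₁ p) continue with continue p
  ... | reaches c₂ q = reaches (c₁ + c₂) (subst Q (sym (run-+ S c₁ c₂)) q)

  Represents : Config machine → Snapshot → Set
  Represents C S = Config.state C ≡ encSt (st S) × (∀ j → lookup (Config.heads C) j ≡ hd S j)
                 × (∀ j i → readCell (lookup (Config.tapes C) j) i ≡ encSym (tp S j i))

  encSt-injective : ∀ s s′ → encSt s ≡ encSt s′ → s ≡ s′
  encSt-injective s s′ e = trans (sym (decSt-encSt s)) (trans (cong decSt e) (decSt-encSt s′))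

  isAccept-≢ : ∀ s → s ≢ ctl accept → isAccept s ≡ false
  isAccept-≢ (ctl accept)          s≢ = ⊥-elim (s≢ refl)
  isAccept-≢ (ctl start)           _  = refl
  isAccept-≢ (ctl initCount)       _  = refl
  isAccept-≢ (ctl diverge)         _  = refl
  isAccept-≢ (ctl copySummary)     _  = refl
  isAccept-≢ (ctl (rewind _))      _  = refl
  isAccept-≢ (ctl (parseFirst _))  _  = refl
  isAccept-≢ (ctl (parseSecond _ _)) _ = refl
  isAccept-≢ (ctl eraseA)          _  = refl
  isAccept-≢ (ctl loadSummary)     _  = refl
  isAccept-≢ (ctl loadTime)        _  = refl
  isAccept-≢ (ctl saveOutput)      _  = refl
  isAccept-≢ (ctl compareBound)    _  = refl
  isAccept-≢ (ctl emitCount)       _  = refl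
  isAccept-≢ (ctl emitBuffer)      _  = refl
  isAccept-≢ (ctl (increment _ _)) _  = refl
  isAccept-≢ (sim _)               _  = refl

  isHalting-encSt : ∀ s → isHalting machine (encSt s) ≡ isAccept s
  isHalting-encSt s = trans (isHalting-≟ machine (encSt s) refl) (decides s)
    where
    decides : ∀ s → does (encSt s F.≟ encSt (ctl accept)) ≡ isAccept s
    decides s with encSt s F.≟ encSt (ctl accept)
    ... | yes e = cong isAccept (sym (encSt-injective s (ctl accept) e))
    ... | no ne = sym (isAccept-≢ s (λ e → ne (cong encSt e)))

  encodeStep : St × (Fin nTapes → Action) → Fin nQT × Vec (Fin (3 + nΓT) × Move) nTapes
  encodeStep r = encSt (proj₁ r) , tabulate (λ j → encSym (proj₁ (proj₂ r j)) , proj₂ (proj₂ r j))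

  δT-encSt : ∀ s v w → V.map decSym v ≡ w → δT (encSt s) v ≡ encodeStep (δS s w)
  δT-encSt s v w e = cong encodeStep (cong₂ δS (decSt-encSt s) e)

  encSym-updateAt : ∀ (f : ℕ → Sym) h a i → encSym (updateAt f h a i) ≡ (if i ≡ᵇ h then encSym a else encSym (f i))
  encSym-updateAt f h a i with i ≡ᵇ h
  ... | true  = refl
  ... | false = refl

  module _ (ts : Vec (List (Fin (3 + nΓT))) nTapes) (hs : Vec ℕ nTapes) (S : Snapshot)
           (heads : ∀ j → lookup hs j ≡ hd S j) (tapes : ∀ j i → readCell (lookup ts j) i ≡ encSym (tp S j i)) where

    decode-reads : V.map decSym (V.zipWith readCell ts hs) ≡ reads S
    decode-reads = trans (sym (tabulate∘lookup (V.map decSym (V.zipWith readCell ts hs)))) (tabulate-cong pointwise)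
      where
      pointwise : ∀ j → lookup (V.map decSym (V.zipWith readCell ts hs)) j ≡ tp S j (hd S j)
      pointwise j = begin
        lookup (V.map decSym (V.zipWith readCell ts hs)) j  ≡⟨ lookup-map j decSym (V.zipWith readCell ts hs) ⟩
        decSym (lookup (V.zipWith readCell ts hs) j)        ≡⟨ cong decSym (lookup-zipWith readCell j ts hs) ⟩
        decSym (readCell (lookup ts j) (lookup hs j))       ≡⟨ cong (λ h → decSym (readCell (lookup ts j) h)) (heads j) ⟩
        decSym (readCell (lookup ts j) (hd S j))            ≡⟨ cong decSym (tapes j (hd S j)) ⟩
        decSym (encSym (tp S j (hd S j)))                   ≡⟨ decSym-encSym _ ⟩
        tp S j (hd S j)                                     ∎
        where open ≡-Reasoning

    represents-apply : Represents (stepResult machine false (δT (encSt (st S)) (V.zipWith readCell ts hs)) (encSt (st S)) ts hs) (apply S)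
    represents-apply =
      subst (λ r → Represents (stepResult machine false r (encSt (st S)) ts hs) (apply S))
            (sym (δT-encSt (st S) (V.zipWith readCell ts hs) (reads S) decode-reads))
            (refl , heads′ , tapes′)
      where
      acts = proj₂ (encodeStep (transition S))
      heads′ : ∀ j → lookup (V.zipWith moveAt hs acts) j ≡ hd (apply S) j
      heads′ j rewrite lookup-zipWith moveAt j hs acts | lookup∘tabulate (λ j → encSym (proj₁ (proj₂ (transition S) j)) , proj₂ (proj₂ (transition S) j)) j
                     | heads j = refl
      tapes′ : ∀ j i → readCell (lookup (V.zipWith writeAt (V.zip ts hs) acts) j) i ≡ encSym (tp (apply S) j i)
      tapes′ j i rewrite lookup-zipWith writeAt j (V.zip ts hs) acts
                       | lookup∘tabulate (λ j → encSym (proj₁ (proj₂ (transition S) j)) , proj₂ (proj₂ (transition S) j)) j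
                       | lookup-zip j ts hs | readCell-writeCell (lookup ts j) (lookup hs j) (encSym (proj₁ (proj₂ (transition S) j))) i
                       | heads j | encSym-updateAt (tp S j) (hd S j) (proj₁ (proj₂ (transition S) j)) i with i ≡ᵇ hd S j
      ... | true  = refl
      ... | false = tapes j i

  represents-next : ∀ C S → Represents C S → Represents (step machine C) (next S)
  represents-next (config q ts hs) S (refl , heads , tapes)
    rewrite step-unfold machine (encSt (st S)) ts hs | isHalting-encSt (st S) with isAccept (st S)
  ... | true  = refl , heads , tapes
  ... | false = represents-apply ts hs S heads tapes

  represents-run : ∀ C S n → Represents C S → Represents (runFor machine C n) (run S n)
  represents-run C S n r = subst (λ C′ → Represents C′ (run S n)) (runFrom≡runFor machine C n) (go C S n r)
    where
    go : ∀ C S n → Represents C S → Represents (runFrom machine C n) (run S n)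
    go C S zero    r = r
    go C S (suc n) r = go (step machine C) (next S) n (represents-next C S r)

  -- Subroutines

  Unchanged : Snapshot → Snapshot → Fin nTapes → Set
  Unchanged S S′ j = hd S′ j ≡ hd S j × (∀ i → tp S′ j i ≡ tp S j i)

  Unchanged-refl : ∀ S j → Unchanged S S j
  Unchanged-refl S j = refl , λ i → refl

  Unchanged-trans : ∀ {S₁ S₂ S₃} j → Unchanged S₁ S₂ j → Unchanged S₂ S₃ j → Unchanged S₁ S₃ j
  Unchanged-trans j (h₁ , t₁) (h₂ , t₂) = trans h₂ h₁ , λ i → trans (t₂ i) (t₁ i)

  record Effect (S : Snapshot) (s′ : St) (acts : Fin nTapes → Action) : Set where
    field
      state : st (next S) ≡ s′
      tape  : ∀ j i → tp (next S) j i ≡ updateAt (tp S j) (hd S j) (proj₁ (acts j)) i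
      head  : ∀ j → hd (next S) j ≡ moveHead (proj₂ (acts j)) (hd S j)

  effect : ∀ S s′ acts → isAccept (st S) ≡ false → transition S ≡ (s′ , acts) → Effect S s′ acts
  effect S s′ acts running e = record
    { state = trans (cong st next≡apply) (cong proj₁ e)
    ; tape  = λ j i → trans (cong (λ S′ → tp S′ j i) next≡apply) (cong (λ r → updateAt (tp S j) (hd S j) (proj₁ (proj₂ r j)) i) e)
    ; head  = λ j → trans (cong (λ S′ → hd S′ j) next≡apply) (cong (λ r → moveHead (proj₂ (proj₂ r j)) (hd S j)) e)
    }
    where
    next≡apply : next S ≡ apply S
    next≡apply rewrite running = refl

  ≡ᵇ-refl : ∀ h → (h ≡ᵇ h) ≡ true
  ≡ᵇ-refl zero    = refl
  ≡ᵇ-refl (suc h) = ≡ᵇ-refl h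

  ≡ᵇ-true : ∀ i h → (i ≡ᵇ h) ≡ true → i ≡ h
  ≡ᵇ-true zero    zero    e = refl
  ≡ᵇ-true (suc i) (suc h) e = cong suc (≡ᵇ-true i h e)

  updateAt-same : ∀ f h i → updateAt f h (f h) i ≡ f i
  updateAt-same f h i with i ≡ᵇ h in eq
  ... | true  = cong f (sym (≡ᵇ-true i h eq))
  ... | false = refl

  updateAt-cong : ∀ {f g} h a → (∀ i → f i ≡ g i) → ∀ i → updateAt f h a i ≡ updateAt g h a i
  updateAt-cong h a f≗g i with i ≡ᵇ h
  ... | true  = refl
  ... | false = f≗g i

  idle-unchanged : ∀ S s′ acts j → Effect S s′ acts → acts j ≡ (tp S j (hd S j) , stay) → Unchanged S (next S) j
  idle-unchanged S s′ acts j eff e =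
    trans (Effect.head eff j) (cong (λ a → moveHead (proj₂ a) (hd S j)) e) ,
    λ i → trans (Effect.tape eff j i) (trans (cong (λ a → updateAt (tp S j) (hd S j) (proj₁ a) i) e) (updateAt-same (tp S j) (hd S j) i))

  idle-reads : ∀ S j → idle (reads S) j ≡ (tp S j (hd S j) , stay)
  idle-reads S j = cong (_, stay) (lookup-reads S j)

  idle-step : ∀ S s′ → isAccept (st S) ≡ false → transition S ≡ (s′ , idle (reads S)) →
              st (next S) ≡ s′ × (∀ j → Unchanged S (next S) j)
  idle-step S s′ running e = Effect.state eff , λ j → idle-unchanged S s′ (idle (reads S)) j eff (idle-reads S j)
    where eff = effect S s′ (idle (reads S)) running e

  eqF-refl : ∀ {n} (j : Fin n) → eqF j j ≡ true
  eqF-refl fz     = refl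
  eqF-refl (fs j) = eqF-refl j

  eqF-sound : ∀ {n} (j k : Fin n) → eqF j k ≡ true → j ≡ k
  eqF-sound fz     fz     e = refl
  eqF-sound (fs j) (fs k) e = cong fs (eqF-sound j k e)

  copyAction-source : ∀ v a D w b → copyAction v a D w b a ≡ (lookup v a , right)
  copyAction-source v a D w b rewrite eqF-refl a = refl

  copyAction-target : ∀ v a D w b j → eqF j a ≡ false → D j ≡ true → copyAction v a D w b j ≡ (w b (lookup v j) , right)
  copyAction-target v a D w b j j≢a Dj rewrite j≢a | Dj = refl

  copyAction-other : ∀ v a D w b j → eqF j a ≡ false → D j ≡ false → copyAction v a D w b j ≡ idle v j
  copyAction-other v a D w b j j≢a ¬Dj rewrite j≢a | ¬Dj = refl

  data BitsAt (f : ℕ → Sym) : ℕ → List Bool → Set where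
    bits-end : ∀ {h} → bitOf (f h) ≡ nothing → BitsAt f h []
    bits-∷ : ∀ {h b bs} → bitOf (f h) ≡ just b → BitsAt f (suc h) bs → BitsAt f h (b ∷ bs)

  BitsAt-cong : ∀ {f g h bs} → (∀ i → g i ≡ f i) → BitsAt f h bs → BitsAt g h bs
  BitsAt-cong g≗f (bits-end x)    = bits-end (trans (cong bitOf (g≗f _)) x)
  BitsAt-cong g≗f (bits-∷ x rest) = bits-∷ (trans (cong bitOf (g≗f _)) x) (BitsAt-cong g≗f rest)

  writeBits : (Bool → Sym → Sym) → List Bool → ℕ → (ℕ → Sym) → ℕ → Sym
  writeBits w []       h f = f
  writeBits w (b ∷ bs) h f = writeBits w bs (suc h) (updateAt f h (w b (f h)))

  writeBits-cong : ∀ w bs h {f g} → (∀ i → f i ≡ g i) → ∀ i → writeBits w bs h f i ≡ writeBits w bs h g i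
  writeBits-cong w []       h f≗g i = f≗g i
  writeBits-cong w (b ∷ bs) h {f} {g} f≗g i =
    writeBits-cong w bs (suc h) (λ k → trans (updateAt-cong h (w b (f h)) f≗g k) (cong (λ x → updateAt g h (w b x) k) (f≗g h))) i

  writeBits-++ : ∀ w bs cs h f → writeBits w (bs ++ cs) h f ≡ writeBits w cs (h + length bs) (writeBits w bs h f)
  writeBits-++ w []       cs h f = cong (λ h′ → writeBits w cs h′ f) (sym (+-identityʳ h))
  writeBits-++ w (b ∷ bs) cs h f =
    trans (writeBits-++ w bs cs (suc h) (updateAt f h (w b (f h))))
          (cong (λ h′ → writeBits w cs h′ (writeBits w bs (suc h) (updateAt f h (w b (f h))))) (sym (+-suc h (length bs))))

  record Copied (D : Fin nTapes → Bool) (w : Bool → Sym → Sym) (a : Fin nTapes) (bs : List Bool) (S S′ : Snapshot) : Set where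
    field
      source-head : hd S′ a ≡ hd S a + length bs
      source-tape : ∀ i → tp S′ a i ≡ tp S a i
      target-head : ∀ j → eqF j a ≡ false → D j ≡ true → hd S′ j ≡ hd S j + length bs
      target-tape : ∀ j → eqF j a ≡ false → D j ≡ true → ∀ i → tp S′ j i ≡ writeBits w bs (hd S j) (tp S j) i
      others      : ∀ j → eqF j a ≡ false → D j ≡ false → Unchanged S S′ j

  Copied-[] : ∀ {D w a S S′} → (∀ j → Unchanged S S′ j) → Copied D w a [] S S′
  Copied-[] unchanged = record
    { source-head = trans (proj₁ (unchanged _)) (sym (+-identityʳ _))
    ; source-tape = proj₂ (unchanged _)
    ; target-head = λ j _ _ → trans (proj₁ (unchanged j)) (sym (+-identityʳ _))
    ; target-tape = λ j _ _ → proj₂ (unchanged j)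
    ; others      = λ j _ _ → unchanged j
    }

  Copied-++ : ∀ {D w a bs cs S₁ S₂ S₃} → Copied D w a bs S₁ S₂ → Copied D w a cs S₂ S₃ → Copied D w a (bs ++ cs) S₁ S₃
  Copied-++ {D} {w} {a} {bs} {cs} {S₁} {S₂} {S₃} c₁ c₂ = record
    { source-head = shift (source-head c₂) (source-head c₁)
    ; source-tape = λ i → trans (source-tape c₂ i) (source-tape c₁ i)
    ; target-head = λ j j≢a Dj → shift (target-head c₂ j j≢a Dj) (target-head c₁ j j≢a Dj)
    ; target-tape = λ j j≢a Dj i → begin
        tp S₃ j i                                                       ≡⟨ target-tape c₂ j j≢a Dj i ⟩
        writeBits w cs (hd S₂ j) (tp S₂ j) i                            ≡⟨ cong (λ h → writeBits w cs h (tp S₂ j) i) (target-head c₁ j j≢a Dj) ⟩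
        writeBits w cs (hd S₁ j + length bs) (tp S₂ j) i                ≡⟨ writeBits-cong w cs _ (target-tape c₁ j j≢a Dj) i ⟩
        writeBits w cs (hd S₁ j + length bs) (writeBits w bs (hd S₁ j) (tp S₁ j)) i
                                                                        ≡⟨ cong (λ f → f i) (writeBits-++ w bs cs (hd S₁ j) (tp S₁ j)) ⟨
        writeBits w (bs ++ cs) (hd S₁ j) (tp S₁ j) i                    ∎
    ; others      = λ j j≢a ¬Dj → Unchanged-trans {S₁} {S₂} {S₃} j (others c₁ j j≢a ¬Dj) (others c₂ j j≢a ¬Dj)
    }
    where
    open Copied
    open ≡-Reasoning
    shift : ∀ {x y z} → x ≡ y + length cs → y ≡ z + length bs → x ≡ z + length (bs ++ cs)
    shift {z = z} x≡ y≡ = trans x≡ (trans (cong (_+ length cs) y≡) (trans (+-assoc z (length bs) (length cs)) (cong (z +_) (sym (length-++ bs)))))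

  copy-step : ∀ S s₁ a D w b → isAccept (st S) ≡ false → transition S ≡ (s₁ , copyAction (reads S) a D w b) →
              st (next S) ≡ s₁ × Copied D w a (b ∷ []) S (next S)
  copy-step S s₁ a D w b running e = Effect.state eff , record
    { source-head = trans (Effect.head eff a) (trans (cong (λ x → moveHead (proj₂ x) (hd S a)) (copyAction-source v a D w b)) (sym (NP.+-comm (hd S a) 1)))
    ; source-tape = λ i → trans (Effect.tape eff a i)
        (trans (cong (λ x → updateAt (tp S a) (hd S a) (proj₁ x) i) (copyAction-source v a D w b))
        (trans (cong (λ x → updateAt (tp S a) (hd S a) x i) (lookup-reads S a)) (updateAt-same (tp S a) (hd S a) i)))
    ; target-head = λ j j≢a Dj → trans (Effect.head eff j)
        (trans (cong (λ x → moveHead (proj₂ x) (hd S j)) (copyAction-target v a D w b j j≢a Dj)) (sym (NP.+-comm (hd S j) 1)))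
    ; target-tape = λ j j≢a Dj i → trans (Effect.tape eff j i)
        (trans (cong (λ x → updateAt (tp S j) (hd S j) (proj₁ x) i) (copyAction-target v a D w b j j≢a Dj))
        (cong (λ x → updateAt (tp S j) (hd S j) (w b x) i) (lookup-reads S j)))
    ; others      = λ j j≢a ¬Dj → idle-unchanged S s₁ (copyAction v a D w b) j eff
        (trans (copyAction-other v a D w b j j≢a ¬Dj) (idle-reads S j))
    }
    where
    v = reads S
    eff = effect S s₁ (copyAction v a D w b) running e

  copyLoop-just : ∀ {s s′ v a act b} → bitOf (lookup v a) ≡ just b → copyLoop s s′ v a act ≡ (s , act b)
  copyLoop-just bit rewrite bit = refl

  copyLoop-nothing : ∀ {s s′ v a act} → bitOf (lookup v a) ≡ nothing → copyLoop s s′ v a act ≡ (s′ , idle v)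
  copyLoop-nothing end rewrite end = refl

  record CopyState (s s′ : St) (a : Fin nTapes) (D : Fin nTapes → Bool) (w : Bool → Sym → Sym) : Set where
    constructor copies
    field
      running : isAccept s ≡ false
      loops   : ∀ v → δS s v ≡ copyLoop s s′ v a (copyAction v a D w)

  copy-run-impl : ∀ {s s′ a D w} → CopyState s s′ a D w → D a ≡ false → ∀ bs S → st S ≡ s → BitsAt (tp S a) (hd S a) bs →
             ∃ λ n → st (run S n) ≡ s′ × Copied D w a bs S (run S n)
  copy-run-impl {s} {s′} {a} {D} {w} (copies running loops) Da [] S e (bits-end end) =
    1 , proj₁ stop , Copied-[] (proj₂ stop)
    where
    stop = idle-step S s′ (trans (cong isAccept e) running)
      (trans (cong (λ s → δS s (reads S)) e) (trans (loops (reads S)) (copyLoop-nothing {a = a} (trans (cong bitOf (lookup-reads S a)) end))))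
  copy-run-impl {s} {s′} {a} {D} {w} (copies running loops) Da (b ∷ bs) S e (bits-∷ bit rest) =
    suc (proj₁ IH) , proj₁ (proj₂ IH) , Copied-++ (proj₂ one) (proj₂ (proj₂ IH))
    where
    one = copy-step S s a D w b (trans (cong isAccept e) running)
      (trans (cong (λ s → δS s (reads S)) e) (trans (loops (reads S)) (copyLoop-just {a = a} (trans (cong bitOf (lookup-reads S a)) bit))))
    S₁ = next S
    IH = copy-run-impl (copies running loops) Da bs S₁ (proj₁ one)
      (subst (λ h → BitsAt (tp S₁ a) h bs) (trans (NP.+-comm 1 (hd S a)) (sym (Copied.source-head (proj₂ one))))
        (BitsAt-cong (Copied.source-tape (proj₂ one)) rest))

  -- Opaque, so that goals mentioning the step count never unfold the proof.
  opaque
    copy-run : ∀ {s s′ a D w} → CopyState s s′ a D w → D a ≡ false → ∀ bs S → st S ≡ s → BitsAt (tp S a) (hd S a) bs →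
               ∃ λ n → st (run S n) ≡ s′ × Copied D w a bs S (run S n)
    copy-run = copy-run-impl

  copySummary-copies : CopyState (ctl copySummary) (ctl (rewind rwWork)) tY (λ j → eqF j tW) writeBit
  copySummary-copies = copies refl λ _ → refl

  loadSummary-copies : CopyState (ctl loadSummary) (ctl loadTime) tW (λ j → eqF j (tA fz)) writeBit
  loadSummary-copies = copies refl λ _ → refl

  loadTime-copies : CopyState (ctl loadTime) (ctl (rewind rwLoaded)) tT isA₁ writeBit
  loadTime-copies = copies refl λ _ → refl

  saveOutput-copies : CopyState (ctl saveOutput) (ctl (increment countCtr readPair)) (tA fz) (λ j → eqF j tB) writeBit
  saveOutput-copies = copies refl λ _ → refl

  emitCount-copies : CopyState (ctl emitCount) (ctl emitBuffer) tN (λ j → eqF j tO) writeRaw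
  emitCount-copies = copies refl λ _ → refl

  emitBuffer-copies : CopyState (ctl emitBuffer) (ctl accept) tB (λ j → eqF j tO) writeRaw
  emitBuffer-copies = copies refl λ _ → refl

  isOrigin : ℕ → Bool
  isOrigin i = i ≡ᵇ 0

  isOrigin-true : ∀ h → isOrigin h ≡ true → h ≡ 0
  isOrigin-true zero _ = refl

  LeftEndMarked : Snapshot → Fin nTapes → Set
  LeftEndMarked S j = ∀ i → leftEnd (tp S j i) ≡ isOrigin i

  rewound : Rewind → Snapshot → Bool
  rewound k S = allFin nTapes (λ j → not (rewinds k j) ∨ leftEnd (tp S j (hd S j)))

  rewindHead : Bool → ℕ → ℕ
  rewindHead z h = if z then pred h else h

  rewind-move : ∀ z e h → (z ≡ true → e ≡ isOrigin h) → moveHead (if z ∧ not e then left else stay) h ≡ rewindHead z h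
  rewind-move true  e zero    marked rewrite marked refl = refl
  rewind-move true  e (suc h) marked rewrite marked refl = refl
  rewind-move false e h       marked = refl

  rewind-step : ∀ k S → st S ≡ ctl (rewind k) → (∀ j → rewinds k j ≡ true → LeftEndMarked S j) →
    st (next S) ≡ (if rewound k S then afterRewind k else ctl (rewind k))
    × (∀ j → hd (next S) j ≡ rewindHead (rewinds k j) (hd S j))
    × (∀ j i → tp (next S) j i ≡ tp S j i)
  rewind-step k S@(snapshot .(ctl (rewind k)) tp hd) refl marked =
    cong (λ b → if b then afterRewind k else ctl (rewind k)) (allFin-cong nTapes λ j → cong (λ x → not (rewinds k j) ∨ leftEnd x) (lookup-reads S j)) ,
    (λ j → trans (cong (λ x → moveHead (if rewinds k j ∧ not (leftEnd x) then left else stay) (hd j)) (lookup-reads S j))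
                 (rewind-move (rewinds k j) (leftEnd (tp j (hd j))) (hd j) (λ z → marked j z (hd j)))) ,
    λ j i → trans (cong (λ x → updateAt (tp j) (hd j) x i) (lookup-reads S j)) (updateAt-same (tp j) (hd j) i)

  record Rewound (k : Rewind) (S S′ : Snapshot) : Set where
    field
      state     : st S′ ≡ afterRewind k
      at-origin : ∀ j → rewinds k j ≡ true → hd S′ j ≡ 0
      kept      : ∀ j → rewinds k j ≡ false → hd S′ j ≡ hd S j
      tapes     : ∀ j i → tp S′ j i ≡ tp S j i

  Rewound-unchanged : ∀ {k S S′} → Rewound k S S′ → ∀ j → rewinds k j ≡ false → Unchanged S S′ j
  Rewound-unchanged r j z = Rewound.kept r j z , Rewound.tapes r j

  -- n bounds the heads to be rewound, so the loop stops within n + 1 steps.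
  rewind-run-within : ∀ k n S → st S ≡ ctl (rewind k) → (∀ j → rewinds k j ≡ true → hd S j ≤ n) →
    (∀ j → rewinds k j ≡ true → LeftEndMarked S j) → ∃ λ c → Rewound k S (run S c)
  rewind-run-within k n S e bound marked = go n bound (rewound k S) refl
    where
    one = rewind-step k S e marked
    state₁ : ∀ {b} → rewound k S ≡ b → st (next S) ≡ (if b then afterRewind k else ctl (rewind k))
    state₁ d = trans (proj₁ one) (cong (λ b → if b then afterRewind k else ctl (rewind k)) d)
    head₁ : ∀ j {z} → rewinds k j ≡ z → hd (next S) j ≡ rewindHead z (hd S j)
    head₁ j z = trans (proj₁ (proj₂ one) j) (cong (λ b → rewindHead b (hd S j)) z)
    go : ∀ m → (∀ j → rewinds k j ≡ true → hd S j ≤ m) → ∀ b → rewound k S ≡ b → ∃ λ c → Rewound k S (run S c)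
    go m bound true d = 1 , record
      { state     = state₁ d
      ; at-origin = λ j z → trans (head₁ j z) (cong pred (isOrigin-true (hd S j) (trans (sym (marked j z (hd S j))) (at-left-end j z))))
      ; kept      = λ j z → head₁ j z
      ; tapes     = proj₂ (proj₂ one)
      }
      where
      at-left-end : ∀ j → rewinds k j ≡ true → leftEnd (tp S j (hd S j)) ≡ true
      at-left-end j z with rewinds k j | allFin-sound nTapes (λ j → not (rewinds k j) ∨ leftEnd (tp S j (hd S j))) d j
      at-left-end j refl | .true | done = done
    go zero bound false d = ⊥-elim (false≢true (trans (sym d) (allFin-complete nTapes _ all-at-origin)))
      where
      false≢true : false ≡ true → ⊥
      false≢true ()
      all-at-origin : ∀ j → (not (rewinds k j) ∨ leftEnd (tp S j (hd S j))) ≡ true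
      all-at-origin j with rewinds k j in z
      ... | false = refl
      ... | true  = trans (marked j z (hd S j)) (cong isOrigin (NP.n≤0⇒n≡0 (bound j z)))
    go (suc m) bound false d = suc (proj₁ IH) , record
      { state     = Rewound.state R
      ; at-origin = Rewound.at-origin R
      ; kept      = λ j z → trans (Rewound.kept R j z) (head₁ j z)
      ; tapes     = λ j i → trans (Rewound.tapes R j i) (proj₂ (proj₂ one) j i)
      }
      where
      IH = rewind-run-within k m (next S) (state₁ d)
        (λ j z → subst (_≤ m) (sym (head₁ j z)) (pred-mono-≤ (bound j z)))
        (λ j z i → trans (cong leftEnd (proj₂ (proj₂ one) j i)) (marked j z i))
      R = proj₂ IH

  opaque
    rewind-run : ∀ k S → st S ≡ ctl (rewind k) → (∀ j → rewinds k j ≡ true → LeftEndMarked S j) →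
                 ∃ λ c → Rewound k S (run S c)
    rewind-run k S e = rewind-run-within k (sumF nTapes (hd S)) S e (λ j _ → sumF-≥ nTapes (hd S) j)

  record Holds (f : ℕ → Sym) (l : List ΓA) (m : ℕ) : Set where
    constructor holds
    field
      pos : 1 ≤ m
      lo  : ∀ i → i < m → f i ≡ cell (readCell l i) (isOrigin i)
      hi  : ∀ i → m ≤ i → f i ≡ □ × readCell l i ≡ fz
  open Holds public

  ≡ᵇ-false : ∀ i h → (i ≡ᵇ h) ≡ false → i ≢ h
  ≡ᵇ-false i h e refl rewrite ≡ᵇ-refl i = case e
    where case : true ≡ false → ⊥
          case ()

  ≢⇒≡ᵇ : ∀ i h → i ≢ h → (i ≡ᵇ h) ≡ false
  ≢⇒≡ᵇ i h i≢h with i ≡ᵇ h in eq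
  ... | true  = ⊥-elim (i≢h (≡ᵇ-true i h eq))
  ... | false = refl

  Holds-cong : ∀ {f g l m} → (∀ i → g i ≡ f i) → Holds f l m → Holds g l m
  Holds-cong g≗f (holds p lo hi) = holds p (λ i q → trans (g≗f i) (lo i q)) (λ i q → trans (g≗f i) (proj₁ (hi i q)) , proj₂ (hi i q))

  isOrigin-pos : ∀ {i} → 1 ≤ i → isOrigin i ≡ false
  isOrigin-pos (s≤s _) = refl

  Holds-leftEnd : ∀ {f l m} → Holds f l m → ∀ i → leftEnd (f i) ≡ isOrigin i
  Holds-leftEnd {m = m} t i with NP.<-≤-connex i m
  ... | inj₁ i<m = cong leftEnd (lo t i i<m)
  ... | inj₂ m≤i = trans (cong leftEnd (proj₁ (hi t i m≤i))) (sym (isOrigin-pos (≤-trans (pos t) m≤i)))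

  Holds-aSymbol : ∀ {f l m} → Holds f l m → ∀ i → aSymbol (f i) ≡ readCell l i
  Holds-aSymbol {m = m} t i with NP.<-≤-connex i m
  ... | inj₁ i<m = cong aSymbol (lo t i i<m)
  ... | inj₂ m≤i = trans (cong aSymbol (proj₁ (hi t i m≤i))) (sym (proj₂ (hi t i m≤i)))

  Holds-write-within : ∀ {f l m} h a → Holds f l m → ∀ m′ → 1 ≤ m′ → h < m′ →
    (∀ i → i < m′ → (i ≡ᵇ h) ≡ false → i < m) → (∀ i → m′ ≤ i → m ≤ i) →
    Holds (updateAt f h (writeA (f h) a)) (writeCell l h a) m′
  Holds-write-within {f} {l} {m} h a t m′ p h<m′ below above = holds p lo′ hi′
    where
    lo′ : ∀ i → i < m′ → updateAt f h (writeA (f h) a) i ≡ cell (readCell (writeCell l h a) i) (isOrigin i)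
    lo′ i q rewrite readCell-writeCell l h a i with i ≡ᵇ h in eq
    ... | true rewrite ≡ᵇ-true i h eq = cong (cell a) (Holds-leftEnd t h)
    ... | false = lo t i (below i q eq)
    hi′ : ∀ i → m′ ≤ i → updateAt f h (writeA (f h) a) i ≡ □ × readCell (writeCell l h a) i ≡ fz
    hi′ i q rewrite readCell-writeCell l h a i | ≢⇒≡ᵇ i h (λ { refl → NP.<-irrefl refl (NP.<-≤-trans h<m′ q) }) = hi t i (above i q)

  Holds-write : ∀ {f l m} h a → Holds f l m → h ≤ m →
    ∃ λ m′ → Holds (updateAt f h (writeA (f h) a)) (writeCell l h a) m′ × suc h ≤ m′ × m ≤ m′
  Holds-write {f} {l} {m} h a t h≤m with NP.m≤n⇒m<n∨m≡n h≤m
  ... | inj₁ h<m  = m , Holds-write-within h a t m (pos t) h<m (λ i q _ → q) (λ i q → q) , h<m , ≤-refl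
  ... | inj₂ refl = suc h , Holds-write-within h a t (suc h) (s≤s z≤n) ≤-refl below (λ i q → ≤-trans (n≤1+n h) q) , ≤-refl , n≤1+n h
    where
    below : ∀ i → i < suc h → (i ≡ᵇ h) ≡ false → i < h
    below i i<1+h i≢h = [ (λ i<h → i<h) , (λ i≡h → ⊥-elim (≡ᵇ-false i h i≢h i≡h)) ]′ (NP.m<1+n⇒m<n∨m≡n i<1+h)

  encBits : List Bool → List ΓA
  encBits = L.map bitSym

  length-snoc : ∀ {X : Set} (cs : List X) b → length (cs ++ b ∷ []) ≡ suc (length cs)
  length-snoc cs b = trans (length-++ cs) (NP.+-comm (length cs) 1)

  writeCell-snoc : ∀ cs b → writeCell (encBits cs) (length cs) (bitSym b) ≡ encBits (cs ++ b ∷ [])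
  writeCell-snoc []       b = refl
  writeCell-snoc (c ∷ cs) b = cong (bitSym c ∷_) (writeCell-snoc cs b)

  Holds-writeBits : ∀ bs cs h {f m} → h ≡ length cs → Holds f (encBits cs) m → h ≤ m →
    ∃ λ m′ → Holds (writeBits writeBit bs h f) (encBits (cs ++ bs)) m′ × h + length bs ≤ m′
  Holds-writeBits [] cs h {f} {m} e t h≤m =
    m , subst (λ cs′ → Holds f (encBits cs′) m) (sym (++-identityʳ cs)) t , subst (_≤ m) (sym (+-identityʳ h)) h≤m
  Holds-writeBits (b ∷ bs) cs h {f} {m} refl t h≤m with Holds-write h (bitSym b) t h≤m
  ... | m₁ , t₁ , h<m₁ , _ with Holds-writeBits bs (cs ++ b ∷ []) (suc h) (sym (length-snoc cs b))
                                  (subst (λ l → Holds (updateAt f h (writeA (f h) (bitSym b))) l m₁) (writeCell-snoc cs b) t₁) h<m₁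
  ... | m₂ , t₂ , h+bs≤m₂ =
    m₂ , subst (λ l → Holds (writeBits writeBit bs (suc h) (updateAt f h (writeA (f h) (bitSym b)))) (encBits l) m₂) (++-assoc cs (b ∷ []) bs) t₂ ,
    subst (_≤ m₂) (sym (+-suc h (length bs))) h+bs≤m₂

  rawTape : List Bool → ℕ → Sym
  rawTape []       i       = □
  rawTape (b ∷ bs) zero    = raw b
  rawTape (b ∷ bs) (suc i) = rawTape bs i

  RawHolds : (ℕ → Sym) → List Bool → Set
  RawHolds f cs = ∀ i → f i ≡ rawTape cs i

  rawTape-snoc : ∀ cs b i → rawTape (cs ++ b ∷ []) i ≡ updateAt (rawTape cs) (length cs) (raw b) i
  rawTape-snoc []       b zero    = refl
  rawTape-snoc []       b (suc i) = refl
  rawTape-snoc (c ∷ cs) b zero    = refl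
  rawTape-snoc (c ∷ cs) b (suc i) = rawTape-snoc cs b i

  RawHolds-writeBits : ∀ bs cs h {f} → h ≡ length cs → RawHolds f cs → RawHolds (writeBits writeRaw bs h f) (cs ++ bs)
  RawHolds-writeBits [] cs h e r i = trans (r i) (cong (λ cs′ → rawTape cs′ i) (sym (++-identityʳ cs)))
  RawHolds-writeBits (b ∷ bs) cs h {f} refl r i =
    trans (RawHolds-writeBits bs (cs ++ b ∷ []) (suc h) (sym (length-snoc cs b)) r′ i) (cong (λ cs′ → rawTape cs′ i) (++-assoc cs (b ∷ []) bs))
    where
    r′ : RawHolds (updateAt f h (raw b)) (cs ++ b ∷ [])
    r′ k = trans (updateAt-cong h (raw b) r k) (sym (rawTape-snoc cs b k))

  bitsOf-encBits : ∀ bs → bitsOf (encBits bs) ≡ bs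
  bitsOf-encBits []           = refl
  bitsOf-encBits (false ∷ bs) = cong (false ∷_) (bitsOf-encBits bs)
  bitsOf-encBits (true ∷ bs)  = cong (true ∷_) (bitsOf-encBits bs)

  bitOf-+0 : ∀ (f : ℕ → Sym) h {x} → bitOf (f (h + 0)) ≡ x → bitOf (f h) ≡ x
  bitOf-+0 f h = trans (cong (λ k → bitOf (f k)) (sym (+-identityʳ h)))

  bitOf-+suc : ∀ (f : ℕ → Sym) h {g : ℕ → Maybe Bool} → (∀ i → bitOf (f (h + i)) ≡ g i) → ∀ i → bitOf (f (suc h + i)) ≡ g (suc i)
  bitOf-+suc f h e i = trans (cong (λ k → bitOf (f k)) (sym (+-suc h i))) (e (suc i))

  bitsAt-readCell : ∀ (f : ℕ → Sym) h (l : List ΓA) → (∀ i → bitOf (f (h + i)) ≡ bitOfΓ (readCell l i)) → BitsAt f h (bitsOf l)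
  bitsAt-readCell f h []                  e = bits-end (bitOf-+0 f h (e 0))
  bitsAt-readCell f h (fz ∷ l)            e = bits-end (bitOf-+0 f h (e 0))
  bitsAt-readCell f h (fs fz ∷ l)         e = bits-∷ (bitOf-+0 f h (e 0)) (bitsAt-readCell f (suc h) l (bitOf-+suc f h e))
  bitsAt-readCell f h (fs (fs fz) ∷ l)    e = bits-∷ (bitOf-+0 f h (e 0)) (bitsAt-readCell f (suc h) l (bitOf-+suc f h e))
  bitsAt-readCell f h (fs (fs (fs _)) ∷ l) e = bits-end (bitOf-+0 f h (e 0))

  Holds-bitsAt : ∀ {f l m} → Holds f l m → BitsAt f 0 (bitsOf l)
  Holds-bitsAt {f} {l} t = bitsAt-readCell f 0 l (λ i → cong bitOfΓ (Holds-aSymbol t i))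

  bitOf-rawTape : ∀ cs i → bitOf (rawTape cs i) ≡ bitOfΓ (readCell (encBits cs) i)
  bitOf-rawTape []           i       = refl
  bitOf-rawTape (false ∷ cs) zero    = refl
  bitOf-rawTape (true ∷ cs)  zero    = refl
  bitOf-rawTape (c ∷ cs)     (suc i) = bitOf-rawTape cs i

  RawHolds-bitsAt : ∀ {f cs} → RawHolds f cs → BitsAt f 0 cs
  RawHolds-bitsAt {f} {cs} r =
    subst (BitsAt f 0) (bitsOf-encBits cs) (bitsAt-readCell f 0 (encBits cs) (λ i → trans (cong bitOf (r i)) (bitOf-rawTape cs i)))

  override-here : ∀ f X a → override f X a X ≡ a
  override-here f X a rewrite eqF-refl X = refl

  override-other : ∀ f X a j → eqF j X ≡ false → override f X a j ≡ f j
  override-other f X a j e rewrite e = refl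

  OneTape : Snapshot → Snapshot → Fin nTapes → Sym → Move → Set
  OneTape S S' X a mv = (∀ i → tp S' X i ≡ updateAt (tp S X) (hd S X) a i) × hd S' X ≡ moveHead mv (hd S X)
    × (∀ j → eqF j X ≡ false → Unchanged S S' j)

  override-step : ∀ S s' X a mv → isAccept (st S) ≡ false → transition S ≡ (s' , override (idle (reads S)) X (a , mv))
    → st (next S) ≡ s' × OneTape S (next S) X a mv
  override-step S s' X a mv na e = Effect.state si ,
    (λ i → trans (Effect.tape si X i) (cong (λ z → updateAt (tp S X) (hd S X) (proj₁ z) i) (override-here (idle (reads S)) X (a , mv)))) ,
    trans (Effect.head si X) (cong (λ z → moveHead (proj₂ z) (hd S X)) (override-here (idle (reads S)) X (a , mv))) ,
    λ j ne → idle-unchanged S s' acts j si (trans (override-other (idle (reads S)) X (a , mv) j ne) (idle-reads S j))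
    where
    acts = override (idle (reads S)) X (a , mv)
    si = effect S s' acts na e

  TapeAt : Snapshot → Fin nTapes → List ΓA → Set
  TapeAt S X l = ∃ λ m → Holds (tp S X) l m × hd S X ≤ m

  write-step : ∀ S s' X γ mv {l} → isAccept (st S) ≡ false → transition S ≡ (s' , override (idle (reads S)) X (writeA (lookup (reads S) X) γ , mv))
    → TapeAt S X l → st (next S) ≡ s' × (∃ λ m' → Holds (tp (next S) X) (writeCell l (hd S X) γ) m' × suc (hd S X) ≤ m')
      × hd (next S) X ≡ moveHead mv (hd S X) × (∀ j → eqF j X ≡ false → Unchanged S (next S) j)
  write-step S s' X γ mv {l} na e (m , t , hm) =
    proj₁ oe , (proj₁ tw , Holds-cong (λ i → trans (proj₁ (proj₂ oe) i) (cong (λ z → updateAt (tp S X) (hd S X) (writeA z γ) i) (lookup-reads S X))) (proj₁ (proj₂ tw)) , proj₁ (proj₂ (proj₂ tw))) ,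
    proj₁ (proj₂ (proj₂ oe)) , proj₂ (proj₂ (proj₂ oe))
    where
    oe = override-step S s' X (writeA (lookup (reads S) X) γ) mv na e
    tw = Holds-write (hd S X) γ t hm

  keep-step : ∀ S s' X mv {l} → isAccept (st S) ≡ false → transition S ≡ (s' , override (idle (reads S)) X (lookup (reads S) X , mv))
    → ∀ m → Holds (tp S X) l m → st (next S) ≡ s' × Holds (tp (next S) X) l m
      × hd (next S) X ≡ moveHead mv (hd S X) × (∀ j → eqF j X ≡ false → Unchanged S (next S) j)
  keep-step S s' X mv {l} na e m t =
    proj₁ oe , Holds-cong (λ i → trans (proj₁ (proj₂ oe) i) (trans (cong (λ z → updateAt (tp S X) (hd S X) z i) (lookup-reads S X)) (updateAt-same (tp S X) (hd S X) i))) t ,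
    proj₁ (proj₂ (proj₂ oe)) , proj₂ (proj₂ (proj₂ oe))
    where
    oe = override-step S s' X (lookup (reads S) X) mv na e

  increment-transition : ∀ x p S → st S ≡ ctl (increment x p) → transition S ≡ incTransition (reads S) x p (bitOf (tp S (ctrTape x) (hd S (ctrTape x))))
  increment-transition x p (snapshot .(ctl (increment x p)) tp hd) refl = cong (λ z → incTransition (reads S) x p (bitOf z)) (lookup-reads S (ctrTape x))
    where S = snapshot (ctl (increment x p)) tp hd

  Frame : Fin nTapes → Snapshot → Snapshot → Set
  Frame X S S' = ∀ j → eqF j X ≡ false → Unchanged S S' j

  Frame-trans : ∀ {X S1 S2 S3} → Frame X S1 S2 → Frame X S2 S3 → Frame X S1 S3
  Frame-trans {X} {S1} {S2} {S3} f g j e = Unchanged-trans {S1} {S2} {S3} j (f j e) (g j e)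

  moveHead-le : ∀ mv h → moveHead mv h ≤ suc h
  moveHead-le left zero = z≤n
  moveHead-le left (suc h) = ≤-trans (n≤1+n h) (n≤1+n (suc h))
  moveHead-le stay h = n≤1+n h
  moveHead-le right h = ≤-refl

  readCell-encBits : ∀ pre y rest → readCell (encBits (pre ++ y ∷ rest)) (length pre) ≡ bitSym y
  readCell-encBits [] y rest = refl
  readCell-encBits (c ∷ pre) y rest = readCell-encBits pre y rest

  writeCell-encBits : ∀ pre y rest z → writeCell (encBits (pre ++ y ∷ rest)) (length pre) (bitSym z) ≡ encBits (pre ++ z ∷ rest)
  writeCell-encBits [] y rest z = refl
  writeCell-encBits (c ∷ pre) y rest z = cong (bitSym c ∷_) (writeCell-encBits pre y rest z)

  bitOfΓ-bit : ∀ y → bitOfΓ (bitSym {nΓA} y) ≡ just y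
  bitOfΓ-bit false = refl
  bitOfΓ-bit true = refl

  bitSym≢blank : ∀ y → bitSym {nΓA} y ≡ fz → ⊥
  bitSym≢blank false ()
  bitSym≢blank true ()

  TapeAt-bitOf : ∀ S X pre y rest → TapeAt S X (encBits (pre ++ y ∷ rest)) → hd S X ≡ length pre → bitOf (tp S X (hd S X)) ≡ just y
  TapeAt-bitOf S X pre y rest (m , t , _) e = trans (cong bitOfΓ (Holds-aSymbol t (hd S X))) (trans (cong (λ z → bitOfΓ (readCell (encBits (pre ++ y ∷ rest)) z)) e)
    (trans (cong bitOfΓ (readCell-encBits pre y rest)) (bitOfΓ-bit y)))

  Holds-bit<extent : ∀ {f l m} h y → Holds f l m → readCell l h ≡ bitSym y → h < m
  Holds-bit<extent {f} {l} {m} h y t e with NP.<-≤-connex h m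
  ... | inj₁ p = p
  ... | inj₂ p = ⊥-elim (bitSym≢blank y (trans (sym e) (proj₂ (hi t h p))))

  writeBit-step : ∀ S s′ X z mv {l l′} → isAccept (st S) ≡ false
    → transition S ≡ (s′ , override (idle (reads S)) X (writeA (lookup (reads S) X) (bitSym z) , mv))
    → TapeAt S X l → writeCell l (hd S X) (bitSym z) ≡ l′
    → st (next S) ≡ s′ × TapeAt (next S) X l′ × hd (next S) X ≡ moveHead mv (hd S X) × Frame X S (next S)
  writeBit-step S s′ X z mv running e ta written =
    proj₁ w , (m′ , subst (λ l → Holds (tp (next S) X) l m′) written (proj₁ (proj₂ w′)) , within) , proj₁ (proj₂ (proj₂ w)) , proj₂ (proj₂ (proj₂ w))
    where
    w = write-step S s′ X (bitSym z) mv running e ta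
    w′ = proj₁ (proj₂ w)
    m′ = proj₁ w′
    within : hd (next S) X ≤ m′
    within = subst (_≤ m′) (sym (proj₁ (proj₂ (proj₂ w)))) (≤-trans (moveHead-le mv (hd S X)) (proj₂ (proj₂ w′)))

  overwriteBit-step : ∀ S s′ X z mv pre y rest → isAccept (st S) ≡ false
    → transition S ≡ (s′ , override (idle (reads S)) X (writeA (lookup (reads S) X) (bitSym z) , mv))
    → TapeAt S X (encBits (pre ++ y ∷ rest)) → hd S X ≡ length pre
    → st (next S) ≡ s′ × TapeAt (next S) X (encBits (pre ++ z ∷ rest)) × hd (next S) X ≡ moveHead mv (length pre) × Frame X S (next S)
  overwriteBit-step S s′ X z mv pre y rest running e ta at with writeBit-step S s′ X z mv running e ta
    (trans (cong (λ h → writeCell (encBits (pre ++ y ∷ rest)) h (bitSym z)) at) (writeCell-encBits pre y rest z))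
  ... | state , tape , head , frame = state , tape , trans head (cong (moveHead mv) at) , frame

  appendBit-step : ∀ S s′ X z mv cs → isAccept (st S) ≡ false
    → transition S ≡ (s′ , override (idle (reads S)) X (writeA (lookup (reads S) X) (bitSym z) , mv))
    → TapeAt S X (encBits cs) → hd S X ≡ length cs
    → st (next S) ≡ s′ × TapeAt (next S) X (encBits (cs ++ z ∷ [])) × hd (next S) X ≡ moveHead mv (length cs) × Frame X S (next S)
  appendBit-step S s′ X z mv cs running e ta at with writeBit-step S s′ X z mv running e ta
    (trans (cong (λ h → writeCell (encBits cs) h (bitSym z)) at) (writeCell-snoc cs z))
  ... | state , tape , head , frame = state , tape , trans head (cong (moveHead mv) at) , frame

  skipBit-step : ∀ S s' X mv pre y rest → isAccept (st S) ≡ false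
    → transition S ≡ (s' , override (idle (reads S)) X (lookup (reads S) X , mv))
    → TapeAt S X (encBits (pre ++ y ∷ rest)) → hd S X ≡ length pre
    → st (next S) ≡ s' × TapeAt (next S) X (encBits (pre ++ y ∷ rest)) × hd (next S) X ≡ moveHead mv (length pre) × Frame X S (next S)
  skipBit-step S s' X mv pre y rest na e (m , t , _) eh =
    proj₁ k , (m , proj₁ (proj₂ k) , hb) , he , proj₂ (proj₂ (proj₂ k))
    where
    k = keep-step S s' X mv na e m t
    h<m : hd S X < m
    h<m = Holds-bit<extent (hd S X) y t (trans (cong (readCell (encBits (pre ++ y ∷ rest))) eh) (readCell-encBits pre y rest))
    hb : hd (next S) X ≤ m
    hb = subst (_≤ m) (sym (proj₁ (proj₂ (proj₂ k)))) (≤-trans (moveHead-le mv (hd S X)) h<m)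
    he : hd (next S) X ≡ moveHead mv (length pre)
    he = trans (proj₁ (proj₂ (proj₂ k))) (cong (moveHead mv) eh)

  TapeAt-subst : ∀ S X {l l′} → l ≡ l′ → TapeAt S X l → TapeAt S X l′
  TapeAt-subst S X refl t = t

  Incremented : Counter → Snapshot → Snapshot → List ΓA → Set
  Incremented x S S' l' = st S' ≡ ctl (rewind (ctrRewind x)) × TapeAt S' (ctrTape x) l' × Frame (ctrTape x) S S'

  length-snoc₂ : ∀ {X : Set} (pre : List X) a b → length (pre ++ a ∷ b ∷ []) ≡ suc (suc (length pre))
  length-snoc₂ pre a b = trans (length-++ pre) (NP.+-comm (length pre) 2)

  increment-run-impl : ∀ x bs pre S → st S ≡ ctl (increment x readPair) → TapeAt S (ctrTape x) (encBits (pre ++ selfDelim bs)) → hd S (ctrTape x) ≡ length pre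
    → ∃ λ c → Incremented x S (run S c) (encBits (pre ++ selfDelim (incBits bs)))
  increment-run-impl x (true ∷ r) pre S est ta eh = 2 , proj₁ s2 , TapeAt-subst S2 X (cong encBits (++-assoc pre (false ∷ []) (false ∷ R))) (proj₁ (proj₂ s2)) ,
      Frame-trans {X} {S} {S1} {S2} (proj₂ (proj₂ (proj₂ s1))) (proj₂ (proj₂ (proj₂ s2)))
    where
    X = ctrTape x
    R = selfDelim r
    e1 = trans (increment-transition x readPair S est) (cong (incTransition (reads S) x readPair) (TapeAt-bitOf S X pre true (true ∷ R) ta eh))
    s1 = overwriteBit-step S (ctl (increment x clearSecond)) X false right pre true (true ∷ R) (cong isAccept est) e1 ta eh
    S1 = next S
    s2 = overwriteBit-step S1 (ctl (rewind (ctrRewind x))) X false stay (pre ++ false ∷ []) true R (cong isAccept (proj₁ s1)) (increment-transition x clearSecond S1 (proj₁ s1))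
           (TapeAt-subst S1 X (cong encBits (sym (++-assoc pre (false ∷ []) (true ∷ R)))) (proj₁ (proj₂ s1)))
           (trans (proj₁ (proj₂ (proj₂ s1))) (sym (length-snoc pre false)))
    S2 = next S1
  increment-run-impl x (false ∷ r) pre S est ta eh =
    4 + proj₁ IH , proj₁ (proj₂ IH) , TapeAt-subst (run S4 (proj₁ IH)) X (cong encBits (++-assoc pre (true ∷ true ∷ []) (selfDelim (incBits r)))) (proj₁ (proj₂ (proj₂ IH))) ,
      Frame-trans {X} {S} {S4} {run S4 (proj₁ IH)}
        (Frame-trans {X} {S} {S3} {S4} (Frame-trans {X} {S} {S2} {S3} (Frame-trans {X} {S} {S1} {S2} (proj₂ (proj₂ (proj₂ s1))) (proj₂ (proj₂ (proj₂ s2)))) (proj₂ (proj₂ (proj₂ s3)))) (proj₂ (proj₂ (proj₂ s4))))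
        (proj₂ (proj₂ (proj₂ IH)))
    where
    X = ctrTape x
    R = selfDelim r
    e1 = trans (increment-transition x readPair S est) (cong (incTransition (reads S) x readPair) (TapeAt-bitOf S X pre false (false ∷ R) ta eh))
    s1 = skipBit-step S (ctl (increment x readSecond)) X right pre false (false ∷ R) (cong isAccept est) e1 ta eh
    S1 = next S
    ta1 = TapeAt-subst S1 X (cong encBits (sym (++-assoc pre (false ∷ []) (false ∷ R)))) (proj₁ (proj₂ s1))
    eh1 = trans (proj₁ (proj₂ (proj₂ s1))) (sym (length-snoc pre false))
    e2 = trans (increment-transition x readSecond S1 (proj₁ s1)) (cong (incTransition (reads S1) x readSecond) (TapeAt-bitOf S1 X (pre ++ false ∷ []) false R ta1 eh1))
    s2 = overwriteBit-step S1 (ctl (increment x setFirst)) X true left (pre ++ false ∷ []) false R (cong isAccept (proj₁ s1)) e2 ta1 eh1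
    S2 = next S1
    ta2 = TapeAt-subst S2 X (cong encBits (++-assoc pre (false ∷ []) (true ∷ R))) (proj₁ (proj₂ s2))
    eh2 : hd S2 X ≡ length pre
    eh2 = trans (proj₁ (proj₂ (proj₂ s2))) (cong (moveHead left) (length-snoc pre false))
    s3 = overwriteBit-step S2 (ctl (increment x skipSecond)) X true right pre false (true ∷ R) (cong isAccept (proj₁ s2)) (increment-transition x setFirst S2 (proj₁ s2)) ta2 eh2
    S3 = next S2
    ta3 = TapeAt-subst S3 X (cong encBits (sym (++-assoc pre (true ∷ []) (true ∷ R)))) (proj₁ (proj₂ s3))
    eh3 = trans (proj₁ (proj₂ (proj₂ s3))) (sym (length-snoc pre true))
    s4 = skipBit-step S3 (ctl (increment x readPair)) X right (pre ++ true ∷ []) true R (cong isAccept (proj₁ s3)) (increment-transition x skipSecond S3 (proj₁ s3)) ta3 eh3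
    S4 = next S3
    ta4 = TapeAt-subst S4 X (cong encBits (trans (++-assoc pre (true ∷ []) (true ∷ R)) (sym (++-assoc pre (true ∷ true ∷ []) R)))) (proj₁ (proj₂ s4))
    eh4 : hd S4 X ≡ length (pre ++ true ∷ true ∷ [])
    eh4 = trans (proj₁ (proj₂ (proj₂ s4))) (trans (cong suc (length-snoc pre true)) (sym (length-snoc₂ pre true true)))
    IH = increment-run-impl x r (pre ++ true ∷ true ∷ []) S4 (proj₁ s4) ta4 eh4
  increment-run-impl x [] pre S est ta eh =
    6 , proj₁ s6 , TapeAt-subst S6 X (cong encBits fin) (proj₁ (proj₂ s6)) ,
      Frame-trans {X} {S} {S5} {S6} (Frame-trans {X} {S} {S4} {S5} (Frame-trans {X} {S} {S3} {S4} (Frame-trans {X} {S} {S2} {S3} (Frame-trans {X} {S} {S1} {S2} (proj₂ (proj₂ (proj₂ s1))) (proj₂ (proj₂ (proj₂ s2)))) (proj₂ (proj₂ (proj₂ s3)))) (proj₂ (proj₂ (proj₂ s4)))) (proj₂ (proj₂ (proj₂ s5)))) (proj₂ (proj₂ (proj₂ s6)))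
    where
    X = ctrTape x
    e1 = trans (increment-transition x readPair S est) (cong (incTransition (reads S) x readPair) (TapeAt-bitOf S X pre false (true ∷ []) ta eh))
    s1 = skipBit-step S (ctl (increment x readSecond)) X right pre false (true ∷ []) (cong isAccept est) e1 ta eh
    S1 = next S
    ta1 = TapeAt-subst S1 X (cong encBits (sym (++-assoc pre (false ∷ []) (true ∷ [])))) (proj₁ (proj₂ s1))
    eh1 = trans (proj₁ (proj₂ (proj₂ s1))) (sym (length-snoc pre false))
    e2 = trans (increment-transition x readSecond S1 (proj₁ s1)) (cong (incTransition (reads S1) x readSecond) (TapeAt-bitOf S1 X (pre ++ false ∷ []) true [] ta1 eh1))
    s2 = overwriteBit-step S1 (ctl (increment x growFirst)) X true left (pre ++ false ∷ []) true [] (cong isAccept (proj₁ s1)) e2 ta1 eh1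
    S2 = next S1
    ta2 = TapeAt-subst S2 X (cong encBits (++-assoc pre (false ∷ []) (true ∷ []))) (proj₁ (proj₂ s2))
    eh2 : hd S2 X ≡ length pre
    eh2 = trans (proj₁ (proj₂ (proj₂ s2))) (cong (moveHead left) (length-snoc pre false))
    s3 = overwriteBit-step S2 (ctl (increment x growSkip)) X true right pre false (true ∷ []) (cong isAccept (proj₁ s2)) (increment-transition x growFirst S2 (proj₁ s2)) ta2 eh2
    S3 = next S2
    ta3 = TapeAt-subst S3 X (cong encBits (sym (++-assoc pre (true ∷ []) (true ∷ [])))) (proj₁ (proj₂ s3))
    eh3 = trans (proj₁ (proj₂ (proj₂ s3))) (sym (length-snoc pre true))
    s4 = skipBit-step S3 (ctl (increment x newTerm0)) X right (pre ++ true ∷ []) true [] (cong isAccept (proj₁ s3)) (increment-transition x growSkip S3 (proj₁ s3)) ta3 eh3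
    S4 = next S3
    cs = pre ++ true ∷ true ∷ []
    ta4 = TapeAt-subst S4 X (cong encBits (++-assoc pre (true ∷ []) (true ∷ []))) (proj₁ (proj₂ s4))
    eh4 : hd S4 X ≡ length cs
    eh4 = trans (proj₁ (proj₂ (proj₂ s4))) (trans (cong suc (length-snoc pre true)) (sym (length-snoc₂ pre true true)))
    s5 = appendBit-step S4 (ctl (increment x newTerm1)) X false right cs (cong isAccept (proj₁ s4)) (increment-transition x newTerm0 S4 (proj₁ s4)) ta4 eh4
    S5 = next S4
    eh5 = trans (proj₁ (proj₂ (proj₂ s5))) (sym (length-snoc cs false))
    s6 = appendBit-step S5 (ctl (rewind (ctrRewind x))) X true stay (cs ++ false ∷ []) (cong isAccept (proj₁ s5)) (increment-transition x newTerm1 S5 (proj₁ s5)) (proj₁ (proj₂ s5)) eh5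
    S6 = next S5
    fin : (cs ++ false ∷ []) ++ true ∷ [] ≡ pre ++ selfDelim (incBits [])
    fin = trans (++-assoc cs (false ∷ []) (true ∷ [])) (++-assoc pre (true ∷ true ∷ []) (false ∷ true ∷ []))

  opaque
    increment-run : ∀ x bs pre S → st S ≡ ctl (increment x readPair) → TapeAt S (ctrTape x) (encBits (pre ++ selfDelim bs)) → hd S (ctrTape x) ≡ length pre
      → ∃ λ c → Incremented x S (run S c) (encBits (pre ++ selfDelim (incBits bs)))
    increment-run = increment-run-impl

  PrefixAt : (ℕ → Sym) → ℕ → List Bool → Set
  PrefixAt f h []       = ⊤
  PrefixAt f h (b ∷ bs) = bitOf (f h) ≡ just b × PrefixAt f (suc h) bs

  PrefixAt-cong : ∀ {f g} h bs → (∀ i → g i ≡ f i) → PrefixAt f h bs → PrefixAt g h bs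
  PrefixAt-cong h []       g≗f _          = tt
  PrefixAt-cong h (b ∷ bs) g≗f (bit , bs′) = trans (cong bitOf (g≗f h)) bit , PrefixAt-cong (suc h) bs g≗f bs′

  ¬b∧b : ∀ b → (not b ∧ b) ≡ false
  ¬b∧b false = refl
  ¬b∧b true  = refl

  parse-pair : ∀ x b₁ b₂ S → st S ≡ ctl (parseFirst x) →
               bitOf (tp S tW (hd S tW)) ≡ just b₁ → bitOf (tp S tW (suc (hd S tW))) ≡ just b₂ →
               st (next (next S)) ≡ (if not b₁ ∧ b₂ then afterParse x else ctl (parseFirst x))
               × Copied (λ j → eqF j (targetTape x)) writeBit tW (b₁ ∷ b₂ ∷ []) S (next (next S))
  parse-pair x b₁ b₂ S refl bit₁ bit₂ = proj₁ second , Copied-++ (proj₂ first) (proj₂ second)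
    where
    D = λ j → eqF j (targetTape x)
    first = copy-step S (ctl (parseSecond x b₁)) tW D writeBit b₁ refl
      (cong (parseStep (reads S) x nothing) (trans (cong bitOf (lookup-reads S tW)) bit₁))
    S₁ = next S
    bit₂′ : bitOf (lookup (reads S₁) tW) ≡ just b₂
    bit₂′ = trans (cong bitOf (lookup-reads S₁ tW))
      (trans (cong bitOf (Copied.source-tape (proj₂ first) (hd S₁ tW)))
      (trans (cong (λ h → bitOf (tp S tW h)) (trans (Copied.source-head (proj₂ first)) (NP.+-comm (hd S tW) 1))) bit₂))
    second = copy-step S₁ _ tW D writeBit b₂ (cong isAccept (proj₁ first))
      (trans (cong (λ s → δS s (reads S₁)) (proj₁ first)) (cong (parseStep (reads S₁) x (just b₁)) bit₂′))

  parse-run-impl : ∀ x bs S → st S ≡ ctl (parseFirst x) → PrefixAt (tp S tW) (hd S tW) (selfDelim bs) →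
              ∃ λ c → st (run S c) ≡ afterParse x × Copied (λ j → eqF j (targetTape x)) writeBit tW (selfDelim bs) S (run S c)
  parse-run-impl x [] S e (bit₁ , bit₂ , _) = 2 , pair
    where pair = parse-pair x false true S e bit₁ bit₂
  parse-run-impl x (b ∷ bs) S e (bit₁ , bit₂ , rest) =
    2 + proj₁ IH , proj₁ (proj₂ IH) , Copied-++ (proj₂ pair) (proj₂ (proj₂ IH))
    where
    pair = parse-pair x b b S e bit₁ bit₂
    S₂ = next (next S)
    IH = parse-run-impl x bs S₂ (trans (proj₁ pair) (cong (λ c → if c then afterParse x else ctl (parseFirst x)) (¬b∧b b)))
      (subst (λ h → PrefixAt (tp S₂ tW) h (selfDelim bs)) (trans (NP.+-comm 2 (hd S tW)) (sym (Copied.source-head (proj₂ pair))))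
        (PrefixAt-cong _ (selfDelim bs) (Copied.source-tape (proj₂ pair)) rest))

  opaque
    parse-run : ∀ x bs S → st S ≡ ctl (parseFirst x) → PrefixAt (tp S tW) (hd S tW) (selfDelim bs) →
                ∃ λ c → st (run S c) ≡ afterParse x × Copied (λ j → eqF j (targetTape x)) writeBit tW (selfDelim bs) S (run S c)
    parse-run = parse-run-impl

  compare-transition : ∀ S → st S ≡ ctl compareBound → transition S ≡ compareStep (reads S) (bitOf (tp S tT (hd S tT))) (bitOf (tp S tR (hd S tR)))
  compare-transition (snapshot .(ctl compareBound) tp hd) refl = refl

  CompareFrame : Snapshot → Snapshot → Set
  CompareFrame S S' = (∀ j i → tp S' j i ≡ tp S j i) × (∀ j → eqF j tT ≡ false → eqF j tR ≡ false → hd S' j ≡ hd S j)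


  advanceTR-symbol : ∀ S j → proj₁ (advanceTR (reads S) j) ≡ lookup (reads S) j
  advanceTR-symbol S j with eqF j tR in e1
  ... | true rewrite eqF-sound j tR e1 = refl
  ... | false with eqF j tT in e2
  ... | true rewrite eqF-sound j tT e2 = refl
  ... | false = refl

  advanceTR-move : ∀ S j → eqF j tT ≡ false → eqF j tR ≡ false → proj₂ (advanceTR (reads S) j) ≡ stay
  advanceTR-move S j e1 e2 rewrite e1 | e2 = refl

  advanceTR-step : ∀ S s' → isAccept (st S) ≡ false → transition S ≡ (s' , advanceTR (reads S)) →
    st (next S) ≡ s' × hd (next S) tT ≡ suc (hd S tT) × hd (next S) tR ≡ suc (hd S tR) × CompareFrame S (next S)
  advanceTR-step S s' na e = Effect.state si , Effect.head si tT , Effect.head si tR ,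
    (λ j i → trans (Effect.tape si j i) (trans (cong (λ z → updateAt (tp S j) (hd S j) z i) (trans (advanceTR-symbol S j) (lookup-reads S j))) (updateAt-same (tp S j) (hd S j) i))) ,
    λ j e1 e2 → trans (Effect.head si j) (cong (λ z → moveHead z (hd S j)) (advanceTR-move S j e1 e2))
    where si = effect S s' (advanceTR (reads S)) na e

  idle-compareFrame : ∀ S s' → isAccept (st S) ≡ false → transition S ≡ (s' , idle (reads S)) → st (next S) ≡ s' × CompareFrame S (next S)
  idle-compareFrame S s' na e = proj₁ ak , (λ j i → proj₂ (proj₂ ak j) i) , λ j _ _ → proj₁ (proj₂ ak j)
    where ak = idle-step S s' na e

  Compared : List Bool → List Bool → Snapshot → Set
  Compared xs ys S' = (xs ≡ ys → st S' ≡ ctl (rewind rwDone)) × (¬ xs ≡ ys → st S' ≡ ctl (rewind rwNext))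

  sameBit-sound : ∀ a b → sameBit a b ≡ true → a ≡ b
  sameBit-sound false false e = refl
  sameBit-sound true true e = refl

  sameBit-refl : ∀ a → sameBit a a ≡ true
  sameBit-refl false = refl
  sameBit-refl true = refl


  compare-run-impl : ∀ xs ys S → st S ≡ ctl compareBound → BitsAt (tp S tT) (hd S tT) xs → BitsAt (tp S tR) (hd S tR) ys
    → ∃ λ c → Compared xs ys (run S c) × CompareFrame S (run S c)
  compare-run-impl [] [] S est (bits-end x) (bits-end y) = 1 , ((λ _ → proj₁ k) , λ ne → ⊥-elim (ne refl)) , proj₂ k
    where k = idle-compareFrame S (ctl (rewind rwDone)) (cong isAccept est) (trans (compare-transition S est) (cong₂ (compareStep (reads S)) x y))
  compare-run-impl [] (b ∷ ys) S est (bits-end x) (bits-∷ y _) = 1 , ((λ ()) , λ _ → proj₁ k) , proj₂ k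
    where k = idle-compareFrame S (ctl (rewind rwNext)) (cong isAccept est) (trans (compare-transition S est) (cong₂ (compareStep (reads S)) x y))
  compare-run-impl (a ∷ xs) [] S est (bits-∷ x _) (bits-end y) = 1 , ((λ ()) , λ _ → proj₁ k) , proj₂ k
    where k = idle-compareFrame S (ctl (rewind rwNext)) (cong isAccept est) (trans (compare-transition S est) (cong₂ (compareStep (reads S)) x y))
  compare-run-impl (a ∷ xs) (b ∷ ys) S est (bits-∷ x sx) (bits-∷ y sy) = go (sameBit a b) refl
    where
    e0 = trans (compare-transition S est) (cong₂ (compareStep (reads S)) x y)
    go : ∀ q → sameBit a b ≡ q → ∃ λ c → Compared (a ∷ xs) (b ∷ ys) (run S c) × CompareFrame S (run S c)
    go false q = 1 , ((λ e → ⊥-elim (neq (cong (λ l → L.head l) e))) , λ _ → proj₁ k) , proj₂ k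
      where
      k = idle-compareFrame S (ctl (rewind rwNext)) (cong isAccept est) (trans e0 (cong (λ z → if z then (ctl compareBound , advanceTR (reads S)) else (ctl (rewind rwNext) , idle (reads S))) q))
      neq : just a ≡ just b → ⊥
      neq refl with trans (sym (sameBit-refl a)) q
      ... | ()
    go true q = suc (proj₁ IH) , ((λ e → proj₁ (proj₁ (proj₂ IH)) (LP.∷-injectiveʳ e)) , λ ne → proj₂ (proj₁ (proj₂ IH)) λ e' → ne (cong₂ _∷_ (sameBit-sound a b q) e')) ,
        (λ j i → trans (proj₁ (proj₂ (proj₂ IH)) j i) (proj₁ m j i)) , λ j e1 e2 → trans (proj₂ (proj₂ (proj₂ IH)) j e1 e2) (proj₂ m j e1 e2)
      where
      mm = advanceTR-step S (ctl compareBound) (cong isAccept est) (trans e0 (cong (λ z → if z then (ctl compareBound , advanceTR (reads S)) else (ctl (rewind rwNext) , idle (reads S))) q))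
      S1 = next S
      m = proj₂ (proj₂ (proj₂ mm))
      sx' : BitsAt (tp S1 tT) (hd S1 tT) xs
      sx' = subst (λ z → BitsAt (tp S1 tT) z xs) (sym (proj₁ (proj₂ mm))) (BitsAt-cong (proj₁ m tT) sx)
      sy' : BitsAt (tp S1 tR) (hd S1 tR) ys
      sy' = subst (λ z → BitsAt (tp S1 tR) z ys) (sym (proj₁ (proj₂ (proj₂ mm)))) (BitsAt-cong (proj₁ m tR) sy)
      IH = compare-run-impl xs ys S1 (proj₁ mm) sx' sy'

  opaque
    compare-run : ∀ xs ys S → st S ≡ ctl compareBound → BitsAt (tp S tT) (hd S tT) xs → BitsAt (tp S tR) (hd S tR) ys
      → ∃ λ c → Compared xs ys (run S c) × CompareFrame S (run S c)
    compare-run = compare-run-impl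

  byTape-idle : ∀ v (f : Fin (suc kA) → Action) j → isATape j ≡ false →
    byTape (idle v tO) (idle v tY) (idle v tW) (idle v tT) (idle v tR) (idle v tN) (idle v tB) f j ≡ idle v j
  byTape-idle v f fz e = refl
  byTape-idle v f (fs fz) e = refl
  byTape-idle v f (fs (fs fz)) e = refl
  byTape-idle v f (fs (fs (fs fz))) e = refl
  byTape-idle v f (fs (fs (fs (fs fz)))) e = refl
  byTape-idle v f (fs (fs (fs (fs (fs fz))))) e = refl
  byTape-idle v f (fs (fs (fs (fs (fs (fs fz)))))) e = refl
  byTape-idle v f (fs (fs (fs (fs (fs (fs (fs j))))))) ()

  erased : ℕ → Sym
  erased zero = cell fz true
  erased (suc _) = □

  record Erasing (f : ℕ → Sym) (h : ℕ) (l : List ΓA) (m : ℕ) : Set where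
    constructor erasing
    field
      h≤m : h ≤ m
      m≥1 : 1 ≤ m
      below : ∀ i → i < h → f i ≡ erased i
      mid : ∀ i → h ≤ i → i < m → f i ≡ cell (readCell l i) (isOrigin i)
      above : ∀ i → m ≤ i → f i ≡ □
  open Erasing

  Erasing-start : ∀ {f l m} → Holds f l m → Erasing f 0 l m
  Erasing-start t = erasing z≤n (pos t) (λ i ()) (λ i _ q → lo t i q) (λ i q → proj₁ (hi t i q))

  ErasingWithin : Snapshot → Fin (suc kA) → ℕ → Set
  ErasingWithin S j n = ∃ λ m → ∃ λ l → Erasing (tp S (tA j)) (hd S (tA j)) l m × m ≤ hd S (tA j) + n

  eraseA-transition : ∀ S → st S ≡ ctl eraseA → transition S ≡
    ((if allFin (suc kA) (λ j → is□ (lookup (reads S) (tA j))) then ctl (rewind rwErased) else ctl eraseA) ,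
     byTape (idle (reads S) tO) (idle (reads S) tY) (idle (reads S) tW) (idle (reads S) tT) (idle (reads S) tR) (idle (reads S) tN) (idle (reads S) tB)
         (λ j → eraseAction (lookup (reads S) (tA j))))
  eraseA-transition (snapshot .(ctl eraseA) tp hd) refl = refl

  allAtBlank : Snapshot → Bool
  allAtBlank S = allFin (suc kA) (λ j → is□ (tp S (tA j) (hd S (tA j))))

  Erasing-step : ∀ {f l m h} → Erasing f h l m → (h < m → Erasing (updateAt f h (erased h)) (suc h) l m) × (h ≡ m → ∀ i → updateAt f h □ i ≡ f i)
  Erasing-step {f} {l} {m} {h} e = st1 , st2
    where
    st1 : h < m → Erasing (updateAt f h (erased h)) (suc h) l m
    st1 h<m = erasing h<m (m≥1 e) b md ab
      where
      b : ∀ i → i < suc h → updateAt f h (erased h) i ≡ erased i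
      b i (s≤s q) with i N.≡ᵇ h in eq
      ... | true = cong erased (sym (≡ᵇ-true i h eq))
      ... | false with NP.m≤n⇒m<n∨m≡n q
      ... | inj₁ r = below e i r
      ... | inj₂ r = ⊥-elim (≡ᵇ-false i h eq r)
      md : ∀ i → suc h ≤ i → i < m → updateAt f h (erased h) i ≡ cell (readCell l i) (isOrigin i)
      md i q r rewrite ≢⇒≡ᵇ i h (λ ee → NP.<-irrefl (sym ee) q) = mid e i (≤-trans (n≤1+n h) q) r
      ab : ∀ i → m ≤ i → updateAt f h (erased h) i ≡ □
      ab i q rewrite ≢⇒≡ᵇ i h (λ ee → NP.<-irrefl refl (≤-trans (subst (λ z → suc z ≤ m) (sym ee) h<m) q)) = above e i q
    st2 : h ≡ m → ∀ i → updateAt f h □ i ≡ f i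
    st2 refl i with i N.≡ᵇ h in eq
    ... | true = trans (sym (above e h ≤-refl)) (cong f (sym (≡ᵇ-true i h eq)))
    ... | false = refl

  Erasing-at-blank : ∀ {f l m h} → Erasing f h l m → is□ (f h) ≡ true → h ≡ m
  Erasing-at-blank {f} {l} {m} {h} e b with NP.m≤n⇒m<n∨m≡n (h≤m e)
  ... | inj₂ r = r
  ... | inj₁ r with f h | mid e h ≤-refl r
  ... | .(cell _ _) | refl = ⊥-elim (case b)
    where case : false ≡ true → ⊥
          case ()

  Erasing-< : ∀ {f l m h} → Erasing f h l m → h < m → f h ≡ cell (readCell l h) (isOrigin h)
  Erasing-< e r = mid e _ ≤-refl r

  Erasing-≡ : ∀ {f l m h} → Erasing f h l m → h ≡ m → f h ≡ □
  Erasing-≡ e refl = above e _ ≤-refl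

  Erasing-done : ∀ {f l m h} → Erasing f h l m → h ≡ m → ∀ i → f i ≡ erased i
  Erasing-done {f} {l} {m} {h} e refl i with NP.<-≤-connex i h
  ... | inj₁ r = below e i r
  ... | inj₂ r = trans (above e i r) (lem i (≤-trans (m≥1 e) r))
    where lem : ∀ i → 1 ≤ i → □ ≡ erased i
          lem (suc i) _ = refl

  eraseAction-cell : ∀ a h → eraseAction (cell a (isOrigin h)) ≡ (erased h , right)
  eraseAction-cell a zero = refl
  eraseAction-cell a (suc h) = refl

  Erased : Snapshot → Snapshot → Set
  Erased S S' = st S' ≡ ctl (rewind rwErased) × (∀ j i → tp S' (tA j) i ≡ erased i) × (∀ j → isATape j ≡ false → Unchanged S S' j)

  Erasing-cong : ∀ {f g h l m} → (∀ i → g i ≡ f i) → Erasing f h l m → Erasing g h l m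
  Erasing-cong e (erasing a b c d f) = erasing a b (λ i q → trans (e i) (c i q)) (λ i q r → trans (e i) (d i q r)) (λ i q → trans (e i) (f i q))

  erase-tape-step : ∀ (f f' : ℕ → Sym) h h' n → (∃ λ m → ∃ λ l → Erasing f h l m × m ≤ h + suc n)
    → (∀ i → f' i ≡ updateAt f h (proj₁ (eraseAction (f h))) i) → h' ≡ moveHead (proj₂ (eraseAction (f h))) h
    → ∃ λ m → ∃ λ l → Erasing f' h' l m × m ≤ h' + n
  erase-tape-step f f' h h' n (m , l , e , b) ef eh with NP.m≤n⇒m<n∨m≡n (h≤m e)
  ... | inj₁ h<m = m , l , subst (λ z → Erasing f' z l m) (sym eh') (Erasing-cong ef' (proj₁ (Erasing-step e) h<m)) , subst (λ z → m ≤ z + n) (sym eh') (subst (m ≤_) (+-suc h n) b)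
    where
    ea : eraseAction (f h) ≡ (erased h , right)
    ea = trans (cong eraseAction (Erasing-< e h<m)) (eraseAction-cell (readCell l h) h)
    ef' : ∀ i → f' i ≡ updateAt f h (erased h) i
    ef' i = trans (ef i) (cong (λ z → updateAt f h (proj₁ z) i) ea)
    eh' : h' ≡ suc h
    eh' = trans eh (cong (λ z → moveHead (proj₂ z) h) ea)
  ... | inj₂ h≡m = m , l , subst (λ z → Erasing f' z l m) (sym eh') (Erasing-cong (λ i → trans (ef' i) (proj₂ (Erasing-step e) h≡m i)) e) , subst (λ z → m ≤ z + n) (sym eh') (subst (_≤ h + n) h≡m (NP.m≤m+n h n))
    where
    ea : eraseAction (f h) ≡ (□ , stay)
    ea = cong eraseAction (Erasing-≡ e h≡m)
    ef' : ∀ i → f' i ≡ updateAt f h □ i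
    ef' i = trans (ef i) (cong (λ z → updateAt f h (proj₁ z) i) ea)
    eh' : h' ≡ h
    eh' = trans eh (cong (λ z → moveHead (proj₂ z) h) ea)

  erase-run-impl : ∀ n S → st S ≡ ctl eraseA → (∀ j → ErasingWithin S j n) → ∃ λ c → Erased S (run S c)
  erase-run-impl n S est H = go n H (allAtBlank S) refl
    where
    v = reads S
    acts = byTape (idle v tO) (idle v tY) (idle v tW) (idle v tT) (idle v tR) (idle v tN) (idle v tB) (λ j → eraseAction (lookup v (tA j)))
    dn : allFin (suc kA) (λ j → is□ (lookup v (tA j))) ≡ allAtBlank S
    dn = allFin-cong (suc kA) (λ j → cong is□ (lookup-reads S (tA j)))
    s1 = if allAtBlank S then ctl (rewind rwErased) else ctl eraseA
    si = effect S s1 acts (cong isAccept est) (trans (eraseA-transition S est) (cong (λ z → (if z then ctl (rewind rwErased) else ctl eraseA) , acts) dn))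
    S1 = next S
    ownS : ∀ j → isATape j ≡ false → Unchanged S S1 j
    ownS j e = idle-unchanged S s1 acts j si (trans (byTape-idle v _ j e) (idle-reads S j))
    tpA : ∀ j i → tp S1 (tA j) i ≡ updateAt (tp S (tA j)) (hd S (tA j)) (proj₁ (eraseAction (tp S (tA j) (hd S (tA j))))) i
    tpA j i = trans (Effect.tape si (tA j) i) (cong (λ z → updateAt (tp S (tA j)) (hd S (tA j)) (proj₁ (eraseAction z)) i) (lookup-reads S (tA j)))
    hdA : ∀ j → hd S1 (tA j) ≡ moveHead (proj₂ (eraseAction (tp S (tA j) (hd S (tA j))))) (hd S (tA j))
    hdA j = trans (Effect.head si (tA j)) (cong (λ z → moveHead (proj₂ (eraseAction z)) (hd S (tA j))) (lookup-reads S (tA j)))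
    allEq : allAtBlank S ≡ true → ∀ j → ∃ λ m → ∃ λ l → Erasing (tp S (tA j)) (hd S (tA j)) l m × hd S (tA j) ≡ m
    allEq d j = proj₁ (H j) , proj₁ (proj₂ (H j)) , proj₁ (proj₂ (proj₂ (H j))) ,
      Erasing-at-blank (proj₁ (proj₂ (proj₂ (H j)))) (allFin-sound (suc kA) (λ j → is□ (tp S (tA j) (hd S (tA j)))) d j)
    go : ∀ n → (∀ j → ErasingWithin S j n) → ∀ b → allAtBlank S ≡ b → ∃ λ c → Erased S (run S c)
    go n H true d = 1 , trans (Effect.state si) (cong (λ z → if z then ctl (rewind rwErased) else ctl eraseA) d) , fin , ownS
      where
      fin : ∀ j i → tp S1 (tA j) i ≡ erased i
      fin j i = trans (tpA j i) (trans (cong (λ z → updateAt (tp S (tA j)) (hd S (tA j)) (proj₁ (eraseAction z)) i) (Erasing-≡ e hm))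
                  (trans (proj₂ (Erasing-step e) hm i) (Erasing-done e hm i)))
        where
        ae = allEq d j
        e = proj₁ (proj₂ (proj₂ ae))
        hm = proj₂ (proj₂ (proj₂ ae))
    go zero H false d = ⊥-elim (f≢t (trans (sym d) (allFin-complete (suc kA) _ λ j → bl j)))
      where
      f≢t : false ≡ true → ⊥
      f≢t ()
      bl : ∀ j → is□ (tp S (tA j) (hd S (tA j))) ≡ true
      bl j = cong is□ (Erasing-≡ e (NP.≤-antisym (h≤m e) (subst (proj₁ (H j) ≤_) (+-identityʳ _) b)))
        where
        e = proj₁ (proj₂ (proj₂ (H j)))
        b = proj₂ (proj₂ (proj₂ (H j)))
    go (suc n') H false d = suc (proj₁ IH) , proj₁ (proj₂ IH) , proj₁ (proj₂ (proj₂ IH)) ,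
        λ j e → Unchanged-trans {S} {S1} {run S1 (proj₁ IH)} j (ownS j e) (proj₂ (proj₂ (proj₂ IH)) j e)
      where
      est1 : st S1 ≡ ctl eraseA
      est1 = trans (Effect.state si) (cong (λ z → if z then ctl (rewind rwErased) else ctl eraseA) d)
      H1 : ∀ j → ErasingWithin S1 j n'
      H1 j = erase-tape-step (tp S (tA j)) (tp S1 (tA j)) (hd S (tA j)) (hd S1 (tA j)) n' (H j) (tpA j) (hdA j)
      IH = erase-run-impl n' S1 est1 H1

  opaque
    erase-run : ∀ n S → st S ≡ ctl eraseA → (∀ j → ErasingWithin S j n) → ∃ λ c → Erased S (run S c)
    erase-run = erase-run-impl

  -- Simulating A

  Simulates : Snapshot → Config A → Set
  Simulates S cA = st S ≡ sim (Config.state cA) ×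
    (∀ j → ∃ λ m → Holds (tp S (tA j)) (lookup (Config.tapes cA) j) m × hd S (tA j) ≡ lookup (Config.heads cA) j × hd S (tA j) ≤ m)

  sim-transition : ∀ q S → st S ≡ sim q → transition S ≡ simStep (reads S) q (isHalting A q)
  sim-transition q (snapshot .(sim q) tp hd) refl = refl

  sim-halt-step : ∀ S cA → Simulates S cA → isHalting A (Config.state cA) ≡ true → st (next S) ≡ ctl (rewind rwOutput) × (∀ j → Unchanged S (next S) j)
  sim-halt-step S cA (est , _) h = idle-step S (ctl (rewind rwOutput)) (cong isAccept est) (trans (sim-transition _ S est) (cong (simStep (reads S) (Config.state cA)) h))

  sim-step : ∀ S cA → Simulates S cA → isHalting A (Config.state cA) ≡ false → Simulates (next S) (step A cA) × (∀ j → isATape j ≡ false → Unchanged S (next S) j)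
  sim-step S (config q ts hs) (est , TRs) hq =
    subst (Simulates S1) (sym (trans (step-unfold A q ts hs) (cong (λ b → stepResult A b resA q ts hs) hq))) (st1 , tps) , others
    where
    v = reads S
    vA = tabulate (λ j → aSymbol (lookup v (tA j)))
    eqv : vA ≡ V.zipWith readCell ts hs
    eqv = trans (tabulate-cong {f = λ j → aSymbol (lookup v (tA j))} {g = lookup (V.zipWith readCell ts hs)} pw) (tabulate∘lookup (V.zipWith readCell ts hs))
      where
      pw : ∀ j → aSymbol (lookup v (tA j)) ≡ lookup (V.zipWith readCell ts hs) j
      pw j = trans (cong aSymbol (lookup-reads S (tA j))) (trans (Holds-aSymbol (proj₁ (proj₂ (TRs j))) (hd S (tA j)))
               (trans (cong (readCell (lookup ts j)) (proj₁ (proj₂ (proj₂ (TRs j))))) (sym (lookup-zipWith readCell j ts hs))))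
    res = TM.δ A q vA
    resA = TM.δ A q (V.zipWith readCell ts hs)
    eres : res ≡ resA
    eres = cong (TM.δ A q) eqv
    acts = byTape (idle v tO) (idle v tY) (idle v tW) (idle v tT) (idle v tR) (idle v tN) (idle v tB)
        (λ j → writeA (lookup v (tA j)) (proj₁ (lookup (proj₂ res) j)) , proj₂ (lookup (proj₂ res) j))
    si = effect S (sim (proj₁ res)) acts (cong isAccept est) (trans (sim-transition q S est) (cong (simStep v q) hq))
    S1 = next S
    st1 : st S1 ≡ sim (proj₁ resA)
    st1 = trans (Effect.state si) (cong (λ r → sim (proj₁ r)) eres)
    others : ∀ j → isATape j ≡ false → Unchanged S S1 j
    others j e = idle-unchanged S (sim (proj₁ res)) acts j si (trans (byTape-idle v _ j e) (idle-reads S j))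
    asA = proj₂ resA
    tps : ∀ j → ∃ λ m → Holds (tp S1 (tA j)) (lookup (V.zipWith writeAt (V.zip ts hs) asA) j) m
            × hd S1 (tA j) ≡ lookup (V.zipWith moveAt hs asA) j × hd S1 (tA j) ≤ m
    tps j = proj₁ tw , Holds-cong tpe (subst (λ l → Holds (updateAt f h (writeA (f h) (proj₁ aj))) l (proj₁ tw)) (sym lst) (proj₁ (proj₂ tw))) , he ,
            subst (_≤ proj₁ tw) (sym he') (≤-trans (moveHead-le (proj₂ aj) h) (proj₁ (proj₂ (proj₂ tw))))
      where
      f = tp S (tA j)
      h = hd S (tA j)
      aj = lookup asA j
      t = proj₁ (proj₂ (TRs j))
      eh = proj₁ (proj₂ (proj₂ (TRs j)))
      tw = Holds-write h (proj₁ aj) t (proj₂ (proj₂ (proj₂ (TRs j))))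
      tpe : ∀ i → tp S1 (tA j) i ≡ updateAt f h (writeA (f h) (proj₁ aj)) i
      tpe i = trans (Effect.tape si (tA j) i) (cong₂ (λ x r → updateAt f h (writeA x (proj₁ (lookup (proj₂ r) j))) i) (lookup-reads S (tA j)) eres)
      lst : lookup (V.zipWith writeAt (V.zip ts hs) asA) j ≡ writeCell (lookup ts j) h (proj₁ aj)
      lst = trans (lookup-zipWith writeAt j (V.zip ts hs) asA) (trans (cong (λ p → writeAt p aj) (lookup-zip j ts hs))
              (cong (λ z → writeCell (lookup ts j) z (proj₁ aj)) (sym eh)))
      he' : hd S1 (tA j) ≡ moveHead (proj₂ aj) h
      he' = trans (Effect.head si (tA j)) (cong (λ r → moveHead (proj₂ (lookup (proj₂ r) j)) h) eres)
      he : hd S1 (tA j) ≡ lookup (V.zipWith moveAt hs asA) j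
      he = trans he' (trans (cong (λ z → moveHead (proj₂ aj) z) eh) (sym (lookup-zipWith moveAt j hs asA)))

  sim-run-impl : ∀ n S c → Simulates S c → (∀ k → k < n → isHalting A (Config.state (runFrom A c k)) ≡ false)
    → Simulates (run S n) (runFrom A c n) × (∀ j → isATape j ≡ false → Unchanged S (run S n) j)
  sim-run-impl zero S c r h = r , λ j _ → Unchanged-refl S j
  sim-run-impl (suc n) S c r h = proj₁ IH , λ j e → Unchanged-trans {S} {next S} {run (next S) n} j (proj₂ s1 j e) (proj₂ IH j e)
    where
    s1 = sim-step S c r (h 0 (s≤s z≤n))
    IH = sim-run-impl n (next S) (step A c) (proj₁ s1) (λ k q → h (suc k) (s≤s q))

  opaque
    sim-run : ∀ n S c → Simulates S c → (∀ k → k < n → isHalting A (Config.state (runFrom A c k)) ≡ false)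
      → Simulates (run S n) (runFrom A c n) × (∀ j → isATape j ≡ false → Unchanged S (run S n) j)
    sim-run = sim-run-impl

  HoldsOn : Snapshot → Fin nTapes → List ΓA → Set
  HoldsOn S X l = ∃ λ m → Holds (tp S X) l m

  HoldsOn-cong : ∀ S S' X {l} → (∀ i → tp S' X i ≡ tp S X i) → HoldsOn S X l → HoldsOn S' X l
  HoldsOn-cong S S' X t (m , r) = m , Holds-cong t r

  TapeAt⇒HoldsOn : ∀ {S X l} → TapeAt S X l → HoldsOn S X l
  TapeAt⇒HoldsOn (m , r , _) = m , r

  HoldsOn⇒TapeAt : ∀ S X {l} → HoldsOn S X l → hd S X ≡ 0 → TapeAt S X l
  HoldsOn⇒TapeAt S X (m , r) e = m , r , subst (_≤ m) (sym e) z≤n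

  RawHolds-cong : ∀ S S' X {cs} → (∀ i → tp S' X i ≡ tp S X i) → RawHolds (tp S X) cs → RawHolds (tp S' X) cs
  RawHolds-cong S S' X t r i = trans (t i) (r i)

  HoldsOn-leftEnd : ∀ {S X l} → HoldsOn S X l → ∀ i → leftEnd (tp S X i) ≡ isOrigin i
  HoldsOn-leftEnd (m , r) = Holds-leftEnd r

  SameTape : Snapshot → Snapshot → Fin nTapes → Set
  SameTape S S' X = ∀ i → tp S' X i ≡ tp S X i

  readBits : ∀ bb i → i < length bb → ∃ λ y → readCell (encBits bb) i ≡ bitSym y
  readBits (b ∷ bb) zero _ = b , refl
  readBits (b ∷ bb) (suc i) (s≤s q) = readBits bb i q

  length≤extent : ∀ {f} bb {m} → Holds f (encBits bb) m → length bb ≤ m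
  length≤extent {f} bb {m} t with NP.<-≤-connex m (length bb)
  ... | inj₂ q = q
  ... | inj₁ q = ⊥-elim (bitSym≢blank (proj₁ rb) (trans (sym (proj₂ rb)) (proj₂ (hi t m ≤-refl))))
    where rb = readBits bb m q

  isATape-view : ∀ j → isATape j ≡ true → ∃ λ j' → j ≡ tA j'
  isATape-view (fs (fs (fs (fs (fs (fs (fs j))))))) e = j , refl

  ¬isATape-eqF : ∀ X j → isATape X ≡ false → eqF X (tA j) ≡ false
  ¬isATape-eqF fz                                j _ = refl
  ¬isATape-eqF (fs fz)                           j _ = refl
  ¬isATape-eqF (fs (fs fz))                      j _ = refl
  ¬isATape-eqF (fs (fs (fs fz)))                 j _ = refl
  ¬isATape-eqF (fs (fs (fs (fs fz))))            j _ = refl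
  ¬isATape-eqF (fs (fs (fs (fs (fs fz)))))       j _ = refl
  ¬isATape-eqF (fs (fs (fs (fs (fs (fs fz)))))) j _ = refl

  ¬isATape-isA₁ : ∀ X → isATape X ≡ false → isA₁ X ≡ false
  ¬isATape-isA₁ fz                                _ = refl
  ¬isATape-isA₁ (fs fz)                           _ = refl
  ¬isATape-isA₁ (fs (fs fz))                      _ = refl
  ¬isATape-isA₁ (fs (fs (fs fz)))                 _ = refl
  ¬isATape-isA₁ (fs (fs (fs (fs fz))))            _ = refl
  ¬isATape-isA₁ (fs (fs (fs (fs (fs fz)))))       _ = refl
  ¬isATape-isA₁ (fs (fs (fs (fs (fs (fs fz)))))) _ = refl

  erased-leftEnd : ∀ i → leftEnd (erased i) ≡ isOrigin i
  erased-leftEnd zero = refl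
  erased-leftEnd (suc i) = refl

  erased-holds-[] : ∀ {f} → (∀ i → f i ≡ erased i) → Holds f [] 1
  erased-holds-[] {f} e = holds (s≤s z≤n) lo' hi'
    where
    lo' : ∀ i → i < 1 → f i ≡ cell (readCell [] i) (isOrigin i)
    lo' zero _ = e zero
    lo' (suc i) (s≤s ())
    hi' : ∀ i → 1 ≤ i → f i ≡ □ × readCell [] i ≡ fz
    hi' (suc i) _ = e (suc i) , refl

  Unchanged-trans₃ : ∀ S1 S2 S3 j → Unchanged S1 S2 j → Unchanged S2 S3 j → Unchanged S1 S3 j
  Unchanged-trans₃ S1 S2 S3 j = Unchanged-trans {S1} {S2} {S3} j

  blank′ : ℕ → Sym
  blank′ _ = □

  initialTapes : List Bool → List Bool → Fin nTapes → ℕ → Sym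
  initialTapes p y = byTape (rawTape p) (rawTape y) blank′ blank′ blank′ blank′ blank′ (λ _ → blank′)

  initial : List Bool → List Bool → Snapshot
  initial p y = snapshot (ctl start) (initialTapes p y) (λ _ → 0)

  PrefixAt-readCell : ∀ (f : ℕ → Sym) h ys rest → (∀ i → bitOf (f (h + i)) ≡ bitOfΓ (readCell (encBits (ys ++ rest)) i)) → PrefixAt f h ys
  PrefixAt-readCell f h [] rest e = tt
  PrefixAt-readCell f h (y ∷ ys) rest e = trans (cong (λ z → bitOf (f z)) (sym (+-identityʳ h))) (trans (e 0) (bitOfΓ-bit y)) ,
    PrefixAt-readCell f (suc h) ys rest (λ i → trans (cong (λ z → bitOf (f z)) (sym (+-suc h i))) (e (suc i)))

  readCell-++ : ∀ xs ys i → readCell (encBits (xs ++ ys)) (length xs + i) ≡ readCell (encBits ys) i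
  readCell-++ [] ys i = refl
  readCell-++ (x ∷ xs) ys i = readCell-++ xs ys i

  record ATapesReset (S S′ : Snapshot) : Set where
    field
      state    : st S′ ≡ ctl loadSummary
      erased-A : ∀ j i → tp S′ (tA j) i ≡ erased i
      origin-A : ∀ j → hd S′ (tA j) ≡ 0
      others   : ∀ X → isATape X ≡ false → Unchanged S S′ X

  reset-A : ∀ S → st S ≡ ctl (rewind rwA) → (∀ j → ∃ λ l → HoldsOn S (tA j) l) → Reaches (ATapesReset S) S
  reset-A S e aTapes = reaches (c1 + (c2 + c3)) (subst (ATapesReset S) (sym runEq) record
    { state = Rewound.state R3 ; erased-A = er3 ; origin-A = h3 ; others = own03 })
    where
    le1 : ∀ j → rewinds rwA j ≡ true → ∀ i → leftEnd (tp S j i) ≡ isOrigin i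
    le1 j z with isATape-view j z
    ... | j' , refl = HoldsOn-leftEnd {S} {tA j'} (proj₂ (aTapes j'))
    rs1 = rewind-run rwA S e le1
    c1 = proj₁ rs1
    S1 = run S c1
    R1 = proj₂ rs1
    own1 : ∀ X → isATape X ≡ false → Unchanged S S1 X
    own1 X e = Rewound-unchanged R1 X e
    TA1 : ∀ j → TapeAt S1 (tA j) (proj₁ (aTapes j))
    TA1 j = HoldsOn⇒TapeAt S1 (tA j) (HoldsOn-cong S S1 (tA j) (Rewound.tapes R1 (tA j)) (proj₂ (aTapes j))) (Rewound.at-origin R1 (tA j) refl)
    n0 = sumF (suc kA) (λ j → proj₁ (TA1 j))
    H2 : ∀ j → ErasingWithin S1 j n0
    H2 j = proj₁ (TA1 j) , proj₁ (aTapes j) ,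
           subst (λ h → Erasing (tp S1 (tA j)) h (proj₁ (aTapes j)) (proj₁ (TA1 j))) (sym (Rewound.at-origin R1 (tA j) refl)) (Erasing-start (proj₁ (proj₂ (TA1 j)))) ,
           subst (λ h → proj₁ (TA1 j) ≤ h + n0) (sym (Rewound.at-origin R1 (tA j) refl)) (sumF-≥ (suc kA) (λ j → proj₁ (TA1 j)) j)
    rs2 = erase-run n0 S1 (Rewound.state R1) H2
    c2 = proj₁ rs2
    S2 = run S1 c2
    R2 = proj₂ rs2
    le3 : ∀ j → rewinds rwErased j ≡ true → ∀ i → leftEnd (tp S2 j i) ≡ isOrigin i
    le3 j z with isATape-view j z
    ... | j' , refl = λ i → trans (cong leftEnd (proj₁ (proj₂ R2) j' i)) (erased-leftEnd i)
    rs3 = rewind-run rwErased S2 (proj₁ R2) le3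
    c3 = proj₁ rs3
    S3 = run S2 c3
    R3 = proj₂ rs3
    own3 : ∀ X → isATape X ≡ false → Unchanged S2 S3 X
    own3 X e = Rewound-unchanged R3 X e
    er3 : ∀ j i → tp S3 (tA j) i ≡ erased i
    er3 j i = trans (Rewound.tapes R3 (tA j) i) (proj₁ (proj₂ R2) j i)
    h3 : ∀ j → hd S3 (tA j) ≡ 0
    h3 j = Rewound.at-origin R3 (tA j) refl
    own03 : ∀ X → isATape X ≡ false → Unchanged S S3 X
    own03 X e = Unchanged-trans₃ S S2 S3 X (Unchanged-trans₃ S S1 S2 X (own1 X e) (proj₂ (proj₂ R2) X e)) (own3 X e)
    runEq : run S (c1 + (c2 + c3)) ≡ S3
    runEq = trans (run-+ S c1 _) (run-+ S1 c2 c3)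

  record Initialised (σ : List Bool) (S : Snapshot) : Set where
    field
      state    : st S ≡ ctl copySummary
      heads    : ∀ j → hd S j ≡ 0
      out-blank′ : RawHolds (tp S tO) []
      summary  : RawHolds (tp S tY) σ
      counter  : Holds (tp S tN) (encBits (encℕ 0)) 2
      erased-X : ∀ X → isATape X ≡ false → eqF X tO ≡ false → eqF X tY ≡ false → eqF X tN ≡ false → ∀ i → tp S X i ≡ erased i
      erased-A : ∀ j i → tp S (tA j) i ≡ erased i

  initialised : ∀ σ → Initialised σ (next (next (initial [] σ)))
  initialised σ = record
    { state = refl ; heads = hd2 ; out-blank′ = oO2 ; summary = oY2 ; counter = N2 ; erased-X = erX ; erased-A = erA }
    where
    S1 = next (initial [] σ)
    S2 = next S1
    erX : ∀ X → isATape X ≡ false → eqF X tO ≡ false → eqF X tY ≡ false → eqF X tN ≡ false → ∀ i → tp S2 X i ≡ erased i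
    erX (fs (fs fz)) _ _ _ _ zero = refl
    erX (fs (fs fz)) _ _ _ _ (suc i) = refl
    erX (fs (fs (fs fz))) _ _ _ _ zero = refl
    erX (fs (fs (fs fz))) _ _ _ _ (suc i) = refl
    erX (fs (fs (fs (fs fz)))) _ _ _ _ zero = refl
    erX (fs (fs (fs (fs fz)))) _ _ _ _ (suc i) = refl
    erX (fs (fs (fs (fs (fs (fs fz)))))) _ _ _ _ zero = refl
    erX (fs (fs (fs (fs (fs (fs fz)))))) _ _ _ _ (suc i) = refl
    si12 = effect S1 (ctl copySummary) (override (idle (reads S1)) tN (cell bit1 false , left)) refl refl
    erA1 : ∀ j i → tp S1 (tA j) i ≡ erased i
    erA1 j zero = refl
    erA1 j (suc i) = refl
    erA : ∀ j i → tp S2 (tA j) i ≡ erased i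
    erA j i = trans (proj₂ (idle-unchanged S1 (ctl copySummary) (override (idle (reads S1)) tN (cell bit1 false , left)) (tA j) si12 (idle-reads S1 (tA j))) i) (erA1 j i)
    hd2 : ∀ j → hd S2 j ≡ 0
    hd2 fz = refl
    hd2 (fs fz) = refl
    hd2 (fs (fs fz)) = refl
    hd2 (fs (fs (fs fz))) = refl
    hd2 (fs (fs (fs (fs fz)))) = refl
    hd2 (fs (fs (fs (fs (fs fz))))) = refl
    hd2 (fs (fs (fs (fs (fs (fs fz)))))) = refl
    hd2 (fs (fs (fs (fs (fs (fs (fs j))))))) = refl
    oO2 : RawHolds (tp S2 tO) []
    oO2 zero = refl
    oO2 (suc i) = refl
    oY2 : RawHolds (tp S2 tY) σ
    oY2 zero = refl
    oY2 (suc i) = refl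
    N2 : Holds (tp S2 tN) (encBits (encℕ 0)) 2
    N2 = holds (s≤s z≤n) lo' hi'
      where
      lo' : ∀ i → i < 2 → tp S2 tN i ≡ cell (readCell (encBits (encℕ 0)) i) (isOrigin i)
      lo' zero _ = refl
      lo' (suc zero) _ = refl
      lo' (suc (suc i)) (s≤s (s≤s ()))
      hi' : ∀ i → 2 ≤ i → tp S2 tN i ≡ □ × readCell (encBits (encℕ 0)) i ≡ fz
      hi' zero ()
      hi' (suc zero) (s≤s ())
      hi' (suc (suc i)) _ = refl , refl

  record SummaryCopied (σ : List Bool) (S₀ S : Snapshot) : Set where
    field
      state     : st S ≡ ctl (parseFirst intoTime)
      work      : HoldsOn S tW (encBits σ)
      work-head : hd S tW ≡ 0
      others    : ∀ X → eqF X tY ≡ false → eqF X tW ≡ false → Unchanged S₀ S X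

  copy-summary : ∀ σ {S2} → Initialised σ S2 → Reaches (SummaryCopied σ S2) S2
  copy-summary σ {S2} init = reaches (c3 + c4) (subst (SummaryCopied σ S2) (sym (run-+ S2 c3 c4)) record
    { state = Rewound.state R4 ; work = W4 ; work-head = Rewound.at-origin R4 tW refl ; others = s24 })
    where
    open Initialised init using () renaming (heads to hd2; summary to oY2; erased-X to erX)
    rs3 = copy-run copySummary-copies refl σ S2 (Initialised.state init) (subst (λ h → BitsAt (tp S2 tY) h σ) (sym (hd2 tY)) (RawHolds-bitsAt oY2))
    c3 = proj₁ rs3
    S3 = run S2 c3
    R3 = proj₂ (proj₂ rs3)
    o3 = Copied.others R3
    twW = Holds-writeBits σ [] (hd S2 tW) (hd2 tW) (erased-holds-[] (erX tW refl refl refl refl)) (subst (_≤ 1) (sym (hd2 tW)) z≤n)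
    W3 : HoldsOn S3 tW (encBits σ)
    W3 = proj₁ twW , Holds-cong (Copied.target-tape R3 tW refl refl) (proj₁ (proj₂ twW))
    le4 : ∀ j → rewinds rwWork j ≡ true → ∀ i → leftEnd (tp S3 j i) ≡ isOrigin i
    le4 j z rewrite eqF-sound j tW z = HoldsOn-leftEnd {S3} {tW} W3
    rs4 = rewind-run rwWork S3 (proj₁ (proj₂ rs3)) le4
    c4 = proj₁ rs4
    S4 = run S3 c4
    R4 = proj₂ rs4
    s4 : ∀ X → rewinds rwWork X ≡ false → Unchanged S3 S4 X
    s4 X z = Rewound-unchanged R4 X z
    W4 : HoldsOn S4 tW (encBits σ)
    W4 = HoldsOn-cong S3 S4 tW (Rewound.tapes R4 tW) W3
    s24 : ∀ X → eqF X tY ≡ false → eqF X tW ≡ false → Unchanged S2 S4 X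
    s24 X e1 e2 = Unchanged-trans₃ S2 S3 S4 X (o3 X e1 e2) (s4 X e2)

  module Iteration (σ : List Bool) (L n : ℕ) (out : ℕ → List Bool) where
    R = L + n

    record Background (S : Snapshot) (nb bb : List Bool) : Set where
      constructor background
      field
        out-blank : RawHolds (tp S tO) []
        out-head : hd S tO ≡ 0
        work : HoldsOn S tW (encBits σ)
        bound : HoldsOn S tR (encBits (encℕ R))
        count : HoldsOn S tN (encBits nb)
        buffer : HoldsOn S tB (encBits bb)
        buffer-head : hd S tB ≡ length bb
    open Background public


    record LoopStart (d : ℕ) (S : Snapshot) : Set where
      constructor loopStart
      field
        start-state : st S ≡ ctl (rewind rwA)
        start-bg : Background S (encℕ d) (outputsUpTo out L d)
        start-time : HoldsOn S tT (encBits (encℕ (L + d)))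
        start-work-head : hd S tW ≡ 0
        start-time-head : hd S tT ≡ 0
        start-bound-head : hd S tR ≡ 0
        start-count-head : hd S tN ≡ 0
        start-aTapes : ∀ j → ∃ λ l → HoldsOn S (tA j) l
    open LoopStart public

    record Loaded (d : ℕ) (S : Snapshot) : Set where
      constructor loaded
      field
        loaded-state : st S ≡ sim (TM.q₀ A)
        loaded-bg : Background S (encℕ d) (outputsUpTo out L d)
        loaded-time : HoldsOn S tT (encBits (encℕ (L + d)))
        loaded-work-head : hd S tW ≡ 0
        loaded-time-head : hd S tT ≡ 0
        loaded-bound-head : hd S tR ≡ 0
        loaded-count-head : hd S tN ≡ 0
        loaded-aTapes : ∀ j → HoldsOn S (tA j) (loadInput (σ ∷ encℕ (L + d) ∷ []) (F.toℕ j))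
        loaded-aHeads : ∀ j → hd S (tA j) ≡ 0
    open Loaded public

    load-inputs : ∀ d S → LoopStart d S → ∀ {S3} → ATapesReset S S3 → Reaches (Loaded d) S3
    load-inputs d S I {S3} reset = reaches (c4 + (c5 + c6)) (subst (Loaded d) (sym runEq) LD)
      where
      τ = L + d
      srcW : BitsAt (tp S3 tW) (hd S3 tW) σ
      srcW = subst₂ (BitsAt (tp S3 tW)) (sym (trans (proj₁ (ATapesReset.others reset tW refl)) (start-work-head I))) (bitsOf-encBits σ)
               (Holds-bitsAt (proj₂ (HoldsOn-cong S S3 tW (proj₂ (ATapesReset.others reset tW refl)) (work (start-bg I)))))
      rs4 = copy-run loadSummary-copies refl σ S3 (ATapesReset.state reset) srcW
      c4 = proj₁ rs4
      S4 = run S3 c4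
      R4 = proj₂ (proj₂ rs4)
      o4 : ∀ j → eqF j tW ≡ false → eqF j (tA fz) ≡ false → Unchanged S3 S4 j
      o4 = Copied.others R4
      A0-4 : HoldsOn S4 (tA fz) (encBits σ)
      A0-4 = proj₁ tw , Holds-cong (Copied.target-tape R4 (tA fz) refl refl) (proj₁ (proj₂ tw))
        where
        tw = Holds-writeBits σ [] (hd S3 (tA fz)) (ATapesReset.origin-A reset fz) (erased-holds-[] (ATapesReset.erased-A reset fz)) (subst (_≤ 1) (sym (ATapesReset.origin-A reset fz)) z≤n)
      T3 : HoldsOn S3 tT (encBits (encℕ τ))
      T3 = HoldsOn-cong S S3 tT (proj₂ (ATapesReset.others reset tT refl)) (start-time I)
      T4 : HoldsOn S4 tT (encBits (encℕ τ))
      T4 = HoldsOn-cong S3 S4 tT (proj₂ (o4 tT refl refl)) T3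
      srcT : BitsAt (tp S4 tT) (hd S4 tT) (encℕ τ)
      srcT = subst₂ (BitsAt (tp S4 tT)) (sym (trans (proj₁ (o4 tT refl refl)) (trans (proj₁ (ATapesReset.others reset tT refl)) (start-time-head I)))) (bitsOf-encBits (encℕ τ))
               (Holds-bitsAt (proj₂ T4))
      rs5 = copy-run loadTime-copies refl (encℕ τ) S4 (proj₁ (proj₂ rs4)) srcT
      c5 = proj₁ rs5
      S5 = run S4 c5
      R5 = proj₂ (proj₂ rs5)
      o5 : ∀ j → eqF j tT ≡ false → isA₁ j ≡ false → Unchanged S4 S5 j
      o5 = Copied.others R5
      lA5 : ∀ j → HoldsOn S5 (tA j) (loadInput (σ ∷ encℕ τ ∷ []) (F.toℕ j))
      lA5 fz = HoldsOn-cong S4 S5 (tA fz) (proj₂ (o5 (tA fz) refl refl)) A0-4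
      lA5 (fs fz) = proj₁ tw , Holds-cong (λ i → trans (Copied.target-tape R5 (tA (fs fz)) refl refl i)
                       (writeBits-cong writeBit (encℕ τ) (hd S4 (tA (fs fz))) (proj₂ (o4 (tA (fs fz)) refl refl)) i)) (proj₁ (proj₂ tw))
        where
        h4 : hd S4 (tA (fs fz)) ≡ 0
        h4 = trans (proj₁ (o4 (tA (fs fz)) refl refl)) (ATapesReset.origin-A reset (fs fz))
        tw = Holds-writeBits (encℕ τ) [] (hd S4 (tA (fs fz))) h4 (erased-holds-[] (ATapesReset.erased-A reset (fs fz))) (subst (_≤ 1) (sym h4) z≤n)
      lA5 (fs (fs k)) = 1 , Holds-cong (λ i → trans (proj₂ (o5 (tA (fs (fs k))) refl refl) i) (proj₂ (o4 (tA (fs (fs k))) refl refl) i)) (erased-holds-[] (ATapesReset.erased-A reset (fs (fs k))))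
      W5 : HoldsOn S5 tW (encBits σ)
      W5 = HoldsOn-cong S S5 tW (λ i → trans (proj₂ (o5 tW refl refl) i) (trans (Copied.source-tape R4 i) (proj₂ (ATapesReset.others reset tW refl) i))) (work (start-bg I))
      T5 : HoldsOn S5 tT (encBits (encℕ τ))
      T5 = HoldsOn-cong S4 S5 tT (Copied.source-tape R5) T4
      le6 : ∀ j → rewinds rwLoaded j ≡ true → ∀ i → leftEnd (tp S5 j i) ≡ isOrigin i
      le6 (fs (fs fz)) z = HoldsOn-leftEnd {S5} {tW} W5
      le6 (fs (fs (fs fz))) z = HoldsOn-leftEnd {S5} {tT} T5
      le6 (fs (fs (fs (fs (fs (fs (fs j))))))) z = HoldsOn-leftEnd {S5} {tA j} (lA5 j)
      rs6 = rewind-run rwLoaded S5 (proj₁ (proj₂ rs5)) le6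
      c6 = proj₁ rs6
      S6 = run S5 c6
      R6 = proj₂ rs6
      runEq : run S3 (c4 + (c5 + c6)) ≡ S6
      runEq = trans (run-+ S3 c4 _) (run-+ S4 c5 c6)
      sm : ∀ X → isATape X ≡ false → eqF X tW ≡ false → eqF X tT ≡ false → rewinds rwLoaded X ≡ false → Unchanged S S6 X
      sm X a w t z = Unchanged-trans₃ S S5 S6 X (Unchanged-trans₃ S S4 S5 X (Unchanged-trans₃ S S3 S4 X (ATapesReset.others reset X a) (o4 X w (¬isATape-eqF X fz a))) (o5 X t (¬isATape-isA₁ X a)))
                     (Rewound-unchanged R6 X z)
      W6 : HoldsOn S6 tW (encBits σ)
      W6 = HoldsOn-cong S5 S6 tW (Rewound.tapes R6 tW) W5
      ow6 = start-bg I
      LD : Loaded d S6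
      LD = loaded (Rewound.state R6)
        (background (RawHolds-cong S S6 tO {[]} (proj₂ (sm tO refl refl refl refl)) (out-blank ow6)) (trans (proj₁ (sm tO refl refl refl refl)) (out-head ow6)) W6
             (HoldsOn-cong S S6 tR (proj₂ (sm tR refl refl refl refl)) (bound ow6)) (HoldsOn-cong S S6 tN (proj₂ (sm tN refl refl refl refl)) (count ow6))
             (HoldsOn-cong S S6 tB (proj₂ (sm tB refl refl refl refl)) (buffer ow6)) (trans (proj₁ (sm tB refl refl refl refl)) (buffer-head ow6)))
        (HoldsOn-cong S5 S6 tT (Rewound.tapes R6 tT) T5)
        (Rewound.at-origin R6 tW refl) (Rewound.at-origin R6 tT refl)
        (trans (proj₁ (sm tR refl refl refl refl)) (start-bound-head I)) (trans (proj₁ (sm tN refl refl refl refl)) (start-count-head I))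
        (λ j → HoldsOn-cong S5 S6 (tA j) (Rewound.tapes R6 (tA j)) (lA5 j))
        (λ j → Rewound.at-origin R6 (tA j) refl)

    load-stage : ∀ d S → LoopStart d S → Reaches (Loaded d) S
    load-stage d S I = reset-A S (start-state I) (start-aTapes I) ⟫ load-inputs d S I

    record Saved (d : ℕ) (S : Snapshot) : Set where
      constructor saved
      field
        saved-state : st S ≡ ctl (increment countCtr readPair)
        saved-bg : Background S (encℕ d) (outputsUpTo out L (suc d))
        saved-time : HoldsOn S tT (encBits (encℕ (L + d)))
        saved-work-head : hd S tW ≡ 0
        saved-time-head : hd S tT ≡ 0
        saved-bound-head : hd S tR ≡ 0
        saved-count-head : hd S tN ≡ 0
        saved-aTapes : ∀ j → ∃ λ l → HoldsOn S (tA j) l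
    open Saved public

    simulate-stage : ∀ d S → Loaded d S → Outputs₂ A σ (encℕ (L + d)) (out (L + d)) → Reaches (Saved d) S
    simulate-stage d S LD (n1 , hlt , oeq) = reaches (n0 + (1 + (c9 + c10))) (subst (Saved d) (sym runEq) AO)
      where
      τ = L + d
      c0 = initConfig A (σ ∷ encℕ τ ∷ [])
      sr0 : Simulates S c0
      sr0 = loaded-state LD , λ j → proj₁ (loaded-aTapes LD j) ,
        subst (λ l → Holds (tp S (tA j)) l (proj₁ (loaded-aTapes LD j))) (sym (lookup∘tabulate (λ i → loadInput (σ ∷ encℕ τ ∷ []) (F.toℕ i)) j)) (proj₂ (loaded-aTapes LD j)) ,
        trans (loaded-aHeads LD j) (sym (lookup-replicate j 0)) ,
        subst (_≤ proj₁ (loaded-aTapes LD j)) (sym (loaded-aHeads LD j)) z≤n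
      P : ℕ → Bool
      P k = isHalting A (Config.state (runFrom A c0 k))
      Pn1 : P n1 ≡ true
      Pn1 = trans (cong (λ C → isHalting A (Config.state C)) (runFrom≡runFor A c0 n1)) hlt
      mt = least-true P n1 Pn1
      n0 = proj₁ mt
      cA = runFrom A c0 n0
      sr = sim-run n0 S c0 sr0 (proj₂ (proj₂ (proj₂ mt)))
      S7 = run S n0
      sr7 = proj₁ sr
      sh = sim-halt-step S7 cA sr7 (proj₁ (proj₂ (proj₂ mt)))
      S8 = next S7
      A0-7 = proj₂ sr7 fz
      le9 : ∀ j → rewinds rwOutput j ≡ true → ∀ i → leftEnd (tp S8 j i) ≡ isOrigin i
      le9 j z rewrite eqF-sound j (tA fz) z = λ i → trans (cong leftEnd (proj₂ (proj₂ sh (tA fz)) i)) (Holds-leftEnd (proj₁ (proj₂ A0-7)) i)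
      rs9 = rewind-run rwOutput S8 (proj₁ sh) le9
      c9 = proj₁ rs9
      S9 = run S8 c9
      R9 = proj₂ rs9
      lA0 = lookup (Config.tapes cA) fz
      t9 : ∀ i → tp S9 (tA fz) i ≡ tp S7 (tA fz) i
      t9 i = trans (Rewound.tapes R9 (tA fz) i) (proj₂ (proj₂ sh (tA fz)) i)
      src : BitsAt (tp S9 (tA fz)) (hd S9 (tA fz)) (bitsOf lA0)
      src = subst (λ h → BitsAt (tp S9 (tA fz)) h (bitsOf lA0)) (sym (Rewound.at-origin R9 (tA fz) refl))
              (Holds-bitsAt (Holds-cong t9 (proj₁ (proj₂ A0-7))))
      rs10 = copy-run saveOutput-copies refl (bitsOf lA0) S9 (Rewound.state R9) src
      c10 = proj₁ rs10
      S10 = run S9 c10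
      R10 = proj₂ (proj₂ rs10)
      runEq : run S (n0 + (1 + (c9 + c10))) ≡ S10
      runEq = trans (run-+ S n0 (1 + (c9 + c10))) (trans (run-+ S7 1 (c9 + c10)) (run-+ S8 c9 c10))
      k = n1 ∸ n0
      outEq : bitsOf lA0 ≡ out τ
      outEq = trans (cong bitsOf (sym (head≡lookup-zero (Config.tapes cA))))
        (trans (cong (output A) (sym (trans (cong (runFrom A c0) (sym (m+[n∸m]≡n (proj₁ (proj₂ mt)))))
            (trans (runFrom-+ A c0 n0 k) (runFrom-halted A cA k (proj₁ (proj₂ (proj₂ mt))))))))
        (trans (cong (output A) (runFrom≡runFor A c0 n1)) oeq))
      sm : ∀ X → isATape X ≡ false → eqF X tB ≡ false → Unchanged S S10 X
      sm X a b = Unchanged-trans₃ S S9 S10 X (Unchanged-trans₃ S S8 S9 X (Unchanged-trans₃ S S7 S8 X (proj₂ sr X a) (proj₂ sh X))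
                   (Rewound-unchanged R9 X (¬isATape-eqF X fz a)))
                   (Copied.others R10 X (¬isATape-eqF X fz a) b)
      smB : Unchanged S S9 tB
      smB = Unchanged-trans₃ S S8 S9 tB (Unchanged-trans₃ S S7 S8 tB (proj₂ sr tB refl) (proj₂ sh tB)) (Rewound-unchanged R9 tB refl)
      ow = loaded-bg LD
      B9 : HoldsOn S9 tB (encBits (outputsUpTo out L d))
      B9 = HoldsOn-cong S S9 tB (proj₂ smB) (buffer ow)
      hB9 : hd S9 tB ≡ length (outputsUpTo out L d)
      hB9 = trans (proj₁ smB) (buffer-head ow)
      tw = Holds-writeBits (bitsOf lA0) (outputsUpTo out L d) (hd S9 tB) hB9 (proj₂ B9) (subst (_≤ proj₁ B9) (sym hB9) (length≤extent (outputsUpTo out L d) (proj₂ B9)))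
      B10 : HoldsOn S10 tB (encBits (outputsUpTo out L (suc d)))
      B10 = proj₁ tw , Holds-cong (Copied.target-tape R10 tB refl refl) (subst (λ z → Holds (writeBits writeBit (bitsOf lA0) (hd S9 tB) (tp S9 tB)) (encBits (outputsUpTo out L d ++ z)) (proj₁ tw)) outEq (proj₁ (proj₂ tw)))
      hB10 : hd S10 tB ≡ length (outputsUpTo out L (suc d))
      hB10 = trans (Copied.target-head R10 tB refl refl) (trans (cong₂ _+_ hB9 (cong length outEq)) (sym (length-++ (outputsUpTo out L d))))
      aA10 : ∀ j → ∃ λ l → HoldsOn S10 (tA j) l
      aA10 j = lookup (Config.tapes cA) j , HoldsOn-cong S7 S10 (tA j) (tpe j) (proj₁ (proj₂ sr7 j) , proj₁ (proj₂ (proj₂ sr7 j)))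
        where
        tpe : ∀ j i → tp S10 (tA j) i ≡ tp S7 (tA j) i
        tpe fz i = trans (Copied.source-tape R10 i) (t9 i)
        tpe (fs k) i = trans (proj₂ (Copied.others R10 (tA (fs k)) refl refl) i) (trans (Rewound.tapes R9 (tA (fs k)) i) (proj₂ (proj₂ sh (tA (fs k))) i))
      AO : Saved d S10
      AO = saved (proj₁ (proj₂ rs10))
        (background (RawHolds-cong S S10 tO {[]} (proj₂ (sm tO refl refl)) (out-blank ow)) (trans (proj₁ (sm tO refl refl)) (out-head ow))
             (HoldsOn-cong S S10 tW (proj₂ (sm tW refl refl)) (work ow)) (HoldsOn-cong S S10 tR (proj₂ (sm tR refl refl)) (bound ow))
             (HoldsOn-cong S S10 tN (proj₂ (sm tN refl refl)) (count ow)) B10 hB10)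
        (HoldsOn-cong S S10 tT (proj₂ (sm tT refl refl)) (loaded-time LD))
        (trans (proj₁ (sm tW refl refl)) (loaded-work-head LD)) (trans (proj₁ (sm tT refl refl)) (loaded-time-head LD))
        (trans (proj₁ (sm tR refl refl)) (loaded-bound-head LD)) (trans (proj₁ (sm tN refl refl)) (loaded-count-head LD))
        aA10

    record Checked (d : ℕ) (S : Snapshot) : Set where
      constructor checked
      field
        checked-done : L + d ≡ R → st S ≡ ctl (rewind rwDone)
        checked-next : ¬ (L + d ≡ R) → st S ≡ ctl (rewind rwNext)
        checked-bg : Background S (encℕ (suc d)) (outputsUpTo out L (suc d))
        checked-time : HoldsOn S tT (encBits (encℕ (L + d)))
        checked-work-head : hd S tW ≡ 0
        checked-count-head : hd S tN ≡ 0
        checked-aTapes : ∀ j → ∃ λ l → HoldsOn S (tA j) l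
    open Checked public

    check-stage : ∀ d S → Saved d S → Reaches (Checked d) S
    check-stage d S AO = reaches (c11 + (c12 + c13)) (subst (Checked d) (sym runEq) PO)
      where
      τ = L + d
      ow = saved-bg AO
      bs = bitsᵇ (B.fromℕ d)
      taN : TapeAt S tN (encBits ([] ++ selfDelim bs))
      taN = HoldsOn⇒TapeAt S tN (count ow) (saved-count-head AO)
      rs11 = increment-run countCtr bs [] S (saved-state AO) taN (saved-count-head AO)
      c11 = proj₁ rs11
      S11 = run S c11
      R11 = proj₂ rs11
      fr11 = proj₂ (proj₂ R11)
      N11 : TapeAt S11 tN (encBits (encℕ (suc d)))
      N11 = TapeAt-subst S11 tN (cong encBits (sym (encℕ-suc d))) (proj₁ (proj₂ R11))
      le12 : ∀ j → rewinds rwCount j ≡ true → ∀ i → leftEnd (tp S11 j i) ≡ isOrigin i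
      le12 j z rewrite eqF-sound j tN z = HoldsOn-leftEnd {S11} {tN} (TapeAt⇒HoldsOn {S11} {tN} N11)
      rs12 = rewind-run rwCount S11 (proj₁ R11) le12
      c12 = proj₁ rs12
      S12 = run S11 c12
      R12 = proj₂ rs12
      sm12 : ∀ X → eqF X tN ≡ false → Unchanged S S12 X
      sm12 X e = Unchanged-trans₃ S S11 S12 X (fr11 X e) (Rewound-unchanged R12 X e)
      T12 : HoldsOn S12 tT (encBits (encℕ τ))
      T12 = HoldsOn-cong S S12 tT (proj₂ (sm12 tT refl)) (saved-time AO)
      R12' : HoldsOn S12 tR (encBits (encℕ R))
      R12' = HoldsOn-cong S S12 tR (proj₂ (sm12 tR refl)) (bound ow)
      srcT : BitsAt (tp S12 tT) (hd S12 tT) (encℕ τ)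
      srcT = subst₂ (BitsAt (tp S12 tT)) (sym (trans (proj₁ (sm12 tT refl)) (saved-time-head AO))) (bitsOf-encBits (encℕ τ)) (Holds-bitsAt (proj₂ T12))
      srcR : BitsAt (tp S12 tR) (hd S12 tR) (encℕ R)
      srcR = subst₂ (BitsAt (tp S12 tR)) (sym (trans (proj₁ (sm12 tR refl)) (saved-bound-head AO))) (bitsOf-encBits (encℕ R)) (Holds-bitsAt (proj₂ R12'))
      rs13 = compare-run (encℕ τ) (encℕ R) S12 (Rewound.state R12) srcT srcR
      c13 = proj₁ rs13
      S13 = run S12 c13
      co = proj₁ (proj₂ rs13)
      cr = proj₂ (proj₂ rs13)
      runEq : run S (c11 + (c12 + c13)) ≡ S13
      runEq = trans (run-+ S c11 (c12 + c13)) (run-+ S11 c12 c13)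
      sm : ∀ X → eqF X tN ≡ false → eqF X tT ≡ false → eqF X tR ≡ false → Unchanged S S13 X
      sm X e1 e2 e3 = Unchanged-trans₃ S S12 S13 X (sm12 X e1) (proj₂ cr X e2 e3 , proj₁ cr X)
      N13 : HoldsOn S13 tN (encBits (encℕ (suc d)))
      N13 = HoldsOn-cong S11 S13 tN (λ i → trans (proj₁ cr tN i) (Rewound.tapes R12 tN i)) (TapeAt⇒HoldsOn {S11} {tN} N11)
      hN13 : hd S13 tN ≡ 0
      hN13 = trans (proj₂ cr tN refl refl) (Rewound.at-origin R12 tN refl)
      PO : Checked d S13
      PO = checked (λ e → proj₁ co (cong encℕ e)) (λ ne → proj₂ co (λ e → ne (encℕ-injective τ R e)))
        (background (RawHolds-cong S S13 tO {[]} (proj₂ (sm tO refl refl refl)) (out-blank ow)) (trans (proj₁ (sm tO refl refl refl)) (out-head ow))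
             (HoldsOn-cong S S13 tW (proj₂ (sm tW refl refl refl)) (work ow)) (HoldsOn-cong S12 S13 tR (proj₁ cr tR) R12')
             N13 (HoldsOn-cong S S13 tB (proj₂ (sm tB refl refl refl)) (buffer ow)) (trans (proj₁ (sm tB refl refl refl)) (buffer-head ow)))
        (HoldsOn-cong S12 S13 tT (proj₁ cr tT) T12)
        (trans (proj₁ (sm tW refl refl refl)) (saved-work-head AO)) hN13
        (λ j → proj₁ (saved-aTapes AO j) , HoldsOn-cong S S13 (tA j) (proj₂ (sm (tA j) refl refl refl)) (proj₂ (saved-aTapes AO j)))

    advance-stage : ∀ d S → Checked d S → st S ≡ ctl (rewind rwNext) → Reaches (LoopStart (suc d)) S
    advance-stage d S PO e = reaches (c14 + (c15 + c16)) (subst (LoopStart (suc d)) (sym runEq) IV)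
      where
      τ = L + d
      ow = checked-bg PO
      le14 : ∀ j → rewinds rwNext j ≡ true → ∀ i → leftEnd (tp S j i) ≡ isOrigin i
      le14 (fs (fs (fs fz))) z = HoldsOn-leftEnd {S} {tT} (checked-time PO)
      le14 (fs (fs (fs (fs fz)))) z = HoldsOn-leftEnd {S} {tR} (bound ow)
      rs14 = rewind-run rwNext S e le14
      c14 = proj₁ rs14
      S14 = run S c14
      R14 = proj₂ rs14
      T14 : HoldsOn S14 tT (encBits (encℕ τ))
      T14 = HoldsOn-cong S S14 tT (Rewound.tapes R14 tT) (checked-time PO)
      bs = bitsᵇ (B.fromℕ τ)
      rs15 = increment-run timeCtr bs [] S14 (Rewound.state R14) (HoldsOn⇒TapeAt S14 tT T14 (Rewound.at-origin R14 tT refl)) (Rewound.at-origin R14 tT refl)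
      c15 = proj₁ rs15
      S15 = run S14 c15
      R15 = proj₂ rs15
      T15 : TapeAt S15 tT (encBits (encℕ (L + suc d)))
      T15 = TapeAt-subst S15 tT (cong encBits (trans (sym (encℕ-suc τ)) (cong encℕ (sym (+-suc L d))))) (proj₁ (proj₂ R15))
      le16 : ∀ j → rewinds rwTime j ≡ true → ∀ i → leftEnd (tp S15 j i) ≡ isOrigin i
      le16 j z rewrite eqF-sound j tT z = HoldsOn-leftEnd {S15} {tT} (TapeAt⇒HoldsOn {S15} {tT} T15)
      rs16 = rewind-run rwTime S15 (proj₁ R15) le16
      c16 = proj₁ rs16
      S16 = run S15 c16
      R16 = proj₂ rs16
      runEq : run S (c14 + (c15 + c16)) ≡ S16
      runEq = trans (run-+ S c14 (c15 + c16)) (run-+ S14 c15 c16)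
      sm : ∀ X → rewinds rwNext X ≡ false → eqF X tT ≡ false → Unchanged S S16 X
      sm X z e = Unchanged-trans₃ S S15 S16 X (Unchanged-trans₃ S S14 S15 X (Rewound-unchanged R14 X z) (proj₂ (proj₂ R15) X e))
                 (Rewound-unchanged R16 X e)
      smR : Unchanged S14 S16 tR
      smR = Unchanged-trans₃ S14 S15 S16 tR (proj₂ (proj₂ R15) tR refl) (Rewound-unchanged R16 tR refl)
      IV : LoopStart (suc d) S16
      IV = loopStart (Rewound.state R16)
        (background (RawHolds-cong S S16 tO {[]} (proj₂ (sm tO refl refl)) (out-blank ow)) (trans (proj₁ (sm tO refl refl)) (out-head ow))
             (HoldsOn-cong S S16 tW (proj₂ (sm tW refl refl)) (work ow))
             (HoldsOn-cong S S16 tR (λ i → trans (proj₂ smR i) (Rewound.tapes R14 tR i)) (bound ow))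
             (HoldsOn-cong S S16 tN (proj₂ (sm tN refl refl)) (count ow)) (HoldsOn-cong S S16 tB (proj₂ (sm tB refl refl)) (buffer ow))
             (trans (proj₁ (sm tB refl refl)) (buffer-head ow)))
        (HoldsOn-cong S15 S16 tT (Rewound.tapes R16 tT) (TapeAt⇒HoldsOn {S15} {tT} T15))
        (trans (proj₁ (sm tW refl refl)) (checked-work-head PO)) (Rewound.at-origin R16 tT refl)
        (trans (proj₁ smR) (Rewound.at-origin R14 tR refl)) (trans (proj₁ (sm tN refl refl)) (checked-count-head PO))
        (λ j → proj₁ (checked-aTapes PO j) , HoldsOn-cong S S16 (tA j) (proj₂ (sm (tA j) refl refl)) (proj₂ (checked-aTapes PO j)))

    Done : ℕ → Snapshot → Set
    Done d S = st S ≡ ctl accept × RawHolds (tp S tO) (encℕ (suc d) ++ outputsUpTo out L (suc d))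

    emit-stage : ∀ d S → Checked d S → st S ≡ ctl (rewind rwDone) → Reaches (Done d) S
    emit-stage d S PO e = reaches (c14 + (c15 + (c16 + c17))) (subst (Done d) (sym runEq) (proj₁ (proj₂ rs17) , O17))
      where
      ow = checked-bg PO
      le14 : ∀ j → rewinds rwDone j ≡ true → ∀ i → leftEnd (tp S j i) ≡ isOrigin i
      le14 (fs (fs (fs fz))) z = HoldsOn-leftEnd {S} {tT} (checked-time PO)
      le14 (fs (fs (fs (fs fz)))) z = HoldsOn-leftEnd {S} {tR} (bound ow)
      rs14 = rewind-run rwDone S e le14
      c14 = proj₁ rs14
      S14 = run S c14
      R14 = proj₂ rs14
      s14 : ∀ X → rewinds rwDone X ≡ false → Unchanged S S14 X
      s14 X z = Rewound-unchanged R14 X z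
      le15 : ∀ j → rewinds rwBuffer j ≡ true → ∀ i → leftEnd (tp S14 j i) ≡ isOrigin i
      le15 j z rewrite eqF-sound j tB z = HoldsOn-leftEnd {S14} {tB} (HoldsOn-cong S S14 tB (proj₂ (s14 tB refl)) (buffer ow))
      rs15 = rewind-run rwBuffer S14 (Rewound.state R14) le15
      c15 = proj₁ rs15
      S15 = run S14 c15
      R15 = proj₂ rs15
      s15 : ∀ X → rewinds rwDone X ≡ false → rewinds rwBuffer X ≡ false → Unchanged S S15 X
      s15 X z1 z2 = Unchanged-trans₃ S S14 S15 X (s14 X z1) (Rewound-unchanged R15 X z2)
      N15 : HoldsOn S15 tN (encBits (encℕ (suc d)))
      N15 = HoldsOn-cong S S15 tN (proj₂ (s15 tN refl refl)) (count ow)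
      srcN : BitsAt (tp S15 tN) (hd S15 tN) (encℕ (suc d))
      srcN = subst₂ (BitsAt (tp S15 tN)) (sym (trans (proj₁ (s15 tN refl refl)) (checked-count-head PO))) (bitsOf-encBits _) (Holds-bitsAt (proj₂ N15))
      rs16 = copy-run emitCount-copies refl (encℕ (suc d)) S15 (Rewound.state R15) srcN
      c16 = proj₁ rs16
      S16 = run S15 c16
      R16 = proj₂ (proj₂ rs16)
      hO15 : hd S15 tO ≡ 0
      hO15 = trans (proj₁ (s15 tO refl refl)) (out-head ow)
      O16 : RawHolds (tp S16 tO) (encℕ (suc d))
      O16 i = trans (Copied.target-tape R16 tO refl refl i) (RawHolds-writeBits (encℕ (suc d)) [] (hd S15 tO) hO15 (RawHolds-cong S S15 tO {[]} (proj₂ (s15 tO refl refl)) (out-blank ow)) i)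
      hO16 : hd S16 tO ≡ length (encℕ (suc d))
      hO16 = trans (Copied.target-head R16 tO refl refl) (cong (_+ length (encℕ (suc d))) hO15)
      B16 : HoldsOn S16 tB (encBits (outputsUpTo out L (suc d)))
      B16 = HoldsOn-cong S S16 tB (λ i → trans (proj₂ (Copied.others R16 tB refl refl) i) (trans (Rewound.tapes R15 tB i) (proj₂ (s14 tB refl) i))) (buffer ow)
      hB16 : hd S16 tB ≡ 0
      hB16 = trans (proj₁ (Copied.others R16 tB refl refl)) (Rewound.at-origin R15 tB refl)
      srcB : BitsAt (tp S16 tB) (hd S16 tB) (outputsUpTo out L (suc d))
      srcB = subst₂ (BitsAt (tp S16 tB)) (sym hB16) (bitsOf-encBits _) (Holds-bitsAt (proj₂ B16))
      rs17 = copy-run emitBuffer-copies refl (outputsUpTo out L (suc d)) S16 (proj₁ (proj₂ rs16)) srcB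
      c17 = proj₁ rs17
      S17 = run S16 c17
      R17 = proj₂ (proj₂ rs17)
      O17 : RawHolds (tp S17 tO) (encℕ (suc d) ++ outputsUpTo out L (suc d))
      O17 i = trans (Copied.target-tape R17 tO refl refl i) (RawHolds-writeBits (outputsUpTo out L (suc d)) (encℕ (suc d)) (hd S16 tO) hO16 O16 i)
      runEq : run S (c14 + (c15 + (c16 + c17))) ≡ S17
      runEq = trans (run-+ S c14 (c15 + (c16 + c17))) (trans (run-+ S14 c15 (c16 + c17)) (run-+ S15 c16 c17))

    parse-bounds : ∀ rest → σ ≡ encℕ L ++ encℕ R ++ rest → ∀ {S2} → Initialised σ S2 → ∀ {S4} → SummaryCopied σ S2 S4 →
                   Reaches (LoopStart 0) S4
    parse-bounds rest eσ {S2} init {S4} copied = reaches (c5 + (c6 + c7)) (subst (LoopStart 0) (sym runEq) IV)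
      where
      open Initialised init using () renaming (heads to hd2; out-blank′ to oO2; counter to N2; erased-X to erX; erased-A to erA)
      bitW4 : ∀ i → bitOf (tp S4 tW i) ≡ bitOfΓ (readCell (encBits σ) i)
      bitW4 i = cong bitOfΓ (Holds-aSymbol (proj₂ (SummaryCopied.work copied)) i)
      prefL : PrefixAt (tp S4 tW) (hd S4 tW) (encℕ L)
      prefL = PrefixAt-readCell (tp S4 tW) (hd S4 tW) (encℕ L) (encℕ R ++ rest)
        (λ i → trans (cong (λ h → bitOf (tp S4 tW (h + i))) (SummaryCopied.work-head copied)) (trans (bitW4 i) (cong (λ z → bitOfΓ (readCell (encBits z) i)) eσ)))
      rs5 = parse-run intoTime (bitsᵇ (B.fromℕ L)) S4 (SummaryCopied.state copied) prefL
      c5 = proj₁ rs5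
      S5 = run S4 c5
      R5 = proj₂ (proj₂ rs5)
      o5 = Copied.others R5
      hT4 : hd S4 tT ≡ 0
      hT4 = trans (proj₁ (SummaryCopied.others copied tT refl refl)) (hd2 tT)
      twT = Holds-writeBits (encℕ L) [] (hd S4 tT) hT4 (erased-holds-[] (λ i → trans (proj₂ (SummaryCopied.others copied tT refl refl) i) (erX tT refl refl refl refl i))) (subst (_≤ 1) (sym hT4) z≤n)
      T5 : HoldsOn S5 tT (encBits (encℕ L))
      T5 = proj₁ twT , Holds-cong (Copied.target-tape R5 tT refl refl) (proj₁ (proj₂ twT))
      hW5 : hd S5 tW ≡ length (encℕ L)
      hW5 = trans (Copied.source-head R5) (cong (_+ length (encℕ L)) (SummaryCopied.work-head copied))
      W5 : HoldsOn S5 tW (encBits σ)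
      W5 = HoldsOn-cong S4 S5 tW (Copied.source-tape R5) (SummaryCopied.work copied)
      prefR : PrefixAt (tp S5 tW) (hd S5 tW) (encℕ R)
      prefR = PrefixAt-readCell (tp S5 tW) (hd S5 tW) (encℕ R) rest
        (λ i → trans (cong (λ h → bitOf (tp S5 tW (h + i))) hW5)
          (trans (cong bitOfΓ (Holds-aSymbol (proj₂ W5) (length (encℕ L) + i)))
          (trans (cong (λ z → bitOfΓ (readCell (encBits z) (length (encℕ L) + i))) eσ) (cong bitOfΓ (readCell-++ (encℕ L) (encℕ R ++ rest) i)))))
      rs6 = parse-run intoBound (bitsᵇ (B.fromℕ R)) S5 (proj₁ (proj₂ rs5)) prefR
      c6 = proj₁ rs6
      S6 = run S5 c6
      R6 = proj₂ (proj₂ rs6)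
      o6 = Copied.others R6
      s46 : ∀ X → eqF X tW ≡ false → eqF X tT ≡ false → eqF X tR ≡ false → Unchanged S4 S6 X
      s46 X e1 e2 e3 = Unchanged-trans₃ S4 S5 S6 X (o5 X e1 e2) (o6 X e1 e3)
      s26 : ∀ X → eqF X tY ≡ false → eqF X tW ≡ false → eqF X tT ≡ false → eqF X tR ≡ false → Unchanged S2 S6 X
      s26 X e0 e1 e2 e3 = Unchanged-trans₃ S2 S4 S6 X (SummaryCopied.others copied X e0 e1) (s46 X e1 e2 e3)
      hR5 : hd S5 tR ≡ 0
      hR5 = trans (proj₁ (o5 tR refl refl)) (trans (proj₁ (SummaryCopied.others copied tR refl refl)) (hd2 tR))
      twR = Holds-writeBits (encℕ R) [] (hd S5 tR) hR5
              (erased-holds-[] (λ i → trans (proj₂ (o5 tR refl refl) i) (trans (proj₂ (SummaryCopied.others copied tR refl refl) i) (erX tR refl refl refl refl i)))) (subst (_≤ 1) (sym hR5) z≤n)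
      R6' : HoldsOn S6 tR (encBits (encℕ R))
      R6' = proj₁ twR , Holds-cong (Copied.target-tape R6 tR refl refl) (proj₁ (proj₂ twR))
      W6 : HoldsOn S6 tW (encBits σ)
      W6 = HoldsOn-cong S5 S6 tW (Copied.source-tape R6) W5
      T6 : HoldsOn S6 tT (encBits (encℕ L))
      T6 = HoldsOn-cong S5 S6 tT (proj₂ (o6 tT refl refl)) T5
      le7 : ∀ j → rewinds rwParsed j ≡ true → ∀ i → leftEnd (tp S6 j i) ≡ isOrigin i
      le7 (fs (fs fz)) z = HoldsOn-leftEnd {S6} {tW} W6
      le7 (fs (fs (fs fz))) z = HoldsOn-leftEnd {S6} {tT} T6
      le7 (fs (fs (fs (fs fz)))) z = HoldsOn-leftEnd {S6} {tR} R6'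
      rs7 = rewind-run rwParsed S6 (proj₁ (proj₂ rs6)) le7
      c7 = proj₁ rs7
      S7 = run S6 c7
      R7 = proj₂ rs7
      s67 : ∀ X → rewinds rwParsed X ≡ false → Unchanged S6 S7 X
      s67 X z = Rewound-unchanged R7 X z
      s27 : ∀ X → eqF X tY ≡ false → eqF X tW ≡ false → eqF X tT ≡ false → eqF X tR ≡ false → Unchanged S2 S7 X
      s27 X e0 e1 e2 e3 = Unchanged-trans₃ S2 S6 S7 X (s26 X e0 e1 e2 e3) (s67 X (lemZ X e1 e2 e3))
        where
        lemZ : ∀ X → eqF X tW ≡ false → eqF X tT ≡ false → eqF X tR ≡ false → rewinds rwParsed X ≡ false
        lemZ X e1 e2 e3 rewrite e1 | e2 | e3 = refl
      runEq : run S4 (c5 + (c6 + c7)) ≡ S7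
      runEq = trans (run-+ S4 c5 (c6 + c7)) (run-+ S5 c6 c7)
      tpe7 : ∀ X → SameTape S6 S7 X
      tpe7 X = Rewound.tapes R7 X
      IV : LoopStart 0 S7
      IV = loopStart (Rewound.state R7)
        (background (RawHolds-cong S2 S7 tO {[]} (proj₂ (s27 tO refl refl refl refl)) oO2) (trans (proj₁ (s27 tO refl refl refl refl)) (hd2 tO))
             (HoldsOn-cong S6 S7 tW (tpe7 tW) W6) (HoldsOn-cong S6 S7 tR (tpe7 tR) R6')
             (HoldsOn-cong S2 S7 tN (proj₂ (s27 tN refl refl refl refl)) (2 , N2))
             (HoldsOn-cong S2 S7 tB (proj₂ (s27 tB refl refl refl refl)) (1 , erased-holds-[] (erX tB refl refl refl refl)))
             (trans (proj₁ (s27 tB refl refl refl refl)) (hd2 tB)))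
        (HoldsOn-cong S6 S7 tT (tpe7 tT) (subst (λ z → HoldsOn S6 tT (encBits (encℕ z))) (sym (+-identityʳ L)) T6))
        (Rewound.at-origin R7 tW refl) (Rewound.at-origin R7 tT refl) (Rewound.at-origin R7 tR refl)
        (trans (proj₁ (s27 tN refl refl refl refl)) (hd2 tN))
        (λ j → [] , 1 , erased-holds-[] (λ i → trans (proj₂ (s27 (tA j) refl refl refl refl) i) (erA j i)))

    prologue : ∀ rest → σ ≡ encℕ L ++ encℕ R ++ rest → Reaches (LoopStart 0) (initial [] σ)
    prologue rest eσ = reaches 2 (initialised σ) ⟫ λ init → copy-summary σ init ⟫ parse-bounds rest eσ init

    round : ∀ d S → LoopStart d S → Outputs₂ A σ (encℕ (L + d)) (out (L + d)) → Reaches (Checked d) S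
    round d S atStart replays =
      load-stage d S atStart ⟫ λ loaded → simulate-stage d _ loaded replays ⟫ λ saved → check-stage d _ saved

    L+d≢R : ∀ {d k} → d + suc k ≡ n → L + d ≢ R
    L+d≢R {d} {k} d+1+k≡n L+d≡R = NP.m≢1+m+n d (begin
      d                ≡⟨ +-cancelˡ-≡ L d n L+d≡R ⟩
      n                ≡⟨ d+1+k≡n ⟨
      d + suc k        ≡⟨ +-suc d k ⟩
      suc (d + k)      ∎)
      where open ≡-Reasoning

    loop : (∀ d → d ≤ n → Outputs₂ A σ (encℕ (L + d)) (out (L + d))) →
           ∀ k d S → d + k ≡ n → LoopStart d S → Reaches (Done n) S
    loop replays zero d S d+0≡n atStart =
      round d S atStart (replays d (subst (d ≤_) d≡n ≤-refl)) ⟫ λ {S′} checked →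
      subst (λ m → Reaches (Done m) S′) d≡n (emit-stage d S′ checked (checked-done checked (cong (L +_) d≡n)))
      where
      d≡n : d ≡ n
      d≡n = trans (sym (+-identityʳ d)) d+0≡n
    loop replays (suc k) d S d+1+k≡n atStart =
      round d S atStart (replays d (subst (d ≤_) d+1+k≡n (m≤m+n d (suc k)))) ⟫ λ checked →
      advance-stage d _ checked (checked-next checked (L+d≢R d+1+k≡n)) ⟫
      loop replays k (suc d) _ (trans (sym (+-suc d k)) d+1+k≡n)

  -- Correctness and prefix-freeness

  readCell-rawBits : ∀ p i → readCell (L.map (bitSym {nΓT}) p) i ≡ encSym (rawTape p i)
  readCell-rawBits [] i = refl
  readCell-rawBits (false ∷ p) zero = refl
  readCell-rawBits (true ∷ p) zero = refl
  readCell-rawBits (b ∷ p) (suc i) = readCell-rawBits p i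

  represents-initial : ∀ p y → Represents (initConfig machine (p ∷ y ∷ [])) (initial p y)
  represents-initial p y = refl , (λ j → lookup-replicate j 0) , tps
    where
    tps : ∀ j i → readCell (lookup (tabulate (λ i → loadInput (p ∷ y ∷ []) (F.toℕ i))) j) i ≡ encSym (initialTapes p y j i)
    tps j i rewrite lookup∘tabulate (λ i → loadInput {nΓT} (p ∷ y ∷ []) (F.toℕ i)) j = go j
      where
      go : ∀ j → readCell (loadInput {nΓT} (p ∷ y ∷ []) (F.toℕ j)) i ≡ encSym (initialTapes p y j i)
      go fz = readCell-rawBits p i
      go (fs fz) = readCell-rawBits y i
      go (fs (fs fz)) = refl
      go (fs (fs (fs fz))) = refl
      go (fs (fs (fs (fs fz)))) = refl
      go (fs (fs (fs (fs (fs fz))))) = refl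
      go (fs (fs (fs (fs (fs (fs fz)))))) = refl
      go (fs (fs (fs (fs (fs (fs (fs j))))))) = refl

  bitsOf-rawTape : ∀ (l : List (Fin (3 + nΓT))) H → (∀ i → readCell l i ≡ encSym (rawTape H i)) → bitsOf l ≡ H
  bitsOf-rawTape [] [] e = refl
  bitsOf-rawTape [] (b ∷ H) e with e 0
  bitsOf-rawTape [] (false ∷ H) e | ()
  bitsOf-rawTape [] (true ∷ H) e | ()
  bitsOf-rawTape (x ∷ l) [] e rewrite e 0 = refl
  bitsOf-rawTape (x ∷ l) (false ∷ H) e rewrite e 0 = cong (false ∷_) (bitsOf-rawTape l H (λ i → e (suc i)))
  bitsOf-rawTape (x ∷ l) (true ∷ H) e rewrite e 0 = cong (true ∷_) (bitsOf-rawTape l H (λ i → e (suc i)))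

  outputs-of-run : ∀ p y H c → st (run (initial p y) c) ≡ ctl accept → RawHolds (tp (run (initial p y) c) tO) H → Outputs₂ machine p y H
  outputs-of-run p y H c est rr = c , hlt , outp
    where
    C = runFor machine (initConfig machine (p ∷ y ∷ [])) c
    rl = represents-run (initConfig machine (p ∷ y ∷ [])) (initial p y) c (represents-initial p y)
    hlt : Halted machine C
    hlt = trans (cong (isHalting machine) (proj₁ rl)) (trans (isHalting-encSt _) (cong isAccept est))
    outp : output machine C ≡ H
    outp = trans (cong bitsOf (head≡lookup-zero (Config.tapes C))) (bitsOf-rawTape _ H (λ i → trans (proj₂ (proj₂ rl) fz i) (cong encSym (rr i))))

  machine-correct : ∀ σ L n rest (out : ℕ → List Bool) → σ ≡ encℕ L ++ encℕ (L + n) ++ rest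
    → (∀ d → d ≤ n → Outputs₂ A σ (encℕ (L + d)) (out (L + d)))
    → Outputs₂ machine [] σ (encℕ (suc n) ++ outputsUpTo out L (suc n))
  machine-correct σ L n rest out eσ replays = outputs-of-run [] σ _ (Reaches.steps reached) (proj₁ (Reaches.reached reached)) (proj₂ (Reaches.reached reached))
    where
    reached = Iteration.prologue σ L n out rest eσ ⟫ Iteration.loop σ L n out replays n 0 _ refl

  diverge-run : ∀ N S → st S ≡ ctl diverge → st (run S N) ≡ ctl diverge
  diverge-run zero S e = e
  diverge-run (suc N) (snapshot .(ctl diverge) tp hd) refl = diverge-run N (next (snapshot (ctl diverge) tp hd)) refl

  program-nonempty-never-accepts : ∀ b p y N → isAccept (st (run (initial (b ∷ p) y) N)) ≡ false
  program-nonempty-never-accepts b p y zero = refl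
  program-nonempty-never-accepts false p y (suc N) = cong isAccept (diverge-run N (next (initial (false ∷ p) y)) refl)
  program-nonempty-never-accepts true p y (suc N) = cong isAccept (diverge-run N (next (initial (true ∷ p) y)) refl)

  halts⇒program-empty : ∀ p y → HaltsOn₂ machine p y → p ≡ []
  halts⇒program-empty [] y h = refl
  halts⇒program-empty (b ∷ p) y (x , N , hlt , _) = ⊥-elim (f≢t (trans (sym (program-nonempty-never-accepts b p y N)) hlt'))
    where
    rl = represents-run (initConfig machine ((b ∷ p) ∷ y ∷ [])) (initial (b ∷ p) y) N (represents-initial (b ∷ p) y)
    f≢t : false ≡ true → ⊥
    f≢t ()
    hlt' : isAccept (st (run (initial (b ∷ p) y) N)) ≡ true
    hlt' = trans (sym (trans (cong (isHalting machine) (proj₁ rl)) (isHalting-encSt _))) hlt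

  machine-prefix : PrefixMachine machine
  machine-prefix y p q h1 h2 with halts⇒program-empty p y h1
  ... | refl = halts⇒program-empty q y h2

machine-replays-history : ∀ M A {cint} (S : BlockStructure M cint) → ReplayEngine M S A →
  ∀ x t b L R → 1 ≤ b → BlockStructure.BlockRespecting S x t b → BlockInterval t b L R →
  Outputs₂ (HistoryMachine.machine A) [] (encSummary M S x t b L R) (encHistory M (history M x L R))
machine-replays-history M A S replay x t b L R b≥1 respecting interval =
  subst (Outputs₂ machine [] σ) (sym (encHistory-history M x L R))
    (machine-correct σ L (R ∸ L) rest config-bits σ-starts-with-L-R replays)
  where
  open HistoryMachine A using (machine; machine-correct)
  σ = encSummary M S x t b L R
  config-bits : ℕ → List Bool
  config-bits τ = encConfig M (configAt M x τ)
  L+[R∸L]≡R : L + (R ∸ L) ≡ R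
  L+[R∸L]≡R = m+[n∸m]≡n (BlockInterval-≤ t b L R b≥1 interval)
  rest : List Bool
  rest = encFin (Config.state (configAt M x L)) ++ encFin (Config.state (configAt M x R))
    ++ encList encℕ (V.toList (Config.heads (configAt M x L)))
    ++ encList encℕ (V.toList (Config.heads (configAt M x R)))
    ++ encList (encCell M) (BlockStructure.window S x t b L R)
  σ-starts-with-L-R : σ ≡ encℕ L ++ encℕ (L + (R ∸ L)) ++ rest
  σ-starts-with-L-R = cong (λ r → encℕ L ++ encℕ r ++ rest) (sym L+[R∸L]≡R)
  replays : ∀ d → d ≤ R ∸ L → Outputs₂ A σ (encℕ (L + d)) (config-bits (L + d))
  replays d d≤R∸L = replay x t b L R (L + d) b≥1 respecting interval (m≤m+n L d)
    (subst (L + d ≤_) L+[R∸L]≡R (+-monoʳ-≤ L d≤R∸L))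

corollary4p2 : (M U A : TM) (cint : ℕ) → 1 ≤ cint → (S : BlockStructure M cint) →
    UniversalPrefix U → ReplayEngine M S A →
    ∃[ c' ] (1 ≤ c' ×
      (∀ (x : List Bool) (t b L R : ℕ) → 1 ≤ b →
        BlockStructure.BlockRespecting S x t b → BlockInterval t b L R →
        K≤ U (encHistory M (history M x L R)) (encSummary M S x t b L R) c'))
corollary4p2 M U A cint _ S (_ , simulates) replay = suc (length c) , s≤s z≤n , K-bound
  where
  open HistoryMachine A using (machine; machine-prefix)
  c = proj₁ (simulates machine machine-prefix)
  K-bound : ∀ x t b L R → 1 ≤ b → BlockStructure.BlockRespecting S x t b → BlockInterval t b L R →
            K≤ U (encHistory M (history M x L R)) (encSummary M S x t b L R) (suc (length c))
  K-bound x t b L R b≥1 respecting interval =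
    c ++ [] ,
    subst (λ p → length p ≤ suc (length c)) (sym (++-identityʳ c)) (n≤1+n (length c)) ,
    Equivalence.to (proj₂ (simulates machine machine-prefix) [] _ _)
      (machine-replays-history M A S replay x t b L R b≥1 respecting interval)
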